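{- For $n,k\geq 1$ there is a bijection $\zeta:\mathcal{Q}_n(k)\to\mathcal{F}_n(k)$ such that $\mathrm{ap}(\pi)=\mathrm{lleaf}(\zeta(\pi))-\mathrm{si}(\zeta(\pi))$ for every $\pi\in\mathcal{Q}_n(k)$. Moreover, $\pi\in\overline{\mathcal{Q}}_n(k)$ if and only if $\zeta(\pi)\in\overline{\mathcal{F}}_n(k)$.
   Context: A $k$-Stirling permutation of order $n$ is a word $\pi=\pi_1\cdots\pi_{kn}$ in which each of $1,\dots,n$ appears exactly $k$ times, such that $\pi_i=\pi_l$ with $i<l$ implies $\pi_j\geq\pi_i$ for all $i<j<l$; $\mathcal{Q}_n(k)$ is the set of them. $\overline{\mathcal{Q}}_n(k)=\{\pi\in\mathcal{Q}_n(k):\pi_1=\pi_2=\cdots=\pi_k\}$. An index $i$ is a longest ascent-plateau of $\pi$ if $\pi_i<\pi_{i+1}=\cdots=\pi_{i+k}$; $\mathrm{ap}(\pi)$ is the number of them. Trees: all trees are ordered (plane) rooted trees; the level of a node is its distance from the root (root at level 0); a leaf is a node with no children. An even $k$-ary tree is an ordered tree in which every node on an even level has exactly $k$ children. A pruned even $k$-ary tree is obtained from an even $k$-ary tree by deleting, for every even-level node all of whose children are leaves, all those children. An increasing pruned even $k$-ary tree on a set $M$ of positive integers is a pruned even $k$-ary tree whose nodes on even levels are labeled bijectively by $M$ (odd-level nodes unlabeled) such that labels increase along every path from the root downward and, for each node, the labels of its children increase from left to right. An increasing pruned even $k$-ary forest on $[n]$ is a sequence $(T_1,\dots,T_m)$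 of such trees whose label sets partition $[n]$ and whose root labels increase from left to right; $\mathcal{F}_n(k)$ is the set of them. A labeled leaf is a leaf on an even level; $\mathrm{lleaf}(F)$ is the total number of labeled leaves of $F$; a singleton is a one-node tree and $\mathrm{si}(F)$ is the number of singletons of $F$. $\overline{\mathcal{F}}_n(k)$ is the set of $F\in\mathcal{F}_n(k)$ such that either the rightmost tree of $F$ is a singleton or the first $k-1$ children (from the left) of the root of the rightmost tree of $F$ are leaves. -}

module Defs where

open import Data.Nat using (ℕ; zero; suc; _+_; _∸_; _≤_; _<_; _<ᵇ_; _≡ᵇ_)
open import Data.Nat.Properties using (_≟_)
open import Data.Bool using (Bool; true; false; _∧_; if_then_else_)
open import Data.List using (List; []; _∷_; length; lookup; filter; take; upTo; map; _++_)
open import Data.List.Membership.Propositional using (_∈_)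
open import Data.List.Relation.Binary.Permutation.Propositional using (_↭_)
open import Data.Fin as Fin using (Fin; toℕ)
open import Data.Product using (Σ; _×_; ∃; proj₁)
open import Data.Unit using (⊤)
open import Data.Empty using (⊥)
open import Data.Sum using (_⊎_)
open import Relation.Binary.PropositionalEquality using (_≡_)

IsStirling : ℕ → ℕ → List ℕ → Set
IsStirling n k w =
  ((m : ℕ) → 1 ≤ m → m ≤ n → length (filter (_≟ m) w) ≡ k) ×
  ((x : ℕ) → x ∈ w → (1 ≤ x × x ≤ n)) ×
  ((i j l : Fin (length w)) → i Fin.< j → j Fin.< l →
     lookup w i ≡ lookup w l → lookup w i ≤ lookup w j)

Q : ℕ → ℕ → Set
Q n k = Σ (List ℕ) (IsStirling n k)

InQbar : ℕ → List ℕ → Set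
InQbar k w = (i j : Fin (length w)) → toℕ i < k → toℕ j < k → lookup w i ≡ lookup w j

allEqᵇ : ℕ → List ℕ → Bool
allEqᵇ b [] = true
allEqᵇ b (x ∷ xs) = (b ≡ᵇ x) ∧ allEqᵇ b xs

isAPᵇ : ℕ → List ℕ → Bool
isAPᵇ k [] = false
isAPᵇ k (a ∷ []) = false
isAPᵇ k (a ∷ b ∷ rest) =
  (a <ᵇ b) ∧ (allEqᵇ b (take k (b ∷ rest)) ∧ (length (take k (b ∷ rest)) ≡ᵇ k))

ap : ℕ → List ℕ → ℕ
ap k [] = 0
ap k (a ∷ w) = (if isAPᵇ k (a ∷ w) then 1 else 0) + ap k w

-- Ordered trees whose even-level nodes carry labels (ℕ) and whose
-- odd-level nodes are unlabeled.

mutual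
  data ETree : Set where
    enode : ℕ → List OTree → ETree
  data OTree : Set where
    onode : List ETree → OTree

label : ETree → ℕ
label (enode l _) = l

isLeafOᵇ : OTree → Bool
isLeafOᵇ (onode []) = true
isLeafOᵇ (onode (_ ∷ _)) = false

allLeavesᵇ : List OTree → Bool
allLeavesᵇ [] = true
allLeavesᵇ (c ∷ cs) = isLeafOᵇ c ∧ allLeavesᵇ cs

mutual
  EvenKary : ℕ → ETree → Set
  EvenKary k (enode _ cs) = (length cs ≡ k) × EvenKaryOs k cs

  EvenKaryOs : ℕ → List OTree → Set
  EvenKaryOs k [] = ⊤
  EvenKaryOs k (onode ts ∷ cs) = EvenKaryEs k ts × EvenKaryOs k cs

  EvenKaryEs : ℕ → List ETree → Set
  EvenKaryEs k [] = ⊤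
  EvenKaryEs k (t ∷ ts) = EvenKary k t × EvenKaryEs k ts

mutual
  prune : ETree → ETree
  prune (enode l cs) = if allLeavesᵇ cs then enode l [] else enode l (pruneOs cs)

  pruneOs : List OTree → List OTree
  pruneOs [] = []
  pruneOs (onode ts ∷ cs) = onode (pruneEs ts) ∷ pruneOs cs

  pruneEs : List ETree → List ETree
  pruneEs [] = []
  pruneEs (t ∷ ts) = prune t ∷ pruneEs ts

IsPrunedEvenKary : ℕ → ETree → Set
IsPrunedEvenKary k T = ∃ λ T' → EvenKary k T' × prune T' ≡ T

mutual
  labels : ETree → List ℕ
  labels (enode l cs) = l ∷ labelsOs cs

  labelsOs : List OTree → List ℕ
  labelsOs [] = []
  labelsOs (onode ts ∷ cs) = labelsEs ts ++ labelsOs cs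

  labelsEs : List ETree → List ℕ
  labelsEs [] = []
  labelsEs (t ∷ ts) = labels t ++ labelsEs ts

data Increasing : List ℕ → Set where
  inc[]  : Increasing []
  inc[x] : ∀ {x} → Increasing (x ∷ [])
  inc∷   : ∀ {x y xs} → x < y → Increasing (y ∷ xs) → Increasing (x ∷ y ∷ xs)

AllAbove : ℕ → List ETree → Set
AllAbove l [] = ⊤
AllAbove l (t ∷ ts) = (l < label t) × AllAbove l ts

-- increasing labelling: labels increase along every downward path
-- (each labeled node is smaller than the labeled nodes directly below it,
-- i.e. its grandchildren), and the (labeled) children of every node
-- increase from left to right (odd-level nodes' children; the children of
-- even-level nodes are unlabeled, so there is no condition there)
mutual
  IncE : ETree → Set
  IncE (enode l cs) = IncOs l cs

  IncOs : ℕ → List OTree → Set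
  IncOs l [] = ⊤
  IncOs l (onode ts ∷ cs) =
    AllAbove l ts × Increasing (map label ts) × IncEs ts × IncOs l cs

  IncEs : List ETree → Set
  IncEs [] = ⊤
  IncEs (t ∷ ts) = IncE t × IncEs ts

IsIncPrunedTree : ℕ → ETree → Set
IsIncPrunedTree k T = IsPrunedEvenKary k T × IncE T

Forest : Set
Forest = List ETree

AllTrees : (ETree → Set) → Forest → Set
AllTrees P [] = ⊤
AllTrees P (t ∷ ts) = P t × AllTrees P ts

forestLabels : Forest → List ℕ
forestLabels [] = []
forestLabels (t ∷ ts) = labels t ++ forestLabels ts

range : ℕ → List ℕ
range n = map suc (upTo n)

IsIncForest : ℕ → ℕ → Forest → Set
IsIncForest n k F =
  AllTrees (IsIncPrunedTree k) F ×
  (forestLabels F ↭ range n) ×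
  Increasing (map label F)

𝓕 : ℕ → ℕ → Set
𝓕 n k = Σ Forest (IsIncForest n k)

mutual
  lleafT : ETree → ℕ
  lleafT (enode l []) = 1
  lleafT (enode l (c ∷ cs)) = lleafOs (c ∷ cs)

  lleafOs : List OTree → ℕ
  lleafOs [] = 0
  lleafOs (onode ts ∷ cs) = lleafEs ts + lleafOs cs

  lleafEs : List ETree → ℕ
  lleafEs [] = 0
  lleafEs (t ∷ ts) = lleafT t + lleafEs ts

lleaf : Forest → ℕ
lleaf = lleafEs

isSingletonᵇ : ETree → Bool
isSingletonᵇ (enode _ []) = true
isSingletonᵇ (enode _ (_ ∷ _)) = false

si : Forest → ℕ
si [] = 0
si (t ∷ ts) = (if isSingletonᵇ t then 1 else 0) + si ts

FirstLeaves : ℕ → List OTree → Set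
FirstLeaves zero cs = ⊤
FirstLeaves (suc m) [] = ⊥
FirstLeaves (suc m) (c ∷ cs) = (c ≡ onode []) × FirstLeaves m cs

RightmostOK : ℕ → ETree → Set
RightmostOK k (enode l cs) = (cs ≡ []) ⊎ FirstLeaves (k ∸ 1) cs

InFbar : ℕ → Forest → Set
InFbar k [] = ⊥
InFbar k (t ∷ []) = RightmostOK k t
InFbar k (t ∷ u ∷ ts) = InFbar k (u ∷ ts)

-- The k copies of the largest letter n form one
-- consecutive block of π, and removing it leaves a Stirling permutation π′ of order n − 1 and
-- a gap of π′. The gaps of π′ are matched with the places where a leaf n can be added to
-- ζ(π′): the front gap makes n a new rightmost singleton tree, and the gap just before the
-- (j+1)-st copy of a letter v makes n the last grandchild of v below its j-th child; for the
-- first letter of π′ the copies are shifted by one, its last child taking the end gap.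
-- Deleting the node n from a forest recovers the gap, which yields the inverse.
-- Along the induction, the values of the longest ascent-plateaux of π are exactly the labels
-- of the leaves of the non-singleton trees: inserting the block creates the value n and
-- destroys the value of the letter after the gap, just as n becomes a leaf and the node it
-- hangs from stops being one. This gives ap = lleaf − si. Moreover the first letter of π is
-- the root of the rightmost tree, and π starts with k equal letters exactly when that tree is
-- a singleton or its first k − 1 root children are leaves.

module Submission where

open import Defs
open import Data.Bool using (Bool; true; false; _∧_; if_then_else_; T)
open import Data.Bool.Properties using (∧-zeroʳ)
open import Data.Empty using (⊥; ⊥-elim)
open import Data.Fin as Fin using (Fin; toℕ)
open import Data.List hiding (ap)
open import Data.List.Membership.Propositional using (_∈_; _∉_)
open import Data.List.Membership.Propositional.Properties using (∈-++⁺ˡ; ∈-++⁺ʳ; ∈-++⁻)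
open import Data.List.Properties
  using (length-++; ++-assoc; ++-identityʳ; length-replicate; take-all; take++drop≡id; length-++-≤ˡ; map-++; filter-accept; filter-reject; upTo-∷ʳ; ∷-injective)
open import Data.List.Relation.Binary.Permutation.Propositional using (_↭_)
import Data.List.Relation.Binary.Permutation.Propositional as Perm
import Data.List.Relation.Binary.Permutation.Propositional.Properties as PermP
open PermP using (∈-resp-↭)
open import Data.List.Relation.Unary.Any using (here; there; any?)
open import Data.Maybe using (Maybe; just; nothing)
open import Data.Nat
open import Data.Nat.Properties
open import Algebra.Properties.CommutativeSemigroup +-commutativeSemigroup using (x∙yz≈y∙xz)
open import Data.Product hiding (map)
open import Data.Sum hiding (map)
open import Data.Unit using (⊤; tt)
open import Function.Bundles using (_⇔_; mk⇔)
open import Relation.Binary.PropositionalEquality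
open import Relation.Nullary

-- Multiplicities and repetition-free lists

mult : ℕ → List ℕ → ℕ
mult x L = length (filter (_≟ x) L)

mult-∷-≡ : ∀ x L → mult x (x ∷ L) ≡ suc (mult x L)
mult-∷-≡ x L rewrite filter-accept (_≟ x) {x} {L} refl = refl

mult-∷-≢ : ∀ {x y} L → y ≢ x → mult x (y ∷ L) ≡ mult x L
mult-∷-≢ {x} {y} L ne rewrite filter-reject (_≟ x) {y} {L} ne = refl

mult-∷≤ : ∀ x y L → mult x L ≤ mult x (y ∷ L)
mult-∷≤ x y L with y ≟ x
... | yes refl rewrite mult-∷-≡ y L = n≤1+n _
... | no ne rewrite mult-∷-≢ L ne = ≤-refl

mult-++ : ∀ x A B → mult x (A ++ B) ≡ mult x A + mult x B
mult-++ x [] B = refl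
mult-++ x (y ∷ A) B with y ≟ x
... | yes refl rewrite mult-∷-≡ y (A ++ B) | mult-∷-≡ y A = cong suc (mult-++ x A B)
... | no ne rewrite mult-∷-≢ (A ++ B) ne | mult-∷-≢ A ne = mult-++ x A B

∈⇒mult≥1 : ∀ {x L} → x ∈ L → 1 ≤ mult x L
∈⇒mult≥1 {x} {y ∷ L} (here refl) rewrite mult-∷-≡ x L = s≤s z≤n
∈⇒mult≥1 {x} {y ∷ L} (there m) with y ≟ x
... | yes refl rewrite mult-∷-≡ y L = s≤s z≤n
... | no ne rewrite mult-∷-≢ L ne = ∈⇒mult≥1 m

mult≥1⇒∈ : ∀ {x} L → 1 ≤ mult x L → x ∈ L
mult≥1⇒∈ {x} (y ∷ L) p with y ≟ x
... | yes refl = here refl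
... | no ne rewrite mult-∷-≢ L ne = there (mult≥1⇒∈ L p)

mult≡0⇒∉ : ∀ {x L} → mult x L ≡ 0 → x ∉ L
mult≡0⇒∉ e m with ∈⇒mult≥1 m
... | p rewrite e = case p
  where case : 1 ≤ 0 → ⊥
        case ()

∉⇒mult≡0 : ∀ {x} L → x ∉ L → mult x L ≡ 0
∉⇒mult≡0 [] _ = refl
∉⇒mult≡0 {x} (y ∷ L) nm with y ≟ x
... | yes refl = ⊥-elim (nm (here refl))
... | no ne rewrite mult-∷-≢ L ne = ∉⇒mult≡0 L (λ m → nm (there m))

mult-replicate : ∀ x i → mult x (replicate i x) ≡ i
mult-replicate x zero = refl
mult-replicate x (suc i) rewrite mult-∷-≡ x (replicate i x) = cong suc (mult-replicate x i)

mult-replicate-≢ : ∀ {x y} i → y ≢ x → mult x (replicate i y) ≡ 0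
mult-replicate-≢ zero ne = refl
mult-replicate-≢ {x} {y} (suc i) ne rewrite mult-∷-≢ {x} {y} (replicate i y) ne = mult-replicate-≢ i ne

mult≤length : ∀ x L → mult x L ≤ length L
mult≤length x [] = z≤n
mult≤length x (y ∷ L) with y ≟ x
... | yes refl rewrite mult-∷-≡ y L = s≤s (mult≤length x L)
... | no ne rewrite mult-∷-≢ L ne = m≤n⇒m≤1+n (mult≤length x L)

∈-replicate⇒≡ : ∀ {x y : ℕ} i → x ∈ replicate i y → x ≡ y
∈-replicate⇒≡ (suc i) (here p) = p
∈-replicate⇒≡ (suc i) (there m) = ∈-replicate⇒≡ i m

Distinct : List ℕ → Set
Distinct L = ∀ x → mult x L ≤ 1

Distinct-tail : ∀ {y L} → Distinct (y ∷ L) → Distinct L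
Distinct-tail {y} {L} u x with y ≟ x | u x
... | yes refl | p rewrite mult-∷-≡ y L = ≤-trans (n≤1+n _) p
... | no ne | p rewrite mult-∷-≢ L ne = p

Distinct-head∉ : ∀ {y L} → Distinct (y ∷ L) → y ∉ L
Distinct-head∉ {y} {L} u m with u y
... | p rewrite mult-∷-≡ y L = contra (≤-trans (s≤s (∈⇒mult≥1 m)) p)
  where contra : 2 ≤ 1 → ⊥
        contra (s≤s ())

Distinct-remove : ∀ {x : ℕ} P S → Distinct (P ++ x ∷ S) → Distinct (P ++ S)
Distinct-remove {x} P S u y with u y
... | p rewrite mult-++ y P (x ∷ S) | mult-++ y P S = ≤-trans (+-monoʳ-≤ (mult y P) (lem S)) p
  where lem : ∀ S → mult y S ≤ mult y (x ∷ S)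
        lem S with x ≟ y
        ... | yes refl rewrite mult-∷-≡ x S = n≤1+n _
        ... | no ne rewrite mult-∷-≢ S ne = ≤-refl

∈⇒split : ∀ {x : ℕ} {L} → x ∈ L → Σ (List ℕ) λ P → Σ (List ℕ) λ S → L ≡ P ++ x ∷ S
∈⇒split {L = y ∷ L} (here refl) = [] , L , refl
∈⇒split {L = y ∷ L} (there m) with ∈⇒split m
... | P , S , e = y ∷ P , S , cong (y ∷_) e

∈-remove : ∀ {x y : ℕ} P S → x ∈ P ++ y ∷ S → x ≢ y → x ∈ P ++ S
∈-remove [] S (here p) ne = ⊥-elim (ne p)
∈-remove [] S (there m) ne = m
∈-remove (z ∷ P) S (here p) ne = here p
∈-remove (z ∷ P) S (there m) ne = there (∈-remove P S m ne)

∈-insert : ∀ {x y : ℕ} P S → x ∈ P ++ S → x ∈ P ++ y ∷ S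
∈-insert [] S m = there m
∈-insert (z ∷ P) S (here p) = here p
∈-insert (z ∷ P) S (there m) = there (∈-insert P S m)

length-insert : ∀ {x : ℕ} P S → length (P ++ x ∷ S) ≡ suc (length (P ++ S))
length-insert [] S = refl
length-insert (y ∷ P) S = cong suc (length-insert P S)

Distinct-same-elements⇒length≡ : ∀ L₁ L₂ → Distinct L₁ → Distinct L₂ → (∀ x → x ∈ L₁ → x ∈ L₂) → (∀ x → x ∈ L₂ → x ∈ L₁) →
           length L₁ ≡ length L₂
Distinct-same-elements⇒length≡ [] [] u₁ u₂ f g = refl
Distinct-same-elements⇒length≡ [] (y ∷ L₂) u₁ u₂ f g with g y (here refl)
... | ()
Distinct-same-elements⇒length≡ (x ∷ L₁) L₂ u₁ u₂ f g with ∈⇒split (f x (here refl))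
... | P , S , refl = trans (cong suc (Distinct-same-elements⇒length≡ L₁ (P ++ S) (Distinct-tail {x} {L₁} u₁) (Distinct-remove P S u₂) f' g'))
                       (sym (length-insert P S))
  where
    x∉L₁ = Distinct-head∉ u₁
    x∉PS : x ∉ P ++ S
    x∉PS m = mult≡0⇒∉ {x} {P ++ S} (lem) m
      where lem : mult x (P ++ S) ≡ 0
            lem with u₂ x
            ... | p rewrite mult-++ x P (x ∷ S) | mult-∷-≡ x S | mult-++ x P S
                  | +-suc (mult x P) (mult x S) = n≤0⇒n≡0 (s≤s⁻¹ p)
    f' : ∀ z → z ∈ L₁ → z ∈ P ++ S
    f' z m = ∈-remove P S (f z (there m)) (λ e → x∉L₁ (subst (_∈ L₁) e m))
    g' : ∀ z → z ∈ P ++ S → z ∈ L₁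
    g' z m with g z (∈-insert P S m)
    ... | here refl = ⊥-elim (x∉PS m)
    ... | there m' = m'

¬T⇒false : ∀ {b} → (T b → ⊥) → b ≡ false
¬T⇒false {false} _ = refl
¬T⇒false {true} f = ⊥-elim (f tt)

T⇒true : ∀ {b} → T b → b ≡ true
T⇒true {true} _ = refl

mult-↭ : ∀ x {L L'} → L ↭ L' → mult x L ≡ mult x L'
mult-↭ x p = PermP.↭-length (PermP.filter-↭ (_≟ x) p)

Distinct-↭ : ∀ {L L'} → L ↭ L' → Distinct L' → Distinct L
Distinct-↭ p u x = subst (_≤ 1) (sym (mult-↭ x p)) (u x)

Distinct-++ˡ : ∀ A B → Distinct (A ++ B) → Distinct A
Distinct-++ˡ A B u x = ≤-trans (m≤m+n (mult x A) (mult x B)) (subst (_≤ 1) (mult-++ x A B) (u x))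

Distinct-++ʳ : ∀ A B → Distinct (A ++ B) → Distinct B
Distinct-++ʳ A B u x = ≤-trans (m≤n+m (mult x B) (mult x A)) (subst (_≤ 1) (mult-++ x A B) (u x))

Distinct-++-disjoint : ∀ {x} A B → Distinct (A ++ B) → x ∈ A → x ∉ B
Distinct-++-disjoint {x} A B u ma mb = <-irrefl refl (≤-trans (+-mono-≤ (∈⇒mult≥1 ma) (∈⇒mult≥1 mb)) (subst (_≤ 1) (mult-++ x A B) (u x)))

Distinct-mono : ∀ {L L'} → (∀ x → mult x L ≤ mult x L') → Distinct L' → Distinct L
Distinct-mono h u x = ≤-trans (h x) (u x)

range-suc : ∀ m → range (suc m) ≡ range m ++ suc m ∷ []
range-suc m = trans (cong (map suc) (sym (upTo-∷ʳ m))) (map-++ suc (upTo m) (m ∷ []))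

∈-range⁻ : ∀ {x} m → x ∈ range m → 1 ≤ x × x ≤ m
∈-range⁻ zero ()
∈-range⁻ {x} (suc m) mm with ∈-++⁻ (range m) (subst (x ∈_) (range-suc m) mm)
... | inj₁ m1 = let (a , b) = ∈-range⁻ m m1 in a , m≤n⇒m≤1+n b
... | inj₂ (here refl) = s≤s z≤n , ≤-refl

∈-range⁺ : ∀ {x} m → 1 ≤ x → x ≤ m → x ∈ range m
∈-range⁺ {x} (suc m) a b with x ≟ suc m
... | yes refl = subst (x ∈_) (sym (range-suc m)) (∈-++⁺ʳ (range m) (here refl))
... | no ne = subst (x ∈_) (sym (range-suc m)) (∈-++⁺ˡ (∈-range⁺ m a (≤-pred (≤∧≢⇒< b ne))))
∈-range⁺ {zero} zero () b
∈-range⁺ {suc x} zero a ()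

Distinct-range : ∀ m → Distinct (range m)
Distinct-range zero x = z≤n
Distinct-range (suc m) x = subst (_≤ 1) (sym (trans (cong (mult x) (range-suc m)) (mult-++ x (range m) (suc m ∷ [])))) (aux (suc m ≟ x))
  where
    aux : Dec (suc m ≡ x) → mult x (range m) + mult x (suc m ∷ []) ≤ 1
    aux (no ne) = subst (λ z → mult x (range m) + z ≤ 1) (sym (mult-∷-≢ [] ne)) (subst (_≤ 1) (sym (+-identityʳ _)) (Distinct-range m x))
    aux (yes refl) = subst (λ z → z + mult x (suc m ∷ []) ≤ 1) (sym (∉⇒mult≡0 (range m) (λ mm → <-irrefl refl (s≤s (proj₂ (∈-range⁻ m mm))))))
                       (subst (_≤ 1) (sym (mult-∷-≡ (suc m) [])) ≤-refl)

range-suc-↭ : ∀ m → suc m ∷ range m ↭ range (suc m)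
range-suc-↭ m = subst (suc m ∷ range m ↭_) (sym (range-suc m))
              (Perm.↭-trans (Perm.prep (suc m) (Perm.↭-sym (Perm.↭-reflexive (++-identityʳ (range m)))))
                (Perm.↭-sym (PermP.shift (suc m) (range m) [])))

-- Words and Stirling permutations

-- Both return the junk value 0 outside the list.
hd : List ℕ → ℕ
hd [] = 0
hd (x ∷ _) = x

nth : List ℕ → ℕ → ℕ
nth [] _ = 0
nth (x ∷ L) zero = x
nth (x ∷ L) (suc i) = nth L i

-- Where the node n is added: a new rightmost singleton tree, or (under v j) as the last
-- grandchild of v through its j-th child (counted from 0).
data Site : Set where
  newTree : Site
  under : ℕ → ℕ → Site

ValidSite : ℕ → ℕ → Site → Set
ValidSite k m newTree = ⊤
ValidSite k m (under v j) = (1 ≤ v × v ≤ m) × j < k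

-- The order condition of IsStirling in recursive form: every letter lying before an
-- occurrence of x is at least x.
BoundsSpan : ℕ → List ℕ → Set
BoundsSpan x [] = ⊤
BoundsSpan x (y ∷ w) = (x ∈ w → x ≤ y) × BoundsSpan x w

StirlingOrder : List ℕ → Set
StirlingOrder [] = ⊤
StirlingOrder (x ∷ w) = BoundsSpan x w × StirlingOrder w

BoundsSpan-remove : ∀ {x} y A C → BoundsSpan x (A ++ y ∷ C) → BoundsSpan x (A ++ C)
BoundsSpan-remove y [] C (_ , ab) = ab
BoundsSpan-remove y (z ∷ A) C (f , ab) = (λ m → f (∈-insert A C m)) , BoundsSpan-remove y A C ab

StirlingOrder-remove : ∀ y A C → StirlingOrder (A ++ y ∷ C) → StirlingOrder (A ++ C)
StirlingOrder-remove y [] C (_ , s) = s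
StirlingOrder-remove y (x ∷ A) C (ab , s) = BoundsSpan-remove y A C ab , StirlingOrder-remove y A C s

StirlingOrder-remove-replicate : ∀ n i A C → StirlingOrder (A ++ replicate i n ++ C) → StirlingOrder (A ++ C)
StirlingOrder-remove-replicate n zero A C s = s
StirlingOrder-remove-replicate n (suc i) A C s = StirlingOrder-remove-replicate n i A C (StirlingOrder-remove n A (replicate i n ++ C) s)

∈-remove-replicate : ∀ {x n} i A C → x ≢ n → x ∈ A ++ replicate i n ++ C → x ∈ A ++ C
∈-remove-replicate zero A C ne m = m
∈-remove-replicate {x} {n} (suc i) A C ne m = ∈-remove-replicate i A C ne (∈-remove A (replicate i n ++ C) m ne)

BoundsSpan-replicate : ∀ {x n} i C → x ≤ n → BoundsSpan x C → BoundsSpan x (replicate i n ++ C)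
BoundsSpan-replicate zero C le ab = ab
BoundsSpan-replicate (suc i) C le ab = (λ _ → le) , BoundsSpan-replicate i C le ab

BoundsSpan-insert : ∀ {x n} i A C → x < n → BoundsSpan x (A ++ C) → BoundsSpan x (A ++ replicate i n ++ C)
BoundsSpan-insert i [] C lt ab = BoundsSpan-replicate i C (<⇒≤ lt) ab
BoundsSpan-insert {x} {n} i (z ∷ A) C lt (f , ab) = (λ m → f (∈-remove-replicate i A C (<⇒≢ lt) m)) , BoundsSpan-insert i A C lt ab

BoundsSpan-∉ : ∀ {x} C → x ∉ C → BoundsSpan x C
BoundsSpan-∉ [] _ = tt
BoundsSpan-∉ (y ∷ C) nm = (λ m → ⊥-elim (nm (there m))) , BoundsSpan-∉ C (λ m → nm (there m))

BoundsSpan-own-block : ∀ {n} i C → n ∉ C → BoundsSpan n (replicate i n ++ C)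
BoundsSpan-own-block zero C nm = BoundsSpan-∉ C nm
BoundsSpan-own-block (suc i) C nm = (λ _ → ≤-refl) , BoundsSpan-own-block i C nm

StirlingOrder-insert : ∀ n i A C → (∀ x → x ∈ A ++ C → x < n) → StirlingOrder (A ++ C) → StirlingOrder (A ++ replicate i n ++ C)
StirlingOrder-insert n zero [] C lt s = s
StirlingOrder-insert n (suc i) [] C lt s = BoundsSpan-own-block i C (λ m → <-irrefl refl (lt n m)) , StirlingOrder-insert n i [] C lt s
StirlingOrder-insert n i (x ∷ A) C lt (ab , s) = BoundsSpan-insert i A C (lt x (here refl)) ab , StirlingOrder-insert n i A C (λ y m → lt y (there m)) s

∈⇒first-split : ∀ {x : ℕ} {L} → x ∈ L → Σ (List ℕ) λ P → Σ (List ℕ) λ S → (L ≡ P ++ x ∷ S) × x ∉ P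
∈⇒first-split {x} {y ∷ L} m with y ≟ x
... | yes refl = [] , L , refl , (λ ())
∈⇒first-split {x} {y ∷ L} (here e) | no ne = ⊥-elim (ne (sym e))
∈⇒first-split {x} {y ∷ L} (there m) | no ne with ∈⇒first-split m
... | P , S , e , nP = y ∷ P , S , cong (y ∷_) e , λ { (here e') → ne (sym e') ; (there mm) → nP mm }

StirlingOrder-suffix : ∀ A B → StirlingOrder (A ++ B) → StirlingOrder B
StirlingOrder-suffix [] B s = s
StirlingOrder-suffix (x ∷ A) B (_ , s) = StirlingOrder-suffix A B s

plateau-split : ∀ n R → (∀ x → x ∈ R → x ≤ n) → BoundsSpan n R →
          Σ ℕ λ i → Σ (List ℕ) λ C → (R ≡ replicate i n ++ C) × n ∉ C
plateau-split n [] le ab = 0 , [] , refl , (λ ())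
plateau-split n (y ∷ R) le (f , ab) with y ≟ n
... | yes refl with plateau-split n R (λ x m → le x (there m)) ab
...   | i , C , e , nC = suc i , C , cong (n ∷_) e , nC
plateau-split n (y ∷ R) le (f , ab) | no ne = 0 , y ∷ R , refl , nm
  where nm : n ∉ y ∷ R
        nm (here e) = ne (sym e)
        nm (there m) = ne (≤-antisym (le y (here refl)) (f m))

∈-insert-replicate : ∀ {x n} i A C → x ∈ A ++ C → x ∈ A ++ replicate i n ++ C
∈-insert-replicate zero A C mm = mm
∈-insert-replicate {n = n} (suc i) A C mm = ∈-insert A (replicate i n ++ C) (∈-insert-replicate i A C mm)

eraseAll : ℕ → List ℕ → List ℕ
eraseAll n [] = []
eraseAll n (y ∷ L) with y ≟ n
... | yes _ = eraseAll n L
... | no _ = y ∷ eraseAll n L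

firstIndex : ℕ → List ℕ → ℕ
firstIndex n [] = 0
firstIndex n (y ∷ L) with y ≟ n
... | yes _ = 0
... | no _ = suc (firstIndex n L)

eraseAll-∉ : ∀ n L → n ∉ L → eraseAll n L ≡ L
eraseAll-∉ n [] _ = refl
eraseAll-∉ n (y ∷ L) nm with y ≟ n
... | yes refl = ⊥-elim (nm (here refl))
... | no _ = cong (y ∷_) (eraseAll-∉ n L (λ mm → nm (there mm)))

eraseAll-replicate : ∀ n i L → eraseAll n (replicate i n ++ L) ≡ eraseAll n L
eraseAll-replicate n zero L = refl
eraseAll-replicate n (suc i) L with n ≟ n
... | yes _ = eraseAll-replicate n i L
... | no ne = ⊥-elim (ne refl)

valueIf : Bool → ℕ → List ℕ
valueIf true b = b ∷ []
valueIf false b = []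

length-valueIf : ∀ c b → length (valueIf c b) ≡ (if c then 1 else 0)
length-valueIf true b = refl
length-valueIf false b = refl

∈-valueIf : ∀ {x c b} → x ∈ valueIf c b → T c × x ≡ b
∈-valueIf {c = true} (here e) = tt , e

T∧ : ∀ {a b} → T (a ∧ b) → T a × T b
T∧ {true} {true} _ = tt , tt

∧T : ∀ {a b} → T a → T b → T (a ∧ b)
∧T {true} {true} _ _ = tt

allEqᵇ-∈ : ∀ {b x} T' → T (allEqᵇ b T') → x ∈ T' → x ≡ b
allEqᵇ-∈ {b} (y ∷ T') t (here refl) = sym (≡ᵇ⇒≡ b y (proj₁ (T∧ t)))
allEqᵇ-∈ {b} (y ∷ T') t (there m) = allEqᵇ-∈ T' (proj₂ (T∧ {b ≡ᵇ y} t)) m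

allEqᵇ-mult : ∀ b T' → T (allEqᵇ b T') → mult b T' ≡ length T'
allEqᵇ-mult b [] t = refl
allEqᵇ-mult b (y ∷ T') t with T∧ {b ≡ᵇ y} t
... | e , t' rewrite sym (≡ᵇ⇒≡ b y e) | mult-∷-≡ b T' = cong suc (allEqᵇ-mult b T' t')

allEqᵇ-replicate : ∀ b i → T (allEqᵇ b (replicate i b))
allEqᵇ-replicate b zero = tt
allEqᵇ-replicate b (suc i) = ∧T (≡⇒≡ᵇ b b refl) (allEqᵇ-replicate b i)

mult-take≤ : ∀ x i L → mult x (take i L) ≤ mult x L
mult-take≤ x i L = subst (mult x (take i L) ≤_) (trans (sym (mult-++ x (take i L) (drop i L))) (cong (mult x) (take++drop≡id i L))) (m≤m+n _ _)

take-++ˡ : ∀ i (L X : List ℕ) → i ≤ length L → take i (L ++ X) ≡ take i L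
take-++ˡ zero L X _ = refl
take-++ˡ (suc i) (y ∷ L) X (s≤s le) = cong (y ∷_) (take-++ˡ i L X le)

∈-take-insert : ∀ {y : ℕ} i L Y → length L < i → y ∈ take i (L ++ y ∷ Y)
∈-take-insert (suc i) [] Y _ = here refl
∈-take-insert (suc i) (z ∷ L) Y (s≤s lt) = there (∈-take-insert i L Y lt)

length-take-short : ∀ i (L : List ℕ) → length L < i → length (take i (L ++ [])) ≡ length L
length-take-short i L lt rewrite ++-identityʳ L = cong length (take-all i L (<⇒≤ lt))

valueIf-false : ∀ {c} b → (T c → ⊥) → valueIf c b ≡ []
valueIf-false {true} b f = ⊥-elim (f tt)
valueIf-false {false} b f = refl

valueIf-true : ∀ {c} b → T c → valueIf c b ≡ b ∷ []
valueIf-true {true} b _ = refl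

take-replicate-++ : ∀ K (n : ℕ) C → take K (replicate K n ++ C) ≡ replicate K n
take-replicate-++ zero n C = refl
take-replicate-++ (suc K) n C = cong (n ∷_) (take-replicate-++ K n C)

NotNext : ℕ → List ℕ → Set
NotNext x C = ∀ C' → C ≢ x ∷ C'

drop-++ˡ : ∀ i (L X : List ℕ) → i ≤ length L → drop i (L ++ X) ≡ drop i L ++ X
drop-++ˡ zero L X _ = refl
drop-++ˡ (suc i) (y ∷ L) X (s≤s le) = drop-++ˡ i L X le

length-take-long : ∀ i (L : List ℕ) → i ≤ length L → length (take i L) ≡ i
length-take-long zero L _ = refl
length-take-long (suc i) (y ∷ L) (s≤s le) = cong suc (length-take-long i L le)

occurrence : ℕ → ℕ → List ℕ → ℕ
occurrence v j [] = 0
occurrence v j (x ∷ L) with x ≟ v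
occurrence v zero (x ∷ L) | yes _ = 0
occurrence v (suc j) (x ∷ L) | yes _ = suc (occurrence v j L)
occurrence v j (x ∷ L) | no _ = suc (occurrence v j L)

occurrence-nth : ∀ w p → p < length w → occurrence (nth w p) (mult (nth w p) (take p w)) w ≡ p
occurrence-nth (x ∷ L) zero _ with x ≟ x
... | yes _ = refl
... | no ne = ⊥-elim (ne refl)
occurrence-nth (x ∷ L) (suc p) (s≤s lt) with x ≟ nth L p
... | yes refl rewrite mult-∷-≡ x (take p L) with x ≟ x
...   | yes _ = cong suc (occurrence-nth L p lt)
...   | no ne = ⊥-elim (ne refl)
occurrence-nth (x ∷ L) (suc p) (s≤s lt) | no ne rewrite mult-∷-≢ (take p L) ne with x ≟ nth L p
...   | yes e = ⊥-elim (ne e)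
...   | no _ = cong suc (occurrence-nth L p lt)

occurrence-props : ∀ v j w → j < mult v w → (occurrence v j w < length w) × (nth w (occurrence v j w) ≡ v) × (mult v (take (occurrence v j w) w) ≡ j)
occurrence-props v j (x ∷ L) lt with x ≟ v
occurrence-props v zero (x ∷ L) lt | yes refl = s≤s z≤n , refl , refl
occurrence-props v (suc j) (x ∷ L) lt | yes refl with occurrence-props v j L (≤-pred (subst (suc (suc j) ≤_) (mult-∷-≡ v L) lt))
... | a , b , c = s≤s a , b , trans (mult-∷-≡ v (take (occurrence v j L) L)) (cong suc c)
occurrence-props v j (x ∷ L) lt | no ne with occurrence-props v j L (subst (suc j ≤_) (mult-∷-≢ L ne) lt)
... | a , b , c = s≤s a , b , trans (mult-∷-≢ (take (occurrence v j L) L) ne) c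

nth-∈-drop : ∀ w p → p < length w → nth w p ∈ drop p w
nth-∈-drop (x ∷ L) zero _ = here refl
nth-∈-drop (x ∷ L) (suc p) (s≤s lt) = nth-∈-drop L p lt

mult-take-drop : ∀ x p w → mult x w ≡ mult x (take p w) + mult x (drop p w)
mult-take-drop x p w = trans (cong (mult x) (sym (take++drop≡id p w))) (mult-++ x (take p w) (drop p w))

mult-hd-take : ∀ w p → 0 < length w → 1 ≤ mult (hd w) (take (suc p) w)
mult-hd-take (x ∷ L) p _ rewrite mult-∷-≡ x (take p L) = s≤s z≤n

mult≥1⇒nonempty : ∀ x w → 1 ≤ mult x w → Σ ℕ λ l → length w ≡ suc l
mult≥1⇒nonempty x (y ∷ w) _ = length w , refl

∈⇒index : ∀ {x : ℕ} {L} → x ∈ L → Σ (Fin (length L)) λ i → lookup L i ≡ x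
∈⇒index (here refl) = Fin.zero , refl
∈⇒index (there m) with ∈⇒index m
... | i , e = Fin.suc i , e

lookup-∈ : ∀ (L : List ℕ) (i : Fin (length L)) → lookup L i ∈ L
lookup-∈ (x ∷ L) Fin.zero = here refl
lookup-∈ (x ∷ L) (Fin.suc i) = there (lookup-∈ L i)

BoundsSpan⇒lookup : ∀ x w → BoundsSpan x w → ∀ (j l : Fin (length w)) → toℕ j < toℕ l → lookup w l ≡ x → x ≤ lookup w j
BoundsSpan⇒lookup x (y ∷ w) (f , ab) Fin.zero (Fin.suc l) _ e = f (subst (_∈ w) e (lookup-∈ w l))
BoundsSpan⇒lookup x (y ∷ w) (f , ab) (Fin.suc j) (Fin.suc l) (s≤s lt) e = BoundsSpan⇒lookup x w ab j l lt e

StirlingOrder⇒lookup : ∀ w → StirlingOrder w → (i j l : Fin (length w)) → i Fin.< j → j Fin.< l → lookup w i ≡ lookup w l → lookup w i ≤ lookup w j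
StirlingOrder⇒lookup (x ∷ w) (ab , s) Fin.zero (Fin.suc j) (Fin.suc l) _ (s≤s jl) e = BoundsSpan⇒lookup x w ab j l jl (sym e)
StirlingOrder⇒lookup (x ∷ w) (ab , s) (Fin.suc i) (Fin.suc j) (Fin.suc l) (s≤s ij) (s≤s jl) e = StirlingOrder⇒lookup w s i j l ij jl e

lookup⇒BoundsSpan : ∀ x w → (∀ (j l : Fin (length w)) → toℕ j < toℕ l → lookup w l ≡ x → x ≤ lookup w j) → BoundsSpan x w
lookup⇒BoundsSpan x [] _ = tt
lookup⇒BoundsSpan x (y ∷ w) h = (λ m → let (l , e) = ∈⇒index m in h Fin.zero (Fin.suc l) (s≤s z≤n) e) ,
                        lookup⇒BoundsSpan x w (λ j l lt e → h (Fin.suc j) (Fin.suc l) (s≤s lt) e)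

lookup⇒StirlingOrder : ∀ w → ((i j l : Fin (length w)) → i Fin.< j → j Fin.< l → lookup w i ≡ lookup w l → lookup w i ≤ lookup w j) → StirlingOrder w
lookup⇒StirlingOrder [] _ = tt
lookup⇒StirlingOrder (x ∷ w) h = lookup⇒BoundsSpan x w (λ j l lt e → h Fin.zero (Fin.suc j) (Fin.suc l) (s≤s z≤n) (s≤s lt) (sym e)) ,
                  lookup⇒StirlingOrder w (λ i j l ij jl e → h (Fin.suc i) (Fin.suc j) (Fin.suc l) (s≤s ij) (s≤s jl) e)

allEqᵇ-take⇒lookup : ∀ x K L → T (allEqᵇ x (take K L)) → ∀ (i : Fin (length L)) → toℕ i < K → lookup L i ≡ x
allEqᵇ-take⇒lookup x (suc K) (y ∷ L) t Fin.zero _ = sym (≡ᵇ⇒≡ x y (proj₁ (T∧ {x ≡ᵇ y} t)))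
allEqᵇ-take⇒lookup x (suc K) (y ∷ L) t (Fin.suc i) (s≤s lt) = allEqᵇ-take⇒lookup x K L (proj₂ (T∧ {x ≡ᵇ y} t)) i lt

lookup⇒allEqᵇ-take : ∀ x K L → (∀ (i : Fin (length L)) → toℕ i < K → lookup L i ≡ x) → T (allEqᵇ x (take K L))
lookup⇒allEqᵇ-take x zero L h = tt
lookup⇒allEqᵇ-take x (suc K) [] h = tt
lookup⇒allEqᵇ-take x (suc K) (y ∷ L) h = ∧T (≡⇒≡ᵇ x y (sym (h Fin.zero (s≤s z≤n)))) (lookup⇒allEqᵇ-take x K L (λ i lt → h (Fin.suc i) (s≤s lt)))

drop-⊆ : ∀ {x : ℕ} p w → x ∈ drop p w → x ∈ w
drop-⊆ zero w m = m
drop-⊆ (suc p) (y ∷ w) m = there (drop-⊆ p w m)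

hd-∈ : ∀ w → 0 < length w → hd w ∈ w
hd-∈ (x ∷ w) _ = here refl

++-injective-length : ∀ (A C A' C' : List ℕ) → A ++ C ≡ A' ++ C' → length A ≡ length A' → A ≡ A' × C ≡ C'
++-injective-length [] C [] C' e _ = refl , e
++-injective-length (x ∷ A) C (y ∷ A') C' e l with ∷-injective e
... | refl , e' with ++-injective-length A C A' C' e' (suc-injective l)
... | refl , refl = refl , refl

take-⊆ : ∀ {x : ℕ} p w → x ∈ take p w → x ∈ w
take-⊆ (suc p) (y ∷ w) (here e) = here e
take-⊆ (suc p) (y ∷ w) (there mm) = there (take-⊆ p w mm)

nth-insert : ∀ L (v : ℕ) C' → nth (L ++ v ∷ C') (length L) ≡ v
nth-insert [] v C' = refl
nth-insert (x ∷ L) v C' = nth-insert L v C'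

take-length-++ : ∀ (L X : List ℕ) → take (length L) (L ++ X) ≡ L
take-length-++ [] X = refl
take-length-++ (x ∷ L) X = cong (x ∷_) (take-length-++ L X)

length<length-insert : ∀ (L : List ℕ) v C' → length L < length (L ++ v ∷ C')
length<length-insert [] v C' = s≤s z≤n
length<length-insert (x ∷ L) v C' = s≤s (length<length-insert L v C')

NotNext⇒≢ : ∀ x u C' → NotNext x (u ∷ C') → x ≢ u
NotNext⇒≢ x u C' nh refl = nh C' refl

≢⇒NotNext : ∀ x u C' → x ≢ u → NotNext x (u ∷ C')
≢⇒NotNext x u C' ne C'' e = ne (sym (proj₁ (∷-injective e)))

module StirlingWords (k : ℕ) where

  Stirling : ℕ → List ℕ → Set
  Stirling m w = ((x : ℕ) → 1 ≤ x → x ≤ m → mult x w ≡ k) × ((x : ℕ) → x ∈ w → 1 ≤ x × x ≤ m) × StirlingOrder w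

  block : ℕ → List ℕ
  block n = replicate k n

  Stirling-insert-block : ∀ m A C → Stirling m (A ++ C) → Stirling (suc m) (A ++ block (suc m) ++ C)
  Stirling-insert-block m A C (c , r , s) = c' , r' , StirlingOrder-insert (suc m) k A C lt s
    where
      lt : ∀ x → x ∈ A ++ C → x < suc m
      lt x mm = s≤s (proj₂ (r x mm))
      n∉ : ∀ L → (∀ x → x ∈ L → x < suc m) → suc m ∉ L
      n∉ L f mm = <-irrefl refl (f _ mm)
      c' : (x : ℕ) → 1 ≤ x → x ≤ suc m → mult x (A ++ block (suc m) ++ C) ≡ k
      c' x 1≤x x≤n with x ≟ suc m
      ... | yes refl rewrite mult-++ x A (block x ++ C) | mult-++ x (block x) C | mult-replicate x k
            | ∉⇒mult≡0 A (n∉ A (λ y mm → lt y (∈-++⁺ˡ mm))) | ∉⇒mult≡0 C (n∉ C (λ y mm → lt y (∈-++⁺ʳ A mm))) = +-identityʳ k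
      ... | no ne rewrite mult-++ x A (block (suc m) ++ C) | mult-++ x (block (suc m)) C
            | mult-replicate-≢ {x} {suc m} k (λ e → ne (sym e)) | sym (mult-++ x A C) = c x 1≤x (≤-pred (≤∧≢⇒< x≤n ne))
      r' : (x : ℕ) → x ∈ A ++ block (suc m) ++ C → 1 ≤ x × x ≤ suc m
      r' x mm with x ≟ suc m
      ... | yes refl = s≤s z≤n , ≤-refl
      ... | no ne = let (a , b) = r x (∈-remove-replicate k A C ne mm) in a , m≤n⇒m≤1+n b

  record BlockDecomposition (m : ℕ) (π : List ℕ) : Set where
    constructor decomposition
    field
      A C : List ℕ
      n∉A : suc m ∉ A
      n∉C : suc m ∉ C
      π≡ : π ≡ A ++ block (suc m) ++ C
      remainder : Stirling m (A ++ C)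

  Stirling-remove-block : ∀ m i A C → suc m ∉ A → suc m ∉ C →
    Stirling (suc m) (A ++ replicate i (suc m) ++ C) → Stirling m (A ++ C)
  Stirling-remove-block m i A C nA nC (c , r , s) = c' , r' , StirlingOrder-remove-replicate (suc m) i A C s
    where
      c' : (x : ℕ) → 1 ≤ x → x ≤ m → mult x (A ++ C) ≡ k
      c' x a b with c x a (m≤n⇒m≤1+n b)
      ... | e rewrite mult-++ x A (replicate i (suc m) ++ C) | mult-++ x (replicate i (suc m)) C
              | mult-replicate-≢ {x} {suc m} i (λ ee → <-irrefl (sym ee) (s≤s b)) | mult-++ x A C = e
      r' : (x : ℕ) → x ∈ A ++ C → 1 ≤ x × x ≤ m
      r' x mm with r x (∈-insert-replicate i A C mm) | ∈-++⁻ A mm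
      ... | a , b | inj₁ mA = a , ≤-pred (≤∧≢⇒< b (λ e → nA (subst (_∈ A) e mA)))
      ... | a , b | inj₂ mC = a , ≤-pred (≤∧≢⇒< b (λ e → nC (subst (_∈ C) e mC)))

  decompose : ∀ m π → 1 ≤ k → Stirling (suc m) π → BlockDecomposition m π
  decompose m π k≥1 V@(c , r , s) with ∈⇒first-split (mult≥1⇒∈ π (subst (1 ≤_) (sym (c (suc m) (s≤s z≤n) ≤-refl)) k≥1))
  ... | A , R , refl , nA with plateau-split (suc m) R (λ x mm → proj₂ (r x (∈-++⁺ʳ A (there mm)))) (proj₁ (StirlingOrder-suffix A _ s))
  ... | i , C , refl , nC =
    decomposition A C nA nC (cong (λ j → A ++ replicate j n ++ C) (sym k≡1+i)) (Stirling-remove-block m (suc i) A C nA nC V)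
    where
      n = suc m
      k≡1+i : k ≡ suc i
      k≡1+i = begin
        k                                         ≡⟨ c n (s≤s z≤n) ≤-refl ⟨
        mult n (A ++ replicate (suc i) n ++ C)    ≡⟨ mult-++ n A (replicate (suc i) n ++ C) ⟩
        mult n A + mult n (replicate (suc i) n ++ C)
          ≡⟨ cong₂ _+_ (∉⇒mult≡0 A nA) (mult-++ n (replicate (suc i) n) C) ⟩
        mult n (replicate (suc i) n) + mult n C   ≡⟨ cong₂ _+_ (mult-replicate n (suc i)) (∉⇒mult≡0 C nC) ⟩
        suc i + 0                                 ≡⟨ +-identityʳ (suc i) ⟩
        suc i                                     ∎
        where open ≡-Reasoning

  eraseAll-block : ∀ n A C → n ∉ A → n ∉ C → eraseAll n (A ++ block n ++ C) ≡ A ++ C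
  eraseAll-block n [] C _ nC = trans (eraseAll-replicate n k C) (eraseAll-∉ n C nC)
  eraseAll-block n (y ∷ A) C nA nC with y ≟ n
  ... | yes refl = ⊥-elim (nA (here refl))
  ... | no _ = cong (y ∷_) (eraseAll-block n A C (λ mm → nA (there mm)) nC)

  firstIndex-block : ∀ n A C → 1 ≤ k → n ∉ A → firstIndex n (A ++ block n ++ C) ≡ length A
  firstIndex-block n [] C (s≤s z≤n) _ with n ≟ n
  ... | yes _ = refl
  ... | no ne = ⊥-elim (ne refl)
  firstIndex-block n (y ∷ A) C k≥1 nA with y ≟ n
  ... | yes refl = ⊥-elim (nA (here refl))
  ... | no _ = cong suc (firstIndex-block n A C k≥1 (λ mm → nA (there mm)))

  apAtHead : List ℕ → List ℕ
  apAtHead (a ∷ b ∷ r) = valueIf (isAPᵇ k (a ∷ b ∷ r)) b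
  apAtHead _ = []

  apValues : List ℕ → List ℕ
  apValues [] = []
  apValues (a ∷ r) = apAtHead (a ∷ r) ++ apValues r

  ap≡length-apValues : ∀ L → ap k L ≡ length (apValues L)
  ap≡length-apValues [] = refl
  ap≡length-apValues (a ∷ []) = refl
  ap≡length-apValues (a ∷ b ∷ r) = trans (cong₂ _+_ (sym (length-valueIf (isAPᵇ k (a ∷ b ∷ r)) b)) (ap≡length-apValues (b ∷ r)))
                            (sym (length-++ (valueIf (isAPᵇ k (a ∷ b ∷ r)) b)))

  lenᵇ : ∀ {L : List ℕ} → T (length L ≡ᵇ k) → length L ≡ k
  lenᵇ {L} t = ≡ᵇ⇒≡ (length L) k t

  isAPᵇ⇒plateau-mult : ∀ a b r → T (isAPᵇ k (a ∷ b ∷ r)) → k ≤ mult b (b ∷ r)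
  isAPᵇ⇒plateau-mult a b r t with T∧ {a <ᵇ b} t
  ... | _ , t' with T∧ {allEqᵇ b (take k (b ∷ r))} {length (take k (b ∷ r)) ≡ᵇ k} t'
  ... | ae , le = subst (_≤ mult b (b ∷ r)) (trans (allEqᵇ-mult b (take k (b ∷ r)) ae) (lenᵇ {take k (b ∷ r)} le)) (mult-take≤ b k (b ∷ r))

  apAtHead-mult : ∀ {x} a L → x ∈ apAtHead (a ∷ L) → k ≤ mult x L
  apAtHead-mult a (b ∷ r) m with ∈-valueIf {c = isAPᵇ k (a ∷ b ∷ r)} m
  ... | t , refl = isAPᵇ⇒plateau-mult a b r t

  apValues-mult : ∀ x L → x ∈ apValues L → k ≤ mult x (drop 1 L)
  apValues-mult x (a ∷ L) m = [ apAtHead-mult a L , (λ mr → ≤-trans (apValues-mult x L mr) (d1 L)) ]′ (∈-++⁻ (apAtHead (a ∷ L)) m)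
    where d1 : ∀ L → mult x (drop 1 L) ≤ mult x L
          d1 [] = z≤n
          d1 (y ∷ L) = mult-∷≤ x y L

  apValues-∌head : ∀ a b r → (∀ x → mult x (a ∷ b ∷ r) ≤ k) → b ∉ apValues (b ∷ r)
  apValues-∌head a b r h mm with apValues-mult b (b ∷ r) mm
  ... | p = <-irrefl refl (≤-trans (≤-trans (s≤s p) (≤-reflexive (sym (mult-∷-≡ b r)))) (≤-trans (mult-∷≤ b a (b ∷ r)) (h b)))

  apAtHead-fresh : ∀ a L → (∀ x → mult x (a ∷ L) ≤ k) → ∀ x → mult x (apValues L) ≤ 1 → mult x (apAtHead (a ∷ L)) + mult x (apValues L) ≤ 1
  apAtHead-fresh a [] h x ih = ih
  apAtHead-fresh a (b ∷ r) h x ih with isAPᵇ k (a ∷ b ∷ r)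
  ... | false = ih
  ... | true with b ≟ x
  ...   | no ne rewrite mult-∷-≢ [] ne = ih
  ...   | yes refl rewrite mult-∷-≡ b [] | ∉⇒mult≡0 (apValues (b ∷ r)) (apValues-∌head a b r h) = ≤-refl

  apValues-Distinct : ∀ L → (∀ x → mult x L ≤ k) → Distinct (apValues L)
  apValues-Distinct [] _ x = z≤n
  apValues-Distinct (a ∷ L) h x = subst (_≤ 1) (sym (mult-++ x (apAtHead (a ∷ L)) (apValues L)))
    (apAtHead-fresh a L h x (apValues-Distinct L (λ y → ≤-trans (mult-∷≤ y a L) (h y)) x))

  isAPᵇ-parts : ∀ a b r → T (isAPᵇ k (a ∷ b ∷ r)) →
               a < b × T (allEqᵇ b (take k (b ∷ r))) × length (take k (b ∷ r)) ≡ k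
  isAPᵇ-parts a b r t with T∧ {a <ᵇ b} t
  ... | t1 , t' with T∧ {allEqᵇ b (take k (b ∷ r))} {length (take k (b ∷ r)) ≡ᵇ k} t'
  ... | ae , le = <ᵇ⇒< a b t1 , ae , lenᵇ {take k (b ∷ r)} le

  apAtPrefix : List ℕ → List ℕ → List ℕ
  apAtPrefix [] X = []
  apAtPrefix (a ∷ A) X = apAtHead (a ∷ A ++ X) ++ apAtPrefix A X

  apValues-++ : ∀ A X → apValues (A ++ X) ≡ apAtPrefix A X ++ apValues X
  apValues-++ [] X = refl
  apValues-++ (a ∷ A) X = trans (cong (apAtHead (a ∷ A ++ X) ++_) (apValues-++ A X)) (sym (++-assoc (apAtHead (a ∷ A ++ X)) (apAtPrefix A X) (apValues X)))

  apAtHead-++ : ∀ a b r X → k ≤ length (b ∷ r) → apAtHead (a ∷ (b ∷ r) ++ X) ≡ apAtHead (a ∷ b ∷ r)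
  apAtHead-++ a b r X le = cong (λ T' → valueIf ((a <ᵇ b) ∧ (allEqᵇ b T' ∧ (length T' ≡ᵇ k))) b) (take-++ˡ k (b ∷ r) X le)

  apAtHead-before-block : ∀ a n C → 1 ≤ k → a < n → apAtHead (a ∷ block n ++ C) ≡ n ∷ []
  apAtHead-before-block a n C (s≤s {n = k'} z≤n) lt = valueIf-true n (∧T (<⇒<ᵇ lt) (subst (λ T' → T (allEqᵇ n T' ∧ (length T' ≡ᵇ suc k'))) (sym (take-replicate-++ (suc k') n C))
                        (∧T (allEqᵇ-replicate n (suc k')) (≡⇒≡ᵇ (length (replicate (suc k') n)) (suc k') (length-replicate (suc k'))))))

  apAtHead-max : ∀ n Y → (∀ x → x ∈ Y → x ≤ n) → apAtHead (n ∷ Y) ≡ []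
  apAtHead-max n [] _ = refl
  apAtHead-max n (b ∷ r) le = valueIf-false b (λ t → <⇒≱ (proj₁ (isAPᵇ-parts n b r t)) (le b (here refl)))

  apAtPrefix-replicate : ∀ n i C → (∀ x → x ∈ C → x ≤ n) → apAtPrefix (replicate i n) C ≡ []
  apAtPrefix-replicate n zero C le = refl
  apAtPrefix-replicate n (suc i) C le = cong₂ _++_ (apAtHead-max n (replicate i n ++ C) le') (apAtPrefix-replicate n i C le)
    where le' : ∀ x → x ∈ replicate i n ++ C → x ≤ n
          le' x m with ∈-++⁻ (replicate i n) m
          ... | inj₁ mr = ≤-reflexive (∈-replicate⇒≡ i mr)
          ... | inj₂ mc = le x mc

  apAtHead-next : ∀ {x} a C → x ∈ apAtHead (a ∷ C) → Σ (List ℕ) λ C' → C ≡ x ∷ C'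
  apAtHead-next a (b ∷ r) m with ∈-valueIf {c = isAPᵇ k (a ∷ b ∷ r)} m
  ... | _ , refl = r , refl

  apAtHead-cut-by-block : ∀ a b r n C → 1 ≤ k → b < n → length (b ∷ r) < k → apAtHead (a ∷ (b ∷ r) ++ block n ++ C) ≡ []
  apAtHead-cut-by-block a b r n C (s≤s {n = k'} z≤n) lt short = valueIf-false b (λ t → let (_ , ae , _) = isAPᵇ-parts a b (r ++ block n ++ C) t in
                   <-irrefl (sym (allEqᵇ-∈ (take (suc k') (b ∷ r ++ n ∷ replicate k' n ++ C)) ae
                                (∈-take-insert (suc k') (b ∷ r) (replicate k' n ++ C) short))) lt)

  apAtHead-short : ∀ {x} a b r C → length (b ∷ r) < k → x ∈ apAtHead (a ∷ (b ∷ r) ++ C) → Σ (List ℕ) λ C' → C ≡ x ∷ C'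
  apAtHead-short {x} a b r [] short m with ∈-valueIf {c = isAPᵇ k (a ∷ b ∷ r ++ [])} m
  ... | t , refl with isAPᵇ-parts a b (r ++ []) t
  ... | _ , ae , len = ⊥-elim (<-irrefl (trans (sym (length-take-short k (b ∷ r) short)) len) short)
  apAtHead-short {x} a b r (c ∷ C') short m with ∈-valueIf {c = isAPᵇ k (a ∷ b ∷ r ++ c ∷ C')} m
  ... | t , refl with isAPᵇ-parts a b (r ++ c ∷ C') t
  ... | _ , ae , len = C' , cong (_∷ C') (allEqᵇ-∈ (take k (b ∷ r ++ c ∷ C')) ae (∈-take-insert k (b ∷ r) C' short))

  -- Inserting n^k after the prefix a ∷ A creates the plateau value n and destroys exactly the
  -- plateaux of the prefix that ran into C, i.e. those whose value is the first letter of C.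
  record PrefixValues (n a : ℕ) (A C : List ℕ) : Set where
    field
      kept : List ℕ
      with-block : apAtPrefix (a ∷ A) (block n ++ C) ≡ kept ++ n ∷ []
      without-block : ∀ x → x ∈ apAtPrefix (a ∷ A) C → x ∈ kept ⊎ (Σ (List ℕ) λ C' → C ≡ x ∷ C')
      kept⊆ : ∀ x → x ∈ kept → x ∈ apAtPrefix (a ∷ A) C
      kept-mult : ∀ x → x ∈ kept → k ≤ mult x (a ∷ A)

  prefixValues-long : ∀ n a b r C → k ≤ length (b ∷ r) → PrefixValues n b r C → PrefixValues n a (b ∷ r) C
  prefixValues-long n a b r C le ih = record
    { kept = apAtHead (a ∷ b ∷ r) ++ kept
    ; with-block = trans (cong (_++ apAtPrefix (b ∷ r) (block n ++ C)) (apAtHead-++ a b r (block n ++ C) le))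
        (trans (cong (apAtHead (a ∷ b ∷ r) ++_) with-block) (sym (++-assoc (apAtHead (a ∷ b ∷ r)) kept (n ∷ []))))
    ; without-block = without-block'
    ; kept⊆ = kept⊆'
    ; kept-mult = kept-mult'
    }
    where
      open PrefixValues ih
      without-block' : ∀ x → x ∈ apAtPrefix (a ∷ b ∷ r) C → x ∈ apAtHead (a ∷ b ∷ r) ++ kept ⊎ (Σ (List ℕ) λ C' → C ≡ x ∷ C')
      without-block' x m with ∈-++⁻ (apAtHead (a ∷ (b ∷ r) ++ C)) m
      ... | inj₁ m1 = inj₁ (∈-++⁺ˡ (subst (x ∈_) (apAtHead-++ a b r C le) m1))
      ... | inj₂ m2 = Data.Sum.map₁ (∈-++⁺ʳ (apAtHead (a ∷ b ∷ r))) (without-block x m2)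
      kept⊆' : ∀ x → x ∈ apAtHead (a ∷ b ∷ r) ++ kept → x ∈ apAtPrefix (a ∷ b ∷ r) C
      kept⊆' x m with ∈-++⁻ (apAtHead (a ∷ b ∷ r)) m
      ... | inj₁ m1 = ∈-++⁺ˡ (subst (x ∈_) (sym (apAtHead-++ a b r C le)) m1)
      ... | inj₂ m2 = ∈-++⁺ʳ (apAtHead (a ∷ (b ∷ r) ++ C)) (kept⊆ x m2)
      kept-mult' : ∀ x → x ∈ apAtHead (a ∷ b ∷ r) ++ kept → k ≤ mult x (a ∷ b ∷ r)
      kept-mult' x m with ∈-++⁻ (apAtHead (a ∷ b ∷ r)) m
      ... | inj₁ m1 = ≤-trans (apAtHead-mult a (b ∷ r) m1) (mult-∷≤ x a (b ∷ r))
      ... | inj₂ m2 = ≤-trans (kept-mult x m2) (mult-∷≤ x a (b ∷ r))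

  prefixValues-short : ∀ n a b r C → 1 ≤ k → b < n → length (b ∷ r) < k → PrefixValues n b r C → PrefixValues n a (b ∷ r) C
  prefixValues-short n a b r C k≥1 b<n short ih = record
    { kept = kept
    ; with-block = trans (cong (_++ apAtPrefix (b ∷ r) (block n ++ C)) (apAtHead-cut-by-block a b r n C k≥1 b<n short)) with-block
    ; without-block = without-block'
    ; kept⊆ = λ x m → ∈-++⁺ʳ (apAtHead (a ∷ (b ∷ r) ++ C)) (kept⊆ x m)
    ; kept-mult = λ x m → ≤-trans (kept-mult x m) (mult-∷≤ x a (b ∷ r))
    }
    where
      open PrefixValues ih
      without-block' : ∀ x → x ∈ apAtPrefix (a ∷ b ∷ r) C → x ∈ kept ⊎ (Σ (List ℕ) λ C' → C ≡ x ∷ C')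
      without-block' x m with ∈-++⁻ (apAtHead (a ∷ (b ∷ r) ++ C)) m
      ... | inj₁ m1 = inj₂ (apAtHead-short a b r C short m1)
      ... | inj₂ m2 = without-block x m2

  prefixValues : ∀ n a A C → 1 ≤ k → (∀ x → x ∈ a ∷ A → x < n) → PrefixValues n a A C
  prefixValues n a [] C k≥1 lt = record
    { kept = []
    ; with-block = trans (++-identityʳ _) (apAtHead-before-block a n C k≥1 (lt a (here refl)))
    ; without-block = λ x m → inj₂ (apAtHead-next a C (subst (x ∈_) (++-identityʳ _) m))
    ; kept⊆ = λ x ()
    ; kept-mult = λ x ()
    }
  prefixValues n a (b ∷ r) C k≥1 lt with k ≤? length (b ∷ r) | prefixValues n b r C k≥1 (λ x m → lt x (there m))
  ... | yes le | ih = prefixValues-long n a b r C le ih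
  ... | no nle | ih = prefixValues-short n a b r C k≥1 (lt b (there (here refl))) (≰⇒> nle) ih

  Stirling-mult≤k : ∀ m w → Stirling m w → ∀ x → mult x w ≤ k
  Stirling-mult≤k m w (c , r , _) x with any? (x ≟_) w
  ... | yes mm = let (a , b) = r x mm in ≤-reflexive (c x a b)
  ... | no nm = subst (_≤ k) (sym (∉⇒mult≡0 w nm)) z≤n

  apValues-block : ∀ n A C → (∀ x → x ∈ C → x ≤ n) → apValues (A ++ block n ++ C) ≡ apAtPrefix A (block n ++ C) ++ apValues C
  apValues-block n A C le = trans (apValues-++ A (block n ++ C)) (cong (apAtPrefix A (block n ++ C) ++_)
                     (trans (apValues-++ (block n) C) (cong (_++ apValues C) (apAtPrefix-replicate n k C le))))

  apValues-leading-block : ∀ n C → (∀ x → x ∈ C → x ≤ n) → apValues (block n ++ C) ≡ apValues C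
  apValues-leading-block n C le = apValues-block n [] C le

  module BlockInsertion (m : ℕ) (a : ℕ) (A C : List ℕ) (k≥1 : 1 ≤ k) (V : Stirling m ((a ∷ A) ++ C)) where
    n = suc m
    w = (a ∷ A) ++ C
    π = (a ∷ A) ++ block n ++ C

    ltA : ∀ x → x ∈ a ∷ A → x < n
    ltA x mm = s≤s (proj₂ (proj₁ (proj₂ V) x (∈-++⁺ˡ mm)))

    leC : ∀ x → x ∈ C → x ≤ n
    leC x mm = m≤n⇒m≤1+n (proj₂ (proj₁ (proj₂ V) x (∈-++⁺ʳ (a ∷ A) mm)))

    R = prefixValues n a A C k≥1 ltA

    eqπ : apValues π ≡ (PrefixValues.kept R ++ n ∷ []) ++ apValues C
    eqπ = trans (apValues-block n (a ∷ A) C leC) (cong (_++ apValues C) (PrefixValues.with-block R))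

    eqw : apValues w ≡ apAtPrefix (a ∷ A) C ++ apValues C
    eqw = apValues-++ (a ∷ A) C

    ckw = Stirling-mult≤k m w V

    n∈ : n ∈ apValues π
    n∈ = subst (n ∈_) (sym eqπ) (∈-++⁺ˡ (∈-++⁺ʳ (PrefixValues.kept R) (here refl)))

    toπ-G : ∀ {x} → x ∈ PrefixValues.kept R → x ∈ apValues π
    toπ-G g = subst (_ ∈_) (sym eqπ) (∈-++⁺ˡ (∈-++⁺ˡ g))

    toπ-C : ∀ {x} → x ∈ apValues C → x ∈ apValues π
    toπ-C {x} mc = subst (x ∈_) (sym eqπ) (∈-++⁺ʳ (PrefixValues.kept R ++ n ∷ []) mc)

    contraG : ∀ {x} C' → x ∈ PrefixValues.kept R → C ≢ x ∷ C'
    contraG {x} C' g refl = <-irrefl refl (≤-trans (s≤s (≤-trans (PrefixValues.kept-mult R x g) (m≤m+n _ _))) (≤-trans big (ckw x)))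
      where big : suc (mult x (a ∷ A) + mult x C') ≤ mult x w
            big rewrite mult-++ x (a ∷ A) (x ∷ C') | mult-∷-≡ x C' | +-suc (mult x (a ∷ A)) (mult x C') = ≤-refl

    contraC : ∀ {x} C' → x ∈ apValues C → C ≢ x ∷ C'
    contraC {x} C' mc refl = <-irrefl refl (≤-trans (s≤s (apValues-mult x (x ∷ C') mc)) (≤-trans big (ckw x)))
      where big : suc (mult x C') ≤ mult x w
            big rewrite mult-++ x (a ∷ A) (x ∷ C') | mult-∷-≡ x C' = m≤n+m _ _

    fwd : ∀ x → x ∈ apValues π → x ≡ n ⊎ (x ∈ apValues w × NotNext x C)
    fwd x mm with ∈-++⁻ (PrefixValues.kept R ++ n ∷ []) (subst (x ∈_) eqπ mm)
    ... | inj₂ mc = inj₂ (subst (x ∈_) (sym eqw) (∈-++⁺ʳ (apAtPrefix (a ∷ A) C) mc) , λ C' → contraC C' mc)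
    ... | inj₁ m1 with ∈-++⁻ (PrefixValues.kept R) m1
    ...   | inj₂ (here e) = inj₁ e
    ...   | inj₁ g = inj₂ (subst (x ∈_) (sym eqw) (∈-++⁺ˡ (PrefixValues.kept⊆ R x g)) , λ C' → contraG C' g)

    bwd : ∀ x → x ∈ apValues w → NotNext x C → x ∈ apValues π
    bwd x mm nh with ∈-++⁻ (apAtPrefix (a ∷ A) C) (subst (x ∈_) eqw mm)
    ... | inj₂ mc = toπ-C mc
    ... | inj₁ mr with PrefixValues.without-block R x mr
    ...   | inj₁ g = toπ-G g
    ...   | inj₂ (C' , e) = ⊥-elim (nh C' e)

  qbarᵇ : List ℕ → Bool
  qbarᵇ [] = true
  qbarᵇ (x ∷ w) = allEqᵇ x (take k (x ∷ w))

  qbarᵇ-block : ∀ n C → 1 ≤ k → qbarᵇ (block n ++ C) ≡ true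
  qbarᵇ-block n C (s≤s {n = k'} z≤n) = T⇒true (subst (λ T' → T (allEqᵇ n T')) (sym (take-replicate-++ (suc k') n C)) (allEqᵇ-replicate n (suc k')))

  qbarᵇ-cut-by-block : ∀ a A n C → length (a ∷ A) < k → a < n → qbarᵇ ((a ∷ A) ++ block n ++ C) ≡ false
  qbarᵇ-cut-by-block a A n C (s≤s {n = k'} sh) lt = ¬T⇒false (λ t → <-irrefl (sym (allEqᵇ-∈ (take (suc k') (a ∷ A ++ n ∷ replicate k' n ++ C)) t
                                (∈-take-insert (suc k') (a ∷ A) (replicate k' n ++ C) (s≤s sh)))) lt)

  qbarᵇ-long-prefix : ∀ a A X Y → k ≤ length (a ∷ A) → qbarᵇ ((a ∷ A) ++ X) ≡ qbarᵇ ((a ∷ A) ++ Y)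
  qbarᵇ-long-prefix a A X Y le = cong (allEqᵇ a) (trans (take-++ˡ k (a ∷ A) X le) (sym (take-++ˡ k (a ∷ A) Y le)))

  qbarᵇ-short-prefix : ∀ a A v C' → length (a ∷ A) < k → v ≢ a → qbarᵇ ((a ∷ A) ++ v ∷ C') ≡ false
  qbarᵇ-short-prefix a A v C' short ne = ¬T⇒false (λ t → ne (allEqᵇ-∈ (take k (a ∷ A ++ v ∷ C')) t (∈-take-insert k (a ∷ A) C' short)))

  qbarᵇ-head-repeated : ∀ m a A C' → Stirling m ((a ∷ A) ++ a ∷ C') → k ≤ length (a ∷ A) → qbarᵇ ((a ∷ A) ++ a ∷ C') ≡ false
  qbarᵇ-head-repeated m a A C' V le = ¬T⇒false contra
    where
      w = (a ∷ A) ++ a ∷ C'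
      contra : T (qbarᵇ w) → ⊥
      contra t = <-irrefl refl (≤-trans big (Stirling-mult≤k m w V a))
        where
          lenw : k ≤ length w
          lenw = ≤-trans le (subst (length (a ∷ A) ≤_) (sym (length-++ (a ∷ A) {a ∷ C'})) (m≤m+n _ _))
          ctake : mult a (take k w) ≡ k
          ctake = trans (allEqᵇ-mult a (take k w) t) (length-take-long k w lenw)
          cdrop : 1 ≤ mult a (drop k w)
          cdrop = ∈⇒mult≥1 (subst (a ∈_) (sym (drop-++ˡ k (a ∷ A) (a ∷ C') le)) (∈-++⁺ʳ (drop k (a ∷ A)) (here refl)))
          big : suc k ≤ mult a w
          big = subst (suc k ≤_) (trans (sym (mult-++ a (take k w) (drop k w))) (cong (mult a) (take++drop≡id k w)))
                  (subst (λ z → suc k ≤ z + mult a (drop k w)) (sym ctake) (subst (_≤ k + mult a (drop k w)) (+-comm k 1) (+-monoʳ-≤ k cdrop)))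

  -- The gap at position p is the one just before the letter of index p.
  siteOf : List ℕ → ℕ → Site
  siteOf w zero = newTree
  siteOf w (suc p) with length w ≤? suc p
  ... | yes _ = under (hd w) (k ∸ 1)
  ... | no _ with nth w (suc p) ≟ hd w
  ...   | yes _ = under (hd w) (mult (hd w) (take (suc p) w) ∸ 1)
  ...   | no _ = under (nth w (suc p)) (mult (nth w (suc p)) (take (suc p) w))

  positionOf : List ℕ → Site → ℕ
  positionOf w newTree = 0
  positionOf w (under v j) with v ≟ hd w
  ... | no _ = occurrence v j w
  ... | yes _ with j ≟ k ∸ 1
  ...   | yes _ = length w
  ...   | no _ = occurrence v (suc j) w

  siteOf-end : ∀ w p → length w ≤ suc p → siteOf w (suc p) ≡ under (hd w) (k ∸ 1)
  siteOf-end w p le with length w ≤? suc p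
  ... | yes _ = refl
  ... | no nle = ⊥-elim (nle le)

  siteOf-head : ∀ w p → suc p < length w → nth w (suc p) ≡ hd w → siteOf w (suc p) ≡ under (hd w) (mult (hd w) (take (suc p) w) ∸ 1)
  siteOf-head w p lt e with length w ≤? suc p
  ... | yes le = ⊥-elim (<⇒≱ lt le)
  ... | no _ with nth w (suc p) ≟ hd w
  ...   | yes _ = refl
  ...   | no ne = ⊥-elim (ne e)

  siteOf-other : ∀ w p → suc p < length w → nth w (suc p) ≢ hd w → siteOf w (suc p) ≡ under (nth w (suc p)) (mult (nth w (suc p)) (take (suc p) w))
  siteOf-other w p lt e with length w ≤? suc p
  ... | yes le = ⊥-elim (<⇒≱ lt le)
  ... | no _ with nth w (suc p) ≟ hd w
  ...   | yes ee = ⊥-elim (e ee)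
  ...   | no ne = refl

  positionOf-other : ∀ w v j → v ≢ hd w → positionOf w (under v j) ≡ occurrence v j w
  positionOf-other w v j ne with v ≟ hd w
  ... | yes e = ⊥-elim (ne e)
  ... | no _ = refl

  positionOf-end : ∀ w → positionOf w (under (hd w) (k ∸ 1)) ≡ length w
  positionOf-end w with hd w ≟ hd w
  ... | no ne = ⊥-elim (ne refl)
  ... | yes _ with k ∸ 1 ≟ k ∸ 1
  ...   | yes _ = refl
  ...   | no ne = ⊥-elim (ne refl)

  positionOf-head : ∀ w j → j ≢ k ∸ 1 → positionOf w (under (hd w) j) ≡ occurrence (hd w) (suc j) w
  positionOf-head w j nj with hd w ≟ hd w
  ... | no ne = ⊥-elim (ne refl)
  ... | yes _ with j ≟ k ∸ 1
  ...   | yes e = ⊥-elim (nj e)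
  ...   | no _ = refl

  positionOf-siteOf : ∀ m w p → Stirling m w → p ≤ length w → positionOf w (siteOf w p) ≡ p
  positionOf-siteOf m w zero V le = refl
  positionOf-siteOf m w (suc p) V le with length w ≤? suc p
  ... | yes le' = trans (positionOf-end w) (≤-antisym le' le)
  ... | no nle with nth w (suc p) ≟ hd w
  ...   | no ne = trans (positionOf-other w _ _ ne) (occurrence-nth w (suc p) (≰⇒> nle))
  ...   | yes e = trans (positionOf-head w (c ∸ 1) nj) (trans (cong (λ z → occurrence (hd w) z w) sc) (subst (λ z → occurrence z (mult z (take (suc p) w)) w ≡ suc p) e (occurrence-nth w (suc p) (≰⇒> nle))))
    where
      c = mult (hd w) (take (suc p) w)
      c≥1 : 1 ≤ c
      c≥1 = mult-hd-take w p (≤-trans (s≤s z≤n) (≰⇒> nle))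
      d≥1 : 1 ≤ mult (hd w) (drop (suc p) w)
      d≥1 = ∈⇒mult≥1 (subst (_∈ drop (suc p) w) e (nth-∈-drop w (suc p) (≰⇒> nle)))
      c<k : c < k
      c<k = ≤-trans (subst (_≤ c + mult (hd w) (drop (suc p) w)) (+-comm c 1) (+-monoʳ-≤ c d≥1))
              (≤-trans (≤-reflexive (sym (mult-take-drop (hd w) (suc p) w))) (Stirling-mult≤k m w V (hd w)))
      sc : suc (c ∸ 1) ≡ c
      sc = trans (+-comm 1 (c ∸ 1)) (m∸n+n≡m c≥1)
      nj : c ∸ 1 ≢ k ∸ 1
      nj e' = <-irrefl (trans (sym sc) (trans (cong suc e') (trans (+-comm 1 (k ∸ 1)) (m∸n+n≡m (≤-trans c≥1 (<⇒≤ c<k)))))) c<k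

  siteOf-occurrence-other : ∀ w v j → j < mult v w → v ≢ hd w → siteOf w (occurrence v j w) ≡ under v j
  siteOf-occurrence-other w v j lt ne with occurrence v j w | occurrence-props v j w lt
  ... | zero | a , b , c = ⊥-elim (ne (sym (trans (hd≡nth0 w) b)))
    where hd≡nth0 : ∀ w → hd w ≡ nth w 0
          hd≡nth0 [] = refl
          hd≡nth0 (x ∷ w) = refl
  ... | suc p | a , b , c = trans (siteOf-other w p a (λ e → ne (trans (sym b) e))) (cong₂ under b (trans (cong (λ z → mult z (take (suc p) w)) b) c))

  siteOf-occurrence-head : ∀ w j → suc j < mult (hd w) w → siteOf w (occurrence (hd w) (suc j) w) ≡ under (hd w) j
  siteOf-occurrence-head w j lt with occurrence (hd w) (suc j) w | occurrence-props (hd w) (suc j) w lt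
  ... | zero | a , b , ()
  ... | suc p | a , b , c = trans (siteOf-head w p a b) (cong (λ z → under (hd w) (z ∸ 1)) c)

  suc-pred-k : 1 ≤ k → suc (k ∸ 1) ≡ k
  suc-pred-k k≥1 = trans (+-comm 1 (k ∸ 1)) (m∸n+n≡m k≥1)

  siteOf-positionOf : ∀ m w tp → 1 ≤ k → Stirling m w → ValidSite k m tp → (siteOf w (positionOf w tp) ≡ tp) × (positionOf w tp ≤ length w)
  siteOf-positionOf m w newTree k≥1 V _ = refl , z≤n
  siteOf-positionOf m w (under v j) k≥1 V ((a , b) , jk) = go (v ≟ hd w) (j ≟ k ∸ 1)
    where
      cv = proj₁ V v a b
      go : Dec (v ≡ hd w) → Dec (j ≡ k ∸ 1) → (siteOf w (positionOf w (under v j)) ≡ under v j) × (positionOf w (under v j) ≤ length w)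
      go (no ne) _ = subst (λ z → (siteOf w z ≡ under v j) × (z ≤ length w)) (sym (positionOf-other w v j ne))
                   (siteOf-occurrence-other w v j (subst (j <_) (sym cv) jk) ne , <⇒≤ (proj₁ (occurrence-props v j w (subst (j <_) (sym cv) jk))))
      go (yes refl) (yes refl) with mult≥1⇒nonempty (hd w) w (subst (1 ≤_) (sym cv) k≥1)
      ... | l , el = subst (λ z → (siteOf w z ≡ under (hd w) (k ∸ 1)) × (z ≤ length w)) (sym (positionOf-end w))
                   (subst (λ z → siteOf w z ≡ under (hd w) (k ∸ 1)) (sym el) (siteOf-end w l (≤-reflexive el)) , ≤-refl)
      go (yes refl) (no nj) = subst (λ z → (siteOf w z ≡ under (hd w) j) × (z ≤ length w)) (sym (positionOf-head w j nj))
                   (siteOf-occurrence-head w j sj , <⇒≤ (proj₁ (occurrence-props (hd w) (suc j) w sj)))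
        where
          j≤ : j ≤ k ∸ 1
          j≤ = ≤-pred (subst (suc j ≤_) (sym (suc-pred-k k≥1)) jk)
          sj : suc j < mult (hd w) w
          sj = subst (suc j <_) (sym cv) (subst (suc j <_) (suc-pred-k k≥1) (s≤s (≤∧≢⇒< j≤ nj)))

  head∉apValues : ∀ m r w' → Stirling m (r ∷ w') → r ∉ apValues (r ∷ w')
  head∉apValues m r w' V mm = <-irrefl refl (≤-trans (s≤s (apValues-mult r (r ∷ w') mm)) (≤-trans (≤-reflexive (sym (mult-∷-≡ r w'))) (Stirling-mult≤k m (r ∷ w') V r)))

  IsStirling⇒Stirling : ∀ m w → IsStirling m k w → Stirling m w
  IsStirling⇒Stirling m w (c , r , s) = c , r , lookup⇒StirlingOrder w s

  Stirling⇒IsStirling : ∀ m w → Stirling m w → IsStirling m k w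
  Stirling⇒IsStirling m w (c , r , s) = c , r , StirlingOrder⇒lookup w s

  qbarᵇ⇒InQbar : ∀ w → qbarᵇ w ≡ true → InQbar k w
  qbarᵇ⇒InQbar (x ∷ w) e i j li lj = trans (allEqᵇ-take⇒lookup x k (x ∷ w) t i li) (sym (allEqᵇ-take⇒lookup x k (x ∷ w) t j lj))
    where t : T (allEqᵇ x (take k (x ∷ w)))
          t = subst T (sym e) tt

  InQbar⇒qbarᵇ : 1 ≤ k → ∀ w → InQbar k w → qbarᵇ w ≡ true
  InQbar⇒qbarᵇ k≥1 [] _ = refl
  InQbar⇒qbarᵇ k≥1 (x ∷ w) h = T⇒true (lookup⇒allEqᵇ-take x k (x ∷ w) (λ i lt → h i Fin.zero lt k≥1))

  hd-block : ∀ n C → 1 ≤ k → hd (block n ++ C) ≡ n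
  hd-block n C (s≤s z≤n) = refl

-- Labelled forests

AllTrees⇒IncEs : ∀ F → AllTrees IncE F → IncEs F
AllTrees⇒IncEs [] _ = tt
AllTrees⇒IncEs (t ∷ F) (p , q) = p , AllTrees⇒IncEs F q

IncEs⇒AllTrees : ∀ F → IncEs F → AllTrees IncE F
IncEs⇒AllTrees [] _ = tt
IncEs⇒AllTrees (t ∷ F) (p , q) = p , IncEs⇒AllTrees F q

label∈labels : ∀ t → label t ∈ labels t
label∈labels (enode l cs) = here refl

allLeavesᵇ-replicate : ∀ i → allLeavesᵇ (replicate i (onode [])) ≡ true
allLeavesᵇ-replicate zero = refl
allLeavesᵇ-replicate (suc i) = allLeavesᵇ-replicate i

if-true : ∀ {A : Set} {b} {x y : A} → b ≡ true → (if b then x else y) ≡ x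
if-true refl = refl

if-false : ∀ {A : Set} {b} {x y : A} → b ≡ false → (if b then x else y) ≡ y
if-false refl = refl

length-pruneOs : ∀ cs → length (pruneOs cs) ≡ length cs
length-pruneOs [] = refl
length-pruneOs (onode ts ∷ cs) = cong suc (length-pruneOs cs)

isLeafOᵇ-pruneEs : ∀ ts → isLeafOᵇ (onode (pruneEs ts)) ≡ isLeafOᵇ (onode ts)
isLeafOᵇ-pruneEs [] = refl
isLeafOᵇ-pruneEs (t ∷ ts) = refl

allLeavesᵇ-pruneOs : ∀ cs → allLeavesᵇ (pruneOs cs) ≡ allLeavesᵇ cs
allLeavesᵇ-pruneOs [] = refl
allLeavesᵇ-pruneOs (onode ts ∷ cs) = cong₂ _∧_ (isLeafOᵇ-pruneEs ts) (allLeavesᵇ-pruneOs cs)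

mutual
  leaves : ETree → List ℕ
  leaves (enode l []) = l ∷ []
  leaves (enode l (c ∷ cs)) = leavesOs (c ∷ cs)

  leavesOs : List OTree → List ℕ
  leavesOs [] = []
  leavesOs (onode ts ∷ cs) = leavesEs ts ++ leavesOs cs

  leavesEs : List ETree → List ℕ
  leavesEs [] = []
  leavesEs (t ∷ ts) = leaves t ++ leavesEs ts

mutual
  lleafT≡length : ∀ T → lleafT T ≡ length (leaves T)
  lleafT≡length (enode l []) = refl
  lleafT≡length (enode l (c ∷ cs)) = lleafOs≡length (c ∷ cs)

  lleafOs≡length : ∀ cs → lleafOs cs ≡ length (leavesOs cs)
  lleafOs≡length [] = refl
  lleafOs≡length (onode ts ∷ cs) = trans (cong₂ _+_ (lleafEs≡length ts) (lleafOs≡length cs)) (sym (length-++ (leavesEs ts)))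

  lleafEs≡length : ∀ ts → lleafEs ts ≡ length (leavesEs ts)
  lleafEs≡length [] = refl
  lleafEs≡length (t ∷ ts) = trans (cong₂ _+_ (lleafT≡length t) (lleafEs≡length ts)) (sym (length-++ (leaves t)))

-- The labelled leaves of a tree other than its root; empty exactly for a singleton.
properLeaves : ETree → List ℕ
properLeaves (enode l cs) = leavesOs cs

properLeavesF : Forest → List ℕ
properLeavesF [] = []
properLeavesF (t ∷ F) = properLeaves t ++ properLeavesF F

lleaf≡si+properLeaves : ∀ F → lleaf F ≡ si F + length (properLeavesF F)
lleaf≡si+properLeaves [] = refl
lleaf≡si+properLeaves (enode l [] ∷ F) = cong suc (lleaf≡si+properLeaves F)
lleaf≡si+properLeaves (enode l (c ∷ cs) ∷ F) = begin
  lleafOs (c ∷ cs) + lleaf F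
    ≡⟨ cong₂ _+_ (lleafOs≡length (c ∷ cs)) (lleaf≡si+properLeaves F) ⟩
  length (leavesOs (c ∷ cs)) + (si F + length (properLeavesF F))
    ≡⟨ x∙yz≈y∙xz (length (leavesOs (c ∷ cs))) (si F) (length (properLeavesF F)) ⟩
  si F + (length (leavesOs (c ∷ cs)) + length (properLeavesF F))
    ≡⟨ cong (si F +_) (length-++ (leavesOs (c ∷ cs))) ⟨
  si F + length (properLeavesF (enode l (c ∷ cs) ∷ F))
    ∎
  where open ≡-Reasoning

lleaf∸si≡properLeaves : ∀ F → lleaf F ∸ si F ≡ length (properLeavesF F)
lleaf∸si≡properLeaves F = trans (cong (_∸ si F) (lleaf≡si+properLeaves F)) (m+n∸m≡n (si F) (length (properLeavesF F)))

graft : ℕ → ETree → List OTree → List OTree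
graft j t [] = []
graft zero t (onode ts ∷ cs) = onode (ts ++ t ∷ []) ∷ cs
graft (suc j) t (c ∷ cs) = c ∷ graft j t cs

leavesEs-++ : ∀ ts us → leavesEs (ts ++ us) ≡ leavesEs ts ++ leavesEs us
leavesEs-++ [] us = refl
leavesEs-++ (t ∷ ts) us = trans (cong (leaves t ++_) (leavesEs-++ ts us)) (sym (++-assoc (leaves t) (leavesEs ts) (leavesEs us)))

leaves-graft⁻ : ∀ {x} j t X → x ∈ leavesOs (graft j t X) → x ∈ leaves t ⊎ x ∈ leavesOs X
leaves-graft⁻ j t [] ()
leaves-graft⁻ {x} zero t (onode ts ∷ cs) m with ∈-++⁻ (leavesEs (ts ++ t ∷ [])) m
... | inj₂ mc = inj₂ (∈-++⁺ʳ (leavesEs ts) mc)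
... | inj₁ mt with ∈-++⁻ (leavesEs ts) (subst (x ∈_) (leavesEs-++ ts (t ∷ [])) mt)
...   | inj₁ m1 = inj₂ (∈-++⁺ˡ m1)
...   | inj₂ m2 = inj₁ (subst (x ∈_) (++-identityʳ (leaves t)) m2)
leaves-graft⁻ (suc j) t (onode ts ∷ cs) m with ∈-++⁻ (leavesEs ts) m
... | inj₁ m1 = inj₂ (∈-++⁺ˡ m1)
... | inj₂ m2 with leaves-graft⁻ j t cs m2
...   | inj₁ mt = inj₁ mt
...   | inj₂ mc = inj₂ (∈-++⁺ʳ (leavesEs ts) mc)

leaves-graft⁺ : ∀ {x} j t X → x ∈ leavesOs X → x ∈ leavesOs (graft j t X)
leaves-graft⁺ zero t (onode ts ∷ cs) m with ∈-++⁻ (leavesEs ts) m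
... | inj₁ m1 = ∈-++⁺ˡ (subst (_ ∈_) (sym (leavesEs-++ ts (t ∷ []))) (∈-++⁺ˡ m1))
... | inj₂ m2 = ∈-++⁺ʳ (leavesEs (ts ++ t ∷ [])) m2
leaves-graft⁺ (suc j) t (onode ts ∷ cs) m with ∈-++⁻ (leavesEs ts) m
... | inj₁ m1 = ∈-++⁺ˡ m1
... | inj₂ m2 = ∈-++⁺ʳ (leavesEs ts) (leaves-graft⁺ j t cs m2)

leaves-graft-new : ∀ {x} j t X → j < length X → x ∈ leaves t → x ∈ leavesOs (graft j t X)
leaves-graft-new zero t (onode ts ∷ cs) _ m = ∈-++⁺ˡ (subst (_ ∈_) (sym (leavesEs-++ ts (t ∷ []))) (∈-++⁺ʳ (leavesEs ts) (∈-++⁺ˡ m)))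
leaves-graft-new (suc j) t (onode ts ∷ cs) (s≤s lt) m = ∈-++⁺ʳ (leavesEs ts) (leaves-graft-new j t cs lt m)

length-graft : ∀ j t X → length (graft j t X) ≡ length X
length-graft j t [] = refl
length-graft zero t (onode ts ∷ cs) = refl
length-graft (suc j) t (c ∷ cs) = cong suc (length-graft j t cs)

NonEmpty : List OTree → Set
NonEmpty X = Σ OTree λ c → Σ (List OTree) λ cs → X ≡ c ∷ cs

leaves-nonempty : ∀ l X → NonEmpty X → leaves (enode l X) ≡ leavesOs X
leaves-nonempty l X (c , cs , refl) = refl

leavesOs⊆leaves : ∀ {x} l cs → x ∈ leavesOs cs → x ∈ leaves (enode l cs)
leavesOs⊆leaves l (c ∷ cs) m = m

properLeavesF-++ : ∀ F G → properLeavesF (F ++ G) ≡ properLeavesF F ++ properLeavesF G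
properLeavesF-++ [] G = refl
properLeavesF-++ (t ∷ F) G = trans (cong (properLeaves t ++_) (properLeavesF-++ F G)) (sym (++-assoc (properLeaves t) (properLeavesF F) (properLeavesF G)))

properLeavesF-newTree : ∀ n F → properLeavesF (F ++ enode n [] ∷ []) ≡ properLeavesF F
properLeavesF-newTree n F = trans (properLeavesF-++ F (enode n [] ∷ [])) (++-identityʳ (properLeavesF F))

firstLeavesᵇ : ℕ → List OTree → Bool
firstLeavesᵇ zero cs = true
firstLeavesᵇ (suc i) [] = false
firstLeavesᵇ (suc i) (c ∷ cs) = isLeafOᵇ c ∧ firstLeavesᵇ i cs

lastRoot : Forest → ℕ
lastRoot [] = 0
lastRoot (t ∷ []) = label t
lastRoot (t ∷ u ∷ ts) = lastRoot (u ∷ ts)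

lastRoot-newTree : ∀ n F → lastRoot (F ++ enode n [] ∷ []) ≡ n
lastRoot-newTree n [] = refl
lastRoot-newTree n (t ∷ []) = refl
lastRoot-newTree n (t ∷ u ∷ F) = lastRoot-newTree n (u ∷ F)

firstLeavesᵇ-graft-early : ∀ i j t Y → j < i → j < length Y → firstLeavesᵇ i (graft j t Y) ≡ false
firstLeavesᵇ-graft-early (suc i) zero t (onode ts ∷ Y) _ _ with ts
... | [] = refl
... | _ ∷ _ = refl
firstLeavesᵇ-graft-early (suc i) (suc j) t (c ∷ Y) (s≤s lt) (s≤s l2) = trans (cong (isLeafOᵇ c ∧_) (firstLeavesᵇ-graft-early i j t Y lt l2)) (∧-zeroʳ (isLeafOᵇ c))

firstLeavesᵇ-graft-late : ∀ i j t Y → i ≤ j → firstLeavesᵇ i (graft j t Y) ≡ firstLeavesᵇ i Y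
firstLeavesᵇ-graft-late zero j t Y _ = refl
firstLeavesᵇ-graft-late (suc i) (suc j) t [] _ = refl
firstLeavesᵇ-graft-late (suc i) (suc j) t (c ∷ Y) (s≤s le) = cong (isLeafOᵇ c ∧_) (firstLeavesᵇ-graft-late i j t Y le)

firstLeavesᵇ-replicate : ∀ i m → i ≤ m → firstLeavesᵇ i (replicate m (onode [])) ≡ true
firstLeavesᵇ-replicate zero m _ = refl
firstLeavesᵇ-replicate (suc i) (suc m) (s≤s le) = firstLeavesᵇ-replicate i m le

forestLabels≡labelsEs : ∀ F → forestLabels F ≡ labelsEs F
forestLabels≡labelsEs [] = refl
forestLabels≡labelsEs (t ∷ F) = cong (labels t ++_) (forestLabels≡labelsEs F)

labelsEs-++ : ∀ ts us → labelsEs (ts ++ us) ≡ labelsEs ts ++ labelsEs us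
labelsEs-++ [] us = refl
labelsEs-++ (t ∷ ts) us = trans (cong (labels t ++_) (labelsEs-++ ts us)) (sym (++-assoc (labels t) (labelsEs ts) (labelsEs us)))

IncEs-++ : ∀ ts us → IncEs ts → IncEs us → IncEs (ts ++ us)
IncEs-++ [] us _ q = q
IncEs-++ (t ∷ ts) us (p , p') q = p , IncEs-++ ts us p' q

AllAbove-∷ʳ : ∀ l ts t → AllAbove l ts → l < label t → AllAbove l (ts ++ t ∷ [])
AllAbove-∷ʳ l [] t _ lt = lt , tt
AllAbove-∷ʳ l (u ∷ ts) t (a , b) lt = a , AllAbove-∷ʳ l ts t b lt

Increasing-∷ʳ : ∀ xs y → Increasing xs → (∀ x → x ∈ xs → x < y) → Increasing (xs ++ y ∷ [])
Increasing-∷ʳ [] y _ _ = inc[x]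
Increasing-∷ʳ (x ∷ []) y _ lt = inc∷ (lt x (here refl)) inc[x]
Increasing-∷ʳ (x ∷ x' ∷ xs) y (inc∷ a b) lt = inc∷ a (Increasing-∷ʳ (x' ∷ xs) y b (λ z m → lt z (there m)))

roots⊆labelsEs : ∀ {x} ts → x ∈ map label ts → x ∈ labelsEs ts
roots⊆labelsEs (enode l cs ∷ ts) (here refl) = here refl
roots⊆labelsEs (t ∷ ts) (there m) = ∈-++⁺ʳ (labels t) (roots⊆labelsEs ts m)

IncOs-replicate : ∀ l i → IncOs l (replicate i (onode []))
IncOs-replicate l zero = tt
IncOs-replicate l (suc i) = tt , inc[] , tt , IncOs-replicate l i

AllTrees-++ : ∀ {P : ETree → Set} F G → AllTrees P F → AllTrees P G → AllTrees P (F ++ G)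
AllTrees-++ [] G _ q = q
AllTrees-++ (t ∷ F) G (p , p') q = p , AllTrees-++ F G p' q

forestLabels-++ : ∀ F G → forestLabels (F ++ G) ≡ forestLabels F ++ forestLabels G
forestLabels-++ F G = trans (forestLabels≡labelsEs (F ++ G)) (trans (labelsEs-++ F G) (sym (cong₂ _++_ (forestLabels≡labelsEs F) (forestLabels≡labelsEs G))))

roots-below : ∀ F n → (∀ x → x ∈ forestLabels F → x < n) → ∀ x → x ∈ map label F → x < n
roots-below (enode l cs ∷ F) n H x (here refl) = H x (here refl)
roots-below (t ∷ F) n H x (there mm) = roots-below F n (λ y my → H y (∈-++⁺ʳ (labels t) my)) x mm

collapse : List OTree → List OTree
collapse cs = if allLeavesᵇ cs then [] else cs

orElse : Maybe (ℕ × ℕ) → Maybe (ℕ × ℕ) → Maybe (ℕ × ℕ)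
orElse (just x) _ = just x
orElse nothing y = y

allLeavesᵇ⇒replicate : ∀ cs → allLeavesᵇ cs ≡ true → cs ≡ replicate (length cs) (onode [])
allLeavesᵇ⇒replicate [] _ = refl
allLeavesᵇ⇒replicate (onode [] ∷ cs) e = cong (onode [] ∷_) (allLeavesᵇ⇒replicate cs e)
allLeavesᵇ⇒replicate (onode (t ∷ ts) ∷ cs) ()

¬allLeavesᵇ⇒label : ∀ l cs → allLeavesᵇ cs ≡ false → IncOs l cs → Σ ℕ λ x → (l < x) × (x ∈ labelsOs cs)
¬allLeavesᵇ⇒label l [] () _
¬allLeavesᵇ⇒label l (onode [] ∷ cs) e (_ , _ , _ , ios) with ¬allLeavesᵇ⇒label l cs e ios
... | x , a , b = x , a , b
¬allLeavesᵇ⇒label l (onode (enode x cs' ∷ ts) ∷ cs) e ((a , _) , _) = x , a , here refl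

mutual
  mult-leaves : ∀ x T → mult x (leaves T) ≤ mult x (labels T)
  mult-leaves x (enode l []) = ≤-refl
  mult-leaves x (enode l (c ∷ cs)) = ≤-trans (mult-leavesOs x (c ∷ cs)) (mult-∷≤ x l (labelsOs (c ∷ cs)))

  mult-leavesOs : ∀ x cs → mult x (leavesOs cs) ≤ mult x (labelsOs cs)
  mult-leavesOs x [] = z≤n
  mult-leavesOs x (onode ts ∷ cs) rewrite mult-++ x (leavesEs ts) (leavesOs cs) | mult-++ x (labelsEs ts) (labelsOs cs) =
    +-mono-≤ (mult-leavesEs x ts) (mult-leavesOs x cs)

  mult-leavesEs : ∀ x ts → mult x (leavesEs ts) ≤ mult x (labelsEs ts)
  mult-leavesEs x [] = z≤n
  mult-leavesEs x (t ∷ ts) rewrite mult-++ x (leaves t) (leavesEs ts) | mult-++ x (labels t) (labelsEs ts) =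
    +-mono-≤ (mult-leaves x t) (mult-leavesEs x ts)

mult-properLeavesF : ∀ x F → mult x (properLeavesF F) ≤ mult x (forestLabels F)
mult-properLeavesF x [] = z≤n
mult-properLeavesF x (enode l cs ∷ F) rewrite mult-++ x (leavesOs cs) (properLeavesF F) | mult-++ x (l ∷ labelsOs cs) (forestLabels F) =
  +-mono-≤ (≤-trans (mult-leavesOs x cs) (mult-∷≤ x l (labelsOs cs))) (mult-properLeavesF x F)

FirstLeaves⇒firstLeavesᵇ : ∀ i cs → FirstLeaves i cs → firstLeavesᵇ i cs ≡ true
FirstLeaves⇒firstLeavesᵇ zero cs _ = refl
FirstLeaves⇒firstLeavesᵇ (suc i) (c ∷ cs) (refl , q) = FirstLeaves⇒firstLeavesᵇ i cs q

firstLeavesᵇ⇒FirstLeaves : ∀ i cs → firstLeavesᵇ i cs ≡ true → FirstLeaves i cs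
firstLeavesᵇ⇒FirstLeaves zero cs _ = tt
firstLeavesᵇ⇒FirstLeaves (suc i) [] ()
firstLeavesᵇ⇒FirstLeaves (suc i) (onode [] ∷ cs) e = refl , firstLeavesᵇ⇒FirstLeaves i cs e
firstLeavesᵇ⇒FirstLeaves (suc i) (onode (t ∷ ts) ∷ cs) ()

module PrunedForests (k : ℕ) where

  -- A direct description of the pruned even k-ary trees: every labelled node has no children
  -- or k children that are not all leaves.
  mutual
    Pruned : ETree → Set
    Pruned (enode l []) = ⊤
    Pruned (enode l (c ∷ cs)) = (length (c ∷ cs) ≡ k) × (allLeavesᵇ (c ∷ cs) ≡ false) × PrunedOs (c ∷ cs)

    PrunedOs : List OTree → Set
    PrunedOs [] = ⊤
    PrunedOs (onode ts ∷ cs) = PrunedEs ts × PrunedOs cs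

    PrunedEs : List ETree → Set
    PrunedEs [] = ⊤
    PrunedEs (t ∷ ts) = Pruned t × PrunedEs ts

  Pruned⇒PrunedOs : ∀ {l} cs → Pruned (enode l cs) → PrunedOs cs
  Pruned⇒PrunedOs [] _ = tt
  Pruned⇒PrunedOs (c ∷ cs) (_ , _ , q) = q

  AllTrees⇒PrunedEs : ∀ F → AllTrees Pruned F → PrunedEs F
  AllTrees⇒PrunedEs [] _ = tt
  AllTrees⇒PrunedEs (t ∷ F) (p , q) = p , AllTrees⇒PrunedEs F q

  PrunedEs⇒AllTrees : ∀ F → PrunedEs F → AllTrees Pruned F
  PrunedEs⇒AllTrees [] _ = tt
  PrunedEs⇒AllTrees (t ∷ F) (p , q) = p , PrunedEs⇒AllTrees F q

  mutual
    unprune : ETree → ETree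
    unprune (enode l []) = enode l (replicate k (onode []))
    unprune (enode l (c ∷ cs)) = enode l (unpruneOs (c ∷ cs))

    unpruneOs : List OTree → List OTree
    unpruneOs [] = []
    unpruneOs (onode ts ∷ cs) = onode (unpruneEs ts) ∷ unpruneOs cs

    unpruneEs : List ETree → List ETree
    unpruneEs [] = []
    unpruneEs (t ∷ ts) = unprune t ∷ unpruneEs ts

  length-unpruneOs : ∀ cs → length (unpruneOs cs) ≡ length cs
  length-unpruneOs [] = refl
  length-unpruneOs (onode ts ∷ cs) = cong suc (length-unpruneOs cs)

  isLeafOᵇ-unpruneEs : ∀ ts → isLeafOᵇ (onode (unpruneEs ts)) ≡ isLeafOᵇ (onode ts)
  isLeafOᵇ-unpruneEs [] = refl
  isLeafOᵇ-unpruneEs (t ∷ ts) = refl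

  allLeavesᵇ-unpruneOs : ∀ cs → allLeavesᵇ (unpruneOs cs) ≡ allLeavesᵇ cs
  allLeavesᵇ-unpruneOs [] = refl
  allLeavesᵇ-unpruneOs (onode ts ∷ cs) = cong₂ _∧_ (isLeafOᵇ-unpruneEs ts) (allLeavesᵇ-unpruneOs cs)

  EvenKaryOs-replicate : ∀ i → EvenKaryOs k (replicate i (onode []))
  EvenKaryOs-replicate zero = tt
  EvenKaryOs-replicate (suc i) = tt , EvenKaryOs-replicate i

  mutual
    unprune-EvenKary : ∀ T → Pruned T → EvenKary k (unprune T)
    unprune-EvenKary (enode l []) _ = length-replicate k , EvenKaryOs-replicate k
    unprune-EvenKary (enode l (c ∷ cs)) (len , _ , p) = trans (length-unpruneOs (c ∷ cs)) len , unpruneOs-EvenKary (c ∷ cs) p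

    unpruneOs-EvenKary : ∀ cs → PrunedOs cs → EvenKaryOs k (unpruneOs cs)
    unpruneOs-EvenKary [] _ = tt
    unpruneOs-EvenKary (onode ts ∷ cs) (p , q) = unpruneEs-EvenKary ts p , unpruneOs-EvenKary cs q

    unpruneEs-EvenKary : ∀ ts → PrunedEs ts → EvenKaryEs k (unpruneEs ts)
    unpruneEs-EvenKary [] _ = tt
    unpruneEs-EvenKary (t ∷ ts) (p , q) = unprune-EvenKary t p , unpruneEs-EvenKary ts q

  mutual
    prune-unprune : ∀ T → Pruned T → prune (unprune T) ≡ T
    prune-unprune (enode l []) _ = if-true (allLeavesᵇ-replicate k)
    prune-unprune (enode l (c ∷ cs)) (_ , al , p) = trans (if-false (trans (allLeavesᵇ-unpruneOs (c ∷ cs)) al)) (cong (enode l) (pruneOs-unpruneOs (c ∷ cs) p))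

    pruneOs-unpruneOs : ∀ cs → PrunedOs cs → pruneOs (unpruneOs cs) ≡ cs
    pruneOs-unpruneOs [] _ = refl
    pruneOs-unpruneOs (onode ts ∷ cs) (p , q) = cong₂ (λ a b → onode a ∷ b) (pruneEs-unpruneEs ts p) (pruneOs-unpruneOs cs q)

    pruneEs-unpruneEs : ∀ ts → PrunedEs ts → pruneEs (unpruneEs ts) ≡ ts
    pruneEs-unpruneEs [] _ = refl
    pruneEs-unpruneEs (t ∷ ts) (p , q) = cong₂ _∷_ (prune-unprune t p) (pruneEs-unpruneEs ts q)

  mutual
    prune-Pruned : ∀ T → EvenKary k T → Pruned (prune T)
    prune-Pruned (enode l cs) (len , ek) with allLeavesᵇ cs in eq
    ... | true = tt
    prune-Pruned (enode l []) (len , ek) | false with eq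
    ... | ()
    prune-Pruned (enode l (c ∷ cs)) (len , ek) | false with pruneOs (c ∷ cs) in e2 | length-pruneOs (c ∷ cs) | allLeavesᵇ-pruneOs (c ∷ cs) | pruneOs-Pruned (c ∷ cs) ek
    ... | c' ∷ cs' | l2 | a2 | p2 = trans l2 len , trans a2 eq , p2

    pruneOs-Pruned : ∀ cs → EvenKaryOs k cs → PrunedOs (pruneOs cs)
    pruneOs-Pruned [] _ = tt
    pruneOs-Pruned (onode ts ∷ cs) (p , q) = pruneEs-Pruned ts p , pruneOs-Pruned cs q

    pruneEs-Pruned : ∀ ts → EvenKaryEs k ts → PrunedEs (pruneEs ts)
    pruneEs-Pruned [] _ = tt
    pruneEs-Pruned (t ∷ ts) (p , q) = prune-Pruned t p , pruneEs-Pruned ts q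

  Pruned⇒IsPrunedEvenKary : ∀ T → Pruned T → IsPrunedEvenKary k T
  Pruned⇒IsPrunedEvenKary T p = unprune T , unprune-EvenKary T p , prune-unprune T p

  IsPrunedEvenKary⇒Pruned : ∀ T → IsPrunedEvenKary k T → Pruned T
  IsPrunedEvenKary⇒Pruned T (T' , ek , refl) = prune-Pruned T' ek

  -- A childless labelled node first receives k leaf children before n is grafted below it.
  expand : List OTree → List OTree
  expand [] = replicate k (onode [])
  expand (c ∷ cs) = c ∷ cs

  length-expand : ∀ {l} cs → Pruned (enode l cs) → length (expand cs) ≡ k
  length-expand [] _ = length-replicate k
  length-expand (c ∷ cs) (len , _) = len

  module Insert (v j n : ℕ) where
    nleaf = enode n []

    mutual
      ins : ETree → ETree
      ins (enode l cs) with l ≟ v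
      ... | yes _ = enode l (graft j nleaf (expand (insOs cs)))
      ... | no _ = enode l (insOs cs)

      insOs : List OTree → List OTree
      insOs [] = []
      insOs (onode ts ∷ cs) = onode (insEs ts) ∷ insOs cs

      insEs : List ETree → List ETree
      insEs [] = []
      insEs (t ∷ ts) = ins t ∷ insEs ts

    label-ins : ∀ T → label (ins T) ≡ label T
    label-ins (enode l cs) with l ≟ v
    ... | yes _ = refl
    ... | no _ = refl

  graftAt : ℕ → Site → Forest → Forest
  graftAt n newTree F = F ++ enode n [] ∷ []
  graftAt n (under v j) F = Insert.insEs v j n F

  leaves-expand : ∀ X → leavesOs (expand X) ≡ leavesOs X
  leaves-expand [] = lem k
    where lem : ∀ i → leavesOs (replicate i (onode [])) ≡ []
          lem zero = refl
          lem (suc i) = lem i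
  leaves-expand (c ∷ cs) = refl

  expand-nonempty : 1 ≤ k → ∀ X → expand X ≢ []
  expand-nonempty (s≤s z≤n) [] ()
  expand-nonempty _ (c ∷ cs) ()

  graft-expand-nonempty : 1 ≤ k → ∀ j t X → NonEmpty (graft j t (expand X))
  graft-expand-nonempty k≥1 j t X with expand X in e
  ... | [] = ⊥-elim (expand-nonempty k≥1 X e)
  graft-expand-nonempty k≥1 zero t X | onode ts ∷ cs = _ , _ , refl
  graft-expand-nonempty k≥1 (suc j) t X | c ∷ cs = _ , _ , refl

  module InsertLeaves (v j n : ℕ) (k≥1 : 1 ≤ k) (j<k : j < k) where
    open Insert v j n

    length-insOs : ∀ cs → length (insOs cs) ≡ length cs
    length-insOs [] = refl
    length-insOs (onode ts ∷ cs) = cong suc (length-insOs cs)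

    mutual
      leaves-ins⁻ : ∀ T x → x ∈ leaves (ins T) → x ≡ n ⊎ (x ∈ leaves T × x ≢ v)
      leaves-ins⁻ (enode l cs) x m with l ≟ v
      ... | yes refl with leaves-graft⁻ j nleaf (expand (insOs cs)) (subst (x ∈_) (leaves-nonempty l _ (graft-expand-nonempty k≥1 j nleaf (insOs cs))) m)
      ...   | inj₁ (here e) = inj₁ e
      ...   | inj₂ mm with leaves-insOs⁻ cs x (subst (x ∈_) (leaves-expand (insOs cs)) mm)
      ...     | inj₁ e = inj₁ e
      ...     | inj₂ (a , b) = inj₂ (leavesOs⊆leaves l cs a , b)
      leaves-ins⁻ (enode l []) x (here e) | no ne = inj₂ (here e , λ e' → ne (trans (sym e) e'))
      leaves-ins⁻ (enode l (onode ts ∷ cs)) x m | no ne with leaves-insOs⁻ (onode ts ∷ cs) x m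
      ... | inj₁ e = inj₁ e
      ... | inj₂ ab = inj₂ ab

      leaves-insOs⁻ : ∀ cs x → x ∈ leavesOs (insOs cs) → x ≡ n ⊎ (x ∈ leavesOs cs × x ≢ v)
      leaves-insOs⁻ (onode ts ∷ cs) x m with ∈-++⁻ (leavesEs (insEs ts)) m
      ... | inj₁ m1 with leaves-insEs⁻ ts x m1
      ...   | inj₁ e = inj₁ e
      ...   | inj₂ (a , b) = inj₂ (∈-++⁺ˡ a , b)
      leaves-insOs⁻ (onode ts ∷ cs) x m | inj₂ m2 with leaves-insOs⁻ cs x m2
      ...   | inj₁ e = inj₁ e
      ...   | inj₂ (a , b) = inj₂ (∈-++⁺ʳ (leavesEs ts) a , b)

      leaves-insEs⁻ : ∀ ts x → x ∈ leavesEs (insEs ts) → x ≡ n ⊎ (x ∈ leavesEs ts × x ≢ v)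
      leaves-insEs⁻ (t ∷ ts) x m with ∈-++⁻ (leaves (ins t)) m
      ... | inj₁ m1 with leaves-ins⁻ t x m1
      ...   | inj₁ e = inj₁ e
      ...   | inj₂ (a , b) = inj₂ (∈-++⁺ˡ a , b)
      leaves-insEs⁻ (t ∷ ts) x m | inj₂ m2 with leaves-insEs⁻ ts x m2
      ...   | inj₁ e = inj₁ e
      ...   | inj₂ (a , b) = inj₂ (∈-++⁺ʳ (leaves t) a , b)

    mutual
      leaves-ins⁺ : ∀ T x → x ∈ leaves T → x ≢ v → x ∈ leaves (ins T)
      leaves-ins⁺ (enode l cs) x m ne with l ≟ v
      leaves-ins⁺ (enode l []) x (here e) ne | yes refl = ⊥-elim (ne e)
      leaves-ins⁺ (enode l (c ∷ cs)) x m ne | yes refl =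
        subst (x ∈_) (sym (leaves-nonempty l _ (graft-expand-nonempty k≥1 j nleaf (insOs (c ∷ cs)))))
          (leaves-graft⁺ j nleaf (expand (insOs (c ∷ cs))) (subst (x ∈_) (sym (leaves-expand (insOs (c ∷ cs)))) (leaves-insOs⁺ (c ∷ cs) x m ne)))
      leaves-ins⁺ (enode l []) x m ne | no _ = m
      leaves-ins⁺ (enode l (onode ts ∷ cs)) x m ne | no _ = leaves-insOs⁺ (onode ts ∷ cs) x m ne

      leaves-insOs⁺ : ∀ cs x → x ∈ leavesOs cs → x ≢ v → x ∈ leavesOs (insOs cs)
      leaves-insOs⁺ (onode ts ∷ cs) x m ne with ∈-++⁻ (leavesEs ts) m
      ... | inj₁ m1 = ∈-++⁺ˡ (leaves-insEs⁺ ts x m1 ne)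
      ... | inj₂ m2 = ∈-++⁺ʳ (leavesEs (insEs ts)) (leaves-insOs⁺ cs x m2 ne)

      leaves-insEs⁺ : ∀ ts x → x ∈ leavesEs ts → x ≢ v → x ∈ leavesEs (insEs ts)
      leaves-insEs⁺ (t ∷ ts) x m ne with ∈-++⁻ (leaves t) m
      ... | inj₁ m1 = ∈-++⁺ˡ (leaves-ins⁺ t x m1 ne)
      ... | inj₂ m2 = ∈-++⁺ʳ (leaves (ins t)) (leaves-insEs⁺ ts x m2 ne)

    graft-here : ∀ cs → Pruned (enode v cs) → n ∈ leavesOs (graft j nleaf (expand (insOs cs)))
    graft-here [] _ = leaves-graft-new j nleaf (replicate k (onode [])) (subst (j <_) (sym (length-replicate k)) j<k) (here refl)
    graft-here (onode ts ∷ cs) (len , _ , _) = leaves-graft-new j nleaf (insOs (onode ts ∷ cs)) (subst (j <_) (sym (trans (length-insOs (onode ts ∷ cs)) len)) j<k) (here refl)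

    mutual
      leaves-ins-new : ∀ T → v ∈ labels T → Pruned T → n ∈ leaves (ins T)
      leaves-ins-new (enode l cs) m p with l ≟ v
      ... | yes refl = subst (n ∈_) (sym (leaves-nonempty l _ (graft-expand-nonempty k≥1 j nleaf (insOs cs)))) (graft-here cs p)
      leaves-ins-new (enode l []) (here e) p | no ne = ⊥-elim (ne (sym e))
      leaves-ins-new (enode l (c ∷ cs)) (here e) p | no ne = ⊥-elim (ne (sym e))
      leaves-ins-new (enode l (onode ts ∷ cs)) (there m) (_ , _ , p) | no ne = leaves-insOs-new (onode ts ∷ cs) m p

      leaves-insOs-new : ∀ cs → v ∈ labelsOs cs → PrunedOs cs → n ∈ leavesOs (insOs cs)
      leaves-insOs-new (onode ts ∷ cs) m (p , q) with ∈-++⁻ (labelsEs ts) m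
      ... | inj₁ m1 = ∈-++⁺ˡ (leaves-insEs-new ts m1 p)
      ... | inj₂ m2 = ∈-++⁺ʳ (leavesEs (insEs ts)) (leaves-insOs-new cs m2 q)

      leaves-insEs-new : ∀ ts → v ∈ labelsEs ts → PrunedEs ts → n ∈ leavesEs (insEs ts)
      leaves-insEs-new (t ∷ ts) m (p , q) with ∈-++⁻ (labels t) m
      ... | inj₁ m1 = ∈-++⁺ˡ (leaves-ins-new t m1 p)
      ... | inj₂ m2 = ∈-++⁺ʳ (leaves (ins t)) (leaves-insEs-new ts m2 q)

    properLeaves-ins⁻ : ∀ T x → x ∈ properLeaves (ins T) → x ≡ n ⊎ (x ∈ properLeaves T × x ≢ v)
    properLeaves-ins⁻ (enode l cs) x m with l ≟ v
    ... | yes refl with leaves-graft⁻ j nleaf (expand (insOs cs)) m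
    ...   | inj₁ (here e) = inj₁ e
    ...   | inj₂ mm = leaves-insOs⁻ cs x (subst (x ∈_) (leaves-expand (insOs cs)) mm)
    properLeaves-ins⁻ (enode l cs) x m | no _ = leaves-insOs⁻ cs x m

    properLeaves-ins⁺ : ∀ T x → x ∈ properLeaves T → x ≢ v → x ∈ properLeaves (ins T)
    properLeaves-ins⁺ (enode l cs) x m ne with l ≟ v
    ... | yes refl = leaves-graft⁺ j nleaf (expand (insOs cs)) (subst (x ∈_) (sym (leaves-expand (insOs cs))) (leaves-insOs⁺ cs x m ne))
    ... | no _ = leaves-insOs⁺ cs x m ne

    properLeaves-ins-new : ∀ T → v ∈ labels T → Pruned T → n ∈ properLeaves (ins T)
    properLeaves-ins-new (enode l cs) m p with l ≟ v
    ... | yes refl = graft-here cs p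
    properLeaves-ins-new (enode l []) (here e) p | no ne = ⊥-elim (ne (sym e))
    properLeaves-ins-new (enode l (c ∷ cs)) (here e) p | no ne = ⊥-elim (ne (sym e))
    properLeaves-ins-new (enode l (onode ts ∷ cs)) (there m) (_ , _ , p) | no ne = leaves-insOs-new (onode ts ∷ cs) m p

    properLeavesF-ins⁻ : ∀ F x → x ∈ properLeavesF (insEs F) → x ≡ n ⊎ (x ∈ properLeavesF F × x ≢ v)
    properLeavesF-ins⁻ (t ∷ F) x m with ∈-++⁻ (properLeaves (ins t)) m
    ... | inj₁ m1 with properLeaves-ins⁻ t x m1
    ...   | inj₁ e = inj₁ e
    ...   | inj₂ (a , b) = inj₂ (∈-++⁺ˡ a , b)
    properLeavesF-ins⁻ (t ∷ F) x m | inj₂ m2 with properLeavesF-ins⁻ F x m2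
    ...   | inj₁ e = inj₁ e
    ...   | inj₂ (a , b) = inj₂ (∈-++⁺ʳ (properLeaves t) a , b)

    properLeavesF-ins⁺ : ∀ F x → x ∈ properLeavesF F → x ≢ v → x ∈ properLeavesF (insEs F)
    properLeavesF-ins⁺ (t ∷ F) x m ne with ∈-++⁻ (properLeaves t) m
    ... | inj₁ m1 = ∈-++⁺ˡ (properLeaves-ins⁺ t x m1 ne)
    ... | inj₂ m2 = ∈-++⁺ʳ (properLeaves (ins t)) (properLeavesF-ins⁺ F x m2 ne)

    properLeavesF-ins-new : ∀ F → v ∈ forestLabels F → AllTrees Pruned F → n ∈ properLeavesF (insEs F)
    properLeavesF-ins-new (t ∷ F) m (p , q) with ∈-++⁻ (labels t) m
    ... | inj₁ m1 = ∈-++⁺ˡ (properLeaves-ins-new t m1 p)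
    ... | inj₂ m2 = ∈-++⁺ʳ (properLeaves (ins t)) (properLeavesF-ins-new F m2 q)

  rightmostOKᵇ : ETree → Bool
  rightmostOKᵇ (enode l []) = true
  rightmostOKᵇ (enode l (c ∷ cs)) = firstLeavesᵇ (k ∸ 1) (c ∷ cs)

  fbarᵇ : Forest → Bool
  fbarᵇ [] = false
  fbarᵇ (t ∷ []) = rightmostOKᵇ t
  fbarᵇ (t ∷ u ∷ ts) = fbarᵇ (u ∷ ts)

  fbarᵇ-newTree : ∀ n F → fbarᵇ (F ++ enode n [] ∷ []) ≡ true
  fbarᵇ-newTree n [] = refl
  fbarᵇ-newTree n (t ∷ []) = refl
  fbarᵇ-newTree n (t ∷ u ∷ F) = fbarᵇ-newTree n (u ∷ F)

  rightmostOKᵇ-nonempty : ∀ l X → NonEmpty X → rightmostOKᵇ (enode l X) ≡ firstLeavesᵇ (k ∸ 1) X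
  rightmostOKᵇ-nonempty l X (c , cs , refl) = refl

  module InsertRightmost (v j n : ℕ) (k≥1 : 1 ≤ k) (j<k : j < k) where
    open Insert v j n
    open InsertLeaves v j n k≥1 j<k

    firstLeavesᵇ-insOs : ∀ i cs → firstLeavesᵇ i (insOs cs) ≡ firstLeavesᵇ i cs
    firstLeavesᵇ-insOs zero cs = refl
    firstLeavesᵇ-insOs (suc i) [] = refl
    firstLeavesᵇ-insOs (suc i) (onode [] ∷ cs) = firstLeavesᵇ-insOs i cs
    firstLeavesᵇ-insOs (suc i) (onode (t ∷ ts) ∷ cs) = refl

    rightmostOKᵇ-other : ∀ T → label T ≢ v → rightmostOKᵇ (ins T) ≡ rightmostOKᵇ T
    rightmostOKᵇ-other (enode l cs) ne with l ≟ v
    ... | yes e = ⊥-elim (ne e)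
    rightmostOKᵇ-other (enode l []) ne | no _ = refl
    rightmostOKᵇ-other (enode l (onode ts ∷ cs)) ne | no _ = firstLeavesᵇ-insOs (k ∸ 1) (onode ts ∷ cs)

    rightmostOKᵇ-early : ∀ T → label T ≡ v → j < k ∸ 1 → Pruned T → rightmostOKᵇ (ins T) ≡ false
    rightmostOKᵇ-early (enode l cs) e lt p with l ≟ v
    ... | no ne = ⊥-elim (ne e)
    ... | yes refl = trans (rightmostOKᵇ-nonempty l _ (graft-expand-nonempty k≥1 j nleaf (insOs cs))) (firstLeavesᵇ-graft-early (k ∸ 1) j nleaf (expand (insOs cs)) lt (lenX cs p))
      where lenX : ∀ cs → Pruned (enode l cs) → j < length (expand (insOs cs))
            lenX [] _ = subst (j <_) (sym (length-replicate k)) j<k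
            lenX (onode ts ∷ cs) (len , _) = subst (j <_) (sym (trans (length-insOs (onode ts ∷ cs)) len)) j<k

    rightmostOKᵇ-last : ∀ T → label T ≡ v → j ≡ k ∸ 1 → rightmostOKᵇ (ins T) ≡ rightmostOKᵇ T
    rightmostOKᵇ-last (enode l cs) e je with l ≟ v
    ... | no ne = ⊥-elim (ne e)
    ... | yes refl = trans (rightmostOKᵇ-nonempty l _ (graft-expand-nonempty k≥1 j nleaf (insOs cs)))
                       (trans (firstLeavesᵇ-graft-late (k ∸ 1) j nleaf (expand (insOs cs)) (≤-reflexive (sym je))) (lem cs))
      where lem : ∀ cs → firstLeavesᵇ (k ∸ 1) (expand (insOs cs)) ≡ rightmostOKᵇ (enode l cs)
            lem [] = firstLeavesᵇ-replicate (k ∸ 1) k (m∸n≤m k 1)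
            lem (onode ts ∷ cs) = firstLeavesᵇ-insOs (k ∸ 1) (onode ts ∷ cs)

    lastRoot-insEs : ∀ F → lastRoot (insEs F) ≡ lastRoot F
    lastRoot-insEs [] = refl
    lastRoot-insEs (t ∷ []) = label-ins t
    lastRoot-insEs (t ∷ u ∷ F) = lastRoot-insEs (u ∷ F)

    fbarᵇ-other : ∀ F → lastRoot F ≢ v → fbarᵇ (insEs F) ≡ fbarᵇ F
    fbarᵇ-other [] _ = refl
    fbarᵇ-other (t ∷ []) ne = rightmostOKᵇ-other t ne
    fbarᵇ-other (t ∷ u ∷ F) ne = fbarᵇ-other (u ∷ F) ne

    fbarᵇ-early : ∀ F → lastRoot F ≡ v → j < k ∸ 1 → AllTrees Pruned F → fbarᵇ (insEs F) ≡ false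
    fbarᵇ-early [] _ _ _ = refl
    fbarᵇ-early (t ∷ []) e lt (p , _) = rightmostOKᵇ-early t e lt p
    fbarᵇ-early (t ∷ u ∷ F) e lt (_ , q) = fbarᵇ-early (u ∷ F) e lt q

    fbarᵇ-last : ∀ F → lastRoot F ≡ v → j ≡ k ∸ 1 → fbarᵇ (insEs F) ≡ fbarᵇ F
    fbarᵇ-last [] _ _ = refl
    fbarᵇ-last (t ∷ []) e je = rightmostOKᵇ-last t e je
    fbarᵇ-last (t ∷ u ∷ F) e je = fbarᵇ-last (u ∷ F) e je

  record ForestOn (m : ℕ) (F : Forest) : Set where
    field
      pruned : AllTrees Pruned F
      increasing : AllTrees IncE F
      labels↭ : forestLabels F ↭ range m
      rootsIncreasing : Increasing (map label F)

  PrunedEs-++ : ∀ ts us → PrunedEs ts → PrunedEs us → PrunedEs (ts ++ us)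
  PrunedEs-++ [] us _ q = q
  PrunedEs-++ (t ∷ ts) us (p , p') q = p , PrunedEs-++ ts us p' q

  Pruned-nonempty : ∀ l X → NonEmpty X → length X ≡ k → allLeavesᵇ X ≡ false → PrunedOs X → Pruned (enode l X)
  Pruned-nonempty l X (c , cs , refl) a b d = a , b , d

  labelsOs-expand : ∀ X → labelsOs (expand X) ≡ labelsOs X
  labelsOs-expand [] = lem k
    where lem : ∀ i → labelsOs (replicate i (onode [])) ≡ []
          lem zero = refl
          lem (suc i) = lem i
  labelsOs-expand (c ∷ cs) = refl

  PrunedOs-replicate : ∀ i → PrunedOs (replicate i (onode []))
  PrunedOs-replicate zero = tt
  PrunedOs-replicate (suc i) = tt , PrunedOs-replicate i

  module InsertValid (v j n : ℕ) (k≥1 : 1 ≤ k) (j<k : j < k) where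
    open Insert v j n
    open InsertLeaves v j n k≥1 j<k

    roots-insEs : ∀ ts → map label (insEs ts) ≡ map label ts
    roots-insEs [] = refl
    roots-insEs (t ∷ ts) = cong₂ _∷_ (label-ins t) (roots-insEs ts)

    allLeavesᵇ-insOs : ∀ cs → allLeavesᵇ (insOs cs) ≡ allLeavesᵇ cs
    allLeavesᵇ-insOs [] = refl
    allLeavesᵇ-insOs (onode [] ∷ cs) = allLeavesᵇ-insOs cs
    allLeavesᵇ-insOs (onode (t ∷ ts) ∷ cs) = refl

    allLeavesᵇ-graft : ∀ j' X → j' < length X → allLeavesᵇ (graft j' nleaf X) ≡ false
    allLeavesᵇ-graft zero (onode [] ∷ cs) _ = refl
    allLeavesᵇ-graft zero (onode (u ∷ ts) ∷ cs) _ = refl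
    allLeavesᵇ-graft (suc j') (c ∷ cs) (s≤s lt) = trans (cong (isLeafOᵇ c ∧_) (allLeavesᵇ-graft j' cs lt)) (∧-zeroʳ (isLeafOᵇ c))

    PrunedOs-graft : ∀ j' X → PrunedOs X → PrunedOs (graft j' nleaf X)
    PrunedOs-graft j' [] _ = tt
    PrunedOs-graft zero (onode ts ∷ cs) (p , q) = PrunedEs-++ ts (nleaf ∷ []) p (tt , tt) , q
    PrunedOs-graft (suc j') (onode ts ∷ cs) (p , q) = p , PrunedOs-graft j' cs q

    length-expand-insOs : ∀ l cs → Pruned (enode l cs) → length (expand (insOs cs)) ≡ k
    length-expand-insOs l [] _ = length-replicate k
    length-expand-insOs l (onode ts ∷ cs) (len , _) = trans (length-insOs (onode ts ∷ cs)) len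

    mutual
      Pruned-ins : ∀ T → Pruned T → Pruned (ins T)
      Pruned-ins (enode l cs) p with l ≟ v
      ... | yes _ = Pruned-nonempty l _ (graft-expand-nonempty k≥1 j nleaf (insOs cs))
                      (trans (length-graft j nleaf (expand (insOs cs))) (length-expand-insOs l cs p))
                      (allLeavesᵇ-graft j (expand (insOs cs)) (subst (j <_) (sym (length-expand-insOs l cs p)) j<k))
                      (PrunedOs-graft j (expand (insOs cs)) (exp-PT cs p))
        where exp-PT : ∀ cs → Pruned (enode l cs) → PrunedOs (expand (insOs cs))
              exp-PT [] _ = PrunedOs-replicate k
              exp-PT (onode ts ∷ cs) (_ , _ , q) = PrunedOs-insOs (onode ts ∷ cs) q
      Pruned-ins (enode l []) p | no _ = tt
      Pruned-ins (enode l (onode ts ∷ cs)) (len , al , q) | no _ =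
        trans (length-insOs (onode ts ∷ cs)) len , trans (allLeavesᵇ-insOs (onode ts ∷ cs)) al , PrunedOs-insOs (onode ts ∷ cs) q

      PrunedOs-insOs : ∀ cs → PrunedOs cs → PrunedOs (insOs cs)
      PrunedOs-insOs [] _ = tt
      PrunedOs-insOs (onode ts ∷ cs) (p , q) = PrunedEs-insEs ts p , PrunedOs-insOs cs q

      PrunedEs-insEs : ∀ ts → PrunedEs ts → PrunedEs (insEs ts)
      PrunedEs-insEs [] _ = tt
      PrunedEs-insEs (t ∷ ts) (p , q) = Pruned-ins t p , PrunedEs-insEs ts q

    AllAbove-insEs : ∀ l ts → AllAbove l ts → AllAbove l (insEs ts)
    AllAbove-insEs l [] _ = tt
    AllAbove-insEs l (t ∷ ts) (a , b) = subst (l <_) (sym (label-ins t)) a , AllAbove-insEs l ts b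

    IncOs-graft : ∀ l j' X → l < n → (∀ x → x ∈ labelsOs X → x < n) → IncOs l X → IncOs l (graft j' nleaf X)
    IncOs-graft l j' [] _ _ _ = tt
    IncOs-graft l zero (onode ts ∷ cs) ln H (aa , inc , ies , ios) =
      AllAbove-∷ʳ l ts nleaf aa ln ,
      subst Increasing (sym (map-++ label ts (nleaf ∷ []))) (Increasing-∷ʳ (map label ts) n inc (λ x m → H x (∈-++⁺ˡ (roots⊆labelsEs ts m)))) ,
      IncEs-++ ts (nleaf ∷ []) ies (tt , tt) , ios
    IncOs-graft l (suc j') (onode ts ∷ cs) ln H (aa , inc , ies , ios) =
      aa , inc , ies , IncOs-graft l j' cs ln (λ x m → H x (∈-++⁺ʳ (labelsEs ts) m)) ios

    mutual
      labels-ins⊆ : ∀ {x} T → x ∈ labels (ins T) → x ≡ n ⊎ x ∈ labels T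
      labels-ins⊆ (enode l cs) m with l ≟ v
      labels-ins⊆ (enode l cs) (here e) | yes _ = inj₂ (here e)
      labels-ins⊆ (enode l cs) (there m) | yes _ with labelsOs-graft⊆ j (expand (insOs cs)) m
      ... | inj₁ e = inj₁ e
      ... | inj₂ m' with labelsOs-insOs⊆ cs (subst (_ ∈_) (labelsOs-expand (insOs cs)) m')
      ...   | inj₁ e = inj₁ e
      ...   | inj₂ m'' = inj₂ (there m'')
      labels-ins⊆ (enode l cs) (here e) | no _ = inj₂ (here e)
      labels-ins⊆ (enode l cs) (there m) | no _ with labelsOs-insOs⊆ cs m
      ... | inj₁ e = inj₁ e
      ... | inj₂ m' = inj₂ (there m')

      labelsOs-insOs⊆ : ∀ {x} cs → x ∈ labelsOs (insOs cs) → x ≡ n ⊎ x ∈ labelsOs cs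
      labelsOs-insOs⊆ (onode ts ∷ cs) m with ∈-++⁻ (labelsEs (insEs ts)) m
      ... | inj₁ m1 with labelsEs-insEs⊆ ts m1
      ...   | inj₁ e = inj₁ e
      ...   | inj₂ m' = inj₂ (∈-++⁺ˡ m')
      labelsOs-insOs⊆ (onode ts ∷ cs) m | inj₂ m2 with labelsOs-insOs⊆ cs m2
      ...   | inj₁ e = inj₁ e
      ...   | inj₂ m' = inj₂ (∈-++⁺ʳ (labelsEs ts) m')

      labelsEs-insEs⊆ : ∀ {x} ts → x ∈ labelsEs (insEs ts) → x ≡ n ⊎ x ∈ labelsEs ts
      labelsEs-insEs⊆ (t ∷ ts) m with ∈-++⁻ (labels (ins t)) m
      ... | inj₁ m1 with labels-ins⊆ t m1
      ...   | inj₁ e = inj₁ e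
      ...   | inj₂ m' = inj₂ (∈-++⁺ˡ m')
      labelsEs-insEs⊆ (t ∷ ts) m | inj₂ m2 with labelsEs-insEs⊆ ts m2
      ...   | inj₁ e = inj₁ e
      ...   | inj₂ m' = inj₂ (∈-++⁺ʳ (labels t) m')

      labelsOs-graft⊆ : ∀ {x} j' X → x ∈ labelsOs (graft j' nleaf X) → x ≡ n ⊎ x ∈ labelsOs X
      labelsOs-graft⊆ j' [] ()
      labelsOs-graft⊆ {x} zero (onode ts ∷ cs) m with ∈-++⁻ (labelsEs (ts ++ nleaf ∷ [])) m
      ... | inj₂ m2 = inj₂ (∈-++⁺ʳ (labelsEs ts) m2)
      ... | inj₁ m1 with ∈-++⁻ (labelsEs ts) (subst (x ∈_) (labelsEs-++ ts (nleaf ∷ [])) m1)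
      ...   | inj₁ m' = inj₂ (∈-++⁺ˡ m')
      ...   | inj₂ (here e) = inj₁ e
      labelsOs-graft⊆ (suc j') (onode ts ∷ cs) m with ∈-++⁻ (labelsEs ts) m
      ... | inj₁ m1 = inj₂ (∈-++⁺ˡ m1)
      ... | inj₂ m2 with labelsOs-graft⊆ j' cs m2
      ...   | inj₁ e = inj₁ e
      ...   | inj₂ m' = inj₂ (∈-++⁺ʳ (labelsEs ts) m')

    mutual
      ins-∉ : ∀ T → v ∉ labels T → ins T ≡ T
      ins-∉ (enode l cs) nm with l ≟ v
      ... | yes e = ⊥-elim (nm (here (sym e)))
      ... | no _ = cong (enode l) (insOs-∉ cs (λ m → nm (there m)))

      insOs-∉ : ∀ cs → v ∉ labelsOs cs → insOs cs ≡ cs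
      insOs-∉ [] _ = refl
      insOs-∉ (onode ts ∷ cs) nm = cong₂ (λ a b → onode a ∷ b) (insEs-∉ ts (λ m → nm (∈-++⁺ˡ m))) (insOs-∉ cs (λ m → nm (∈-++⁺ʳ (labelsEs ts) m)))

      insEs-∉ : ∀ ts → v ∉ labelsEs ts → insEs ts ≡ ts
      insEs-∉ [] _ = refl
      insEs-∉ (t ∷ ts) nm = cong₂ _∷_ (ins-∉ t (λ m → nm (∈-++⁺ˡ m))) (insEs-∉ ts (λ m → nm (∈-++⁺ʳ (labels t) m)))

    IncOs-expand : ∀ l X → IncOs l X → IncOs l (expand X)
    IncOs-expand l [] _ = IncOs-replicate l k
    IncOs-expand l (c ∷ cs) p = p

    mutual
      IncE-ins : ∀ T → (∀ x → x ∈ labels T → x < n) → Distinct (labels T) → IncE T → IncE (ins T)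
      IncE-ins (enode l cs) H U p with l ≟ v
      ... | yes refl = subst (λ z → IncOs l (graft j nleaf (expand z))) (sym (insOs-∉ cs (Distinct-head∉ {l} {labelsOs cs} U)))
                         (IncOs-graft l j (expand cs) (H l (here refl)) (λ x m → H x (there (subst (x ∈_) (labelsOs-expand cs) m))) (IncOs-expand l cs p))
      ... | no _ = IncOs-insOs l cs (λ x m → H x (there m)) (Distinct-tail {l} U) p

      IncOs-insOs : ∀ l cs → (∀ x → x ∈ labelsOs cs → x < n) → Distinct (labelsOs cs) → IncOs l cs → IncOs l (insOs cs)
      IncOs-insOs l [] _ _ _ = tt
      IncOs-insOs l (onode ts ∷ cs) H U (aa , inc , ies , ios) =
        AllAbove-insEs l ts aa , subst Increasing (sym (roots-insEs ts)) inc ,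
        IncEs-insEs ts (λ x m → H x (∈-++⁺ˡ m)) (Distinct-++ˡ (labelsEs ts) (labelsOs cs) U) ies ,
        IncOs-insOs l cs (λ x m → H x (∈-++⁺ʳ (labelsEs ts) m)) (Distinct-++ʳ (labelsEs ts) (labelsOs cs) U) ios

      IncEs-insEs : ∀ ts → (∀ x → x ∈ labelsEs ts → x < n) → Distinct (labelsEs ts) → IncEs ts → IncEs (insEs ts)
      IncEs-insEs [] _ _ _ = tt
      IncEs-insEs (t ∷ ts) H U (p , q) =
        IncE-ins t (λ x m → H x (∈-++⁺ˡ m)) (Distinct-++ˡ (labels t) (labelsEs ts) U) p ,
        IncEs-insEs ts (λ x m → H x (∈-++⁺ʳ (labels t) m)) (Distinct-++ʳ (labels t) (labelsEs ts) U) q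

    labelsOs-graft-↭ : ∀ j' X → j' < length X → labelsOs (graft j' nleaf X) ↭ n ∷ labelsOs X
    labelsOs-graft-↭ zero (onode ts ∷ cs) _ =
      Perm.↭-trans (Perm.↭-reflexive (trans (cong (_++ labelsOs cs) (labelsEs-++ ts (nleaf ∷ []))) (++-assoc (labelsEs ts) (n ∷ []) (labelsOs cs))))
        (PermP.shift n (labelsEs ts) (labelsOs cs))
    labelsOs-graft-↭ (suc j') (onode ts ∷ cs) (s≤s lt) =
      Perm.↭-trans (PermP.++⁺ˡ (labelsEs ts) (labelsOs-graft-↭ j' cs lt)) (PermP.shift n (labelsEs ts) (labelsOs cs))

    mutual
      labels-ins-↭ : ∀ T → v ∈ labels T → Distinct (labels T) → Pruned T → labels (ins T) ↭ n ∷ labels T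
      labels-ins-↭ (enode l cs) m U p with l ≟ v
      ... | yes refl = subst (λ z → l ∷ labelsOs (graft j nleaf (expand z)) ↭ n ∷ l ∷ labelsOs cs) (sym (insOs-∉ cs (Distinct-head∉ {l} {labelsOs cs} U)))
                         (Perm.↭-trans (Perm.prep l (Perm.↭-trans (labelsOs-graft-↭ j (expand cs) jl) (Perm.↭-reflexive (cong (n ∷_) (labelsOs-expand cs)))))
                           (Perm.swap l n Perm.refl))
        where jl : j < length (expand cs)
              jl = subst (j <_) (sym (length-expand cs p)) j<k
      labels-ins-↭ (enode l cs) (here e) U p | no ne = ⊥-elim (ne (sym e))
      labels-ins-↭ (enode l (c ∷ cs)) (there m) U (_ , _ , p) | no ne =
        Perm.↭-trans (Perm.prep l (labelsOs-insOs-↭ (c ∷ cs) m (Distinct-tail {l} U) p)) (Perm.swap l n Perm.refl)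

      labelsOs-insOs-↭ : ∀ cs → v ∈ labelsOs cs → Distinct (labelsOs cs) → PrunedOs cs → labelsOs (insOs cs) ↭ n ∷ labelsOs cs
      labelsOs-insOs-↭ (onode ts ∷ cs) m U (p , q) with ∈-++⁻ (labelsEs ts) m
      ... | inj₁ m1 = subst (λ z → labelsEs (insEs ts) ++ labelsOs z ↭ n ∷ labelsEs ts ++ labelsOs cs) (sym (insOs-∉ cs (Distinct-++-disjoint (labelsEs ts) (labelsOs cs) U m1)))
                        (PermP.++⁺ʳ (labelsOs cs) (labelsEs-insEs-↭ ts m1 (Distinct-++ˡ (labelsEs ts) (labelsOs cs) U) p))
      ... | inj₂ m2 = subst (λ z → labelsEs z ++ labelsOs (insOs cs) ↭ n ∷ labelsEs ts ++ labelsOs cs) (sym (insEs-∉ ts (λ mm → Distinct-++-disjoint (labelsEs ts) (labelsOs cs) U mm m2)))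
                        (Perm.↭-trans (PermP.++⁺ˡ (labelsEs ts) (labelsOs-insOs-↭ cs m2 (Distinct-++ʳ (labelsEs ts) (labelsOs cs) U) q)) (PermP.shift n (labelsEs ts) (labelsOs cs)))

      labelsEs-insEs-↭ : ∀ ts → v ∈ labelsEs ts → Distinct (labelsEs ts) → PrunedEs ts → labelsEs (insEs ts) ↭ n ∷ labelsEs ts
      labelsEs-insEs-↭ (t ∷ ts) m U (p , q) with ∈-++⁻ (labels t) m
      ... | inj₁ m1 = subst (λ z → labels (ins t) ++ labelsEs z ↭ n ∷ labels t ++ labelsEs ts) (sym (insEs-∉ ts (Distinct-++-disjoint (labels t) (labelsEs ts) U m1)))
                        (PermP.++⁺ʳ (labelsEs ts) (labels-ins-↭ t m1 (Distinct-++ˡ (labels t) (labelsEs ts) U) p))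
      ... | inj₂ m2 = subst (λ z → labels z ++ labelsEs (insEs ts) ↭ n ∷ labels t ++ labelsEs ts) (sym (ins-∉ t (λ mm → Distinct-++-disjoint (labels t) (labelsEs ts) U mm m2)))
                        (Perm.↭-trans (PermP.++⁺ˡ (labels t) (labelsEs-insEs-↭ ts m2 (Distinct-++ʳ (labels t) (labelsEs ts) U) q)) (PermP.shift n (labels t) (labelsEs ts)))

  module ForestOnProps (m : ℕ) (F : Forest) (V : ForestOn m F) where
    open ForestOn V
    bound : ∀ x → x ∈ forestLabels F → 1 ≤ x × x ≤ m
    bound x mm = ∈-range⁻ m (∈-resp-↭ labels↭ mm)

    U : Distinct (forestLabels F)
    U = Distinct-↭ labels↭ (Distinct-range m)

  ForestOn-newTree : ∀ m F → ForestOn m F → ForestOn (suc m) (F ++ enode (suc m) [] ∷ [])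
  ForestOn-newTree m F V = record
    { pruned = AllTrees-++ F _ (ForestOn.pruned V) (tt , tt)
    ; increasing = AllTrees-++ F _ (ForestOn.increasing V) (tt , tt)
    ; labels↭ = Perm.↭-trans (Perm.↭-reflexive (forestLabels-++ F (enode (suc m) [] ∷ [])))
               (Perm.↭-trans (PermP.++-comm (forestLabels F) (suc m ∷ []))
                 (Perm.↭-trans (Perm.prep (suc m) (ForestOn.labels↭ V)) (range-suc-↭ m)))
    ; rootsIncreasing = subst Increasing (sym (map-++ label F (enode (suc m) [] ∷ [])))
                (Increasing-∷ʳ (map label F) (suc m) (ForestOn.rootsIncreasing V) (roots-below F (suc m) (λ x mm → s≤s (proj₂ (ForestOnProps.bound m F V x mm)))))
    }

  module InsertForest (m v j : ℕ) (k≥1 : 1 ≤ k) (j<k : j < k) where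
    n = suc m
    open Insert v j n
    open InsertLeaves v j n k≥1 j<k
    open InsertValid v j n k≥1 j<k

    AllTrees-Pruned-insEs : ∀ F → AllTrees Pruned F → AllTrees Pruned (insEs F)
    AllTrees-Pruned-insEs [] _ = tt
    AllTrees-Pruned-insEs (t ∷ F) (p , q) = Pruned-ins t p , AllTrees-Pruned-insEs F q

    AllTrees-IncE-insEs : ∀ F → (∀ x → x ∈ forestLabels F → x < n) → Distinct (forestLabels F) → AllTrees IncE F → AllTrees IncE (insEs F)
    AllTrees-IncE-insEs [] _ _ _ = tt
    AllTrees-IncE-insEs (t ∷ F) H U (p , q) = IncE-ins t (λ x mm → H x (∈-++⁺ˡ mm)) (Distinct-++ˡ (labels t) (forestLabels F) U) p ,
                                AllTrees-IncE-insEs F (λ x mm → H x (∈-++⁺ʳ (labels t) mm)) (Distinct-++ʳ (labels t) (forestLabels F) U) q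

    ForestOn-under : ∀ F → ForestOn m F → 1 ≤ v → v ≤ m → ForestOn n (insEs F)
    ForestOn-under F V a b = record
      { pruned = AllTrees-Pruned-insEs F (ForestOn.pruned V)
      ; increasing = AllTrees-IncE-insEs F (λ x mm → s≤s (proj₂ (ForestOnProps.bound m F V x mm))) (ForestOnProps.U m F V) (ForestOn.increasing V)
      ; labels↭ = Perm.↭-trans (Perm.↭-reflexive (forestLabels≡labelsEs (insEs F)))
                 (Perm.↭-trans (labelsEs-insEs-↭ F (subst (v ∈_) (forestLabels≡labelsEs F) vin) (subst Distinct (forestLabels≡labelsEs F) (ForestOnProps.U m F V)) (AllTrees⇒PrunedEs F (ForestOn.pruned V)))
                   (Perm.↭-trans (Perm.prep n (Perm.↭-trans (Perm.↭-reflexive (sym (forestLabels≡labelsEs F))) (ForestOn.labels↭ V))) (range-suc-↭ m)))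
      ; rootsIncreasing = subst Increasing (sym (roots-insEs F)) (ForestOn.rootsIncreasing V)
      }
      where vin : v ∈ forestLabels F
            vin = ∈-resp-↭ (Perm.↭-sym (ForestOn.labels↭ V)) (∈-range⁺ m a b)

  module Delete (n : ℕ) where
    mutual
      del : ETree → ETree
      del (enode l cs) = enode l (collapse (delOs cs))

      delOs : List OTree → List OTree
      delOs [] = []
      delOs (onode ts ∷ cs) = onode (delEs ts) ∷ delOs cs

      delEs : List ETree → List ETree
      delEs [] = []
      delEs (t ∷ ts) with label t ≟ n
      ... | yes _ = delEs ts
      ... | no _ = del t ∷ delEs ts

    hasLabelᵇ : List ℕ → Bool
    hasLabelᵇ [] = false
    hasLabelᵇ (x ∷ xs) with x ≟ n
    ... | yes _ = true
    ... | no _ = hasLabelᵇ xs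

    hasRootᵇ : List ETree → Bool
    hasRootᵇ ts = hasLabelᵇ (map label ts)

    mutual
      site : ETree → Maybe (ℕ × ℕ)
      site (enode l cs) = siteOs l 0 cs

      siteOs : ℕ → ℕ → List OTree → Maybe (ℕ × ℕ)
      siteOs l i [] = nothing
      siteOs l i (onode ts ∷ cs) with hasRootᵇ ts
      ... | true = just (l , i)
      ... | false = orElse (siteEs ts) (siteOs l (suc i) cs)

      siteEs : List ETree → Maybe (ℕ × ℕ)
      siteEs [] = nothing
      siteEs (t ∷ ts) = orElse (site t) (siteEs ts)

    toSite : Maybe (ℕ × ℕ) → Site
    toSite nothing = newTree
    toSite (just (v , j)) = under v j

    siteF : Forest → Site
    siteF F = toSite (siteEs F)

    collapse-Pruned : ∀ l cs → Pruned (enode l cs) → collapse cs ≡ cs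
    collapse-Pruned l [] _ = refl
    collapse-Pruned l (c ∷ cs) (_ , al , _) = if-false al

    mutual
      del-∉ : ∀ T → n ∉ labels T → Pruned T → del T ≡ T
      del-∉ (enode l cs) nm p = cong (enode l) (trans (cong collapse (delOs-∉ cs (λ mm → nm (there mm)) (Pruned⇒PrunedOs cs p))) (collapse-Pruned l cs p))

      delOs-∉ : ∀ cs → n ∉ labelsOs cs → PrunedOs cs → delOs cs ≡ cs
      delOs-∉ [] _ _ = refl
      delOs-∉ (onode ts ∷ cs) nm (p , q) = cong₂ (λ a b → onode a ∷ b) (delEs-∉ ts (λ mm → nm (∈-++⁺ˡ mm)) p) (delOs-∉ cs (λ mm → nm (∈-++⁺ʳ (labelsEs ts) mm)) q)

      delEs-∉ : ∀ ts → n ∉ labelsEs ts → PrunedEs ts → delEs ts ≡ ts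
      delEs-∉ [] _ _ = refl
      delEs-∉ (t ∷ ts) nm (p , q) with label t ≟ n
      ... | yes e = ⊥-elim (nm (∈-++⁺ˡ (subst (_∈ labels t) e (lab∈ t))))
        where lab∈ : ∀ t → label t ∈ labels t
              lab∈ (enode l cs) = here refl
      ... | no _ = cong₂ _∷_ (del-∉ t (λ mm → nm (∈-++⁺ˡ mm)) p) (delEs-∉ ts (λ mm → nm (∈-++⁺ʳ (labels t) mm)) q)

    hasRootᵇ-∉ : ∀ ts → n ∉ labelsEs ts → hasRootᵇ ts ≡ false
    hasRootᵇ-∉ [] _ = refl
    hasRootᵇ-∉ (t ∷ ts) nm with label t ≟ n
    ... | yes e = ⊥-elim (nm (∈-++⁺ˡ (subst (_∈ labels t) e (label∈labels t))))
    ... | no _ = hasRootᵇ-∉ ts (λ mm → nm (∈-++⁺ʳ (labels t) mm))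

    hasLabelᵇ-∷ʳ : ∀ xs → hasLabelᵇ (xs ++ n ∷ []) ≡ true
    hasLabelᵇ-∷ʳ [] with n ≟ n
    ... | yes _ = refl
    ... | no ne = ⊥-elim (ne refl)
    hasLabelᵇ-∷ʳ (x ∷ xs) with x ≟ n
    ... | yes _ = refl
    ... | no _ = hasLabelᵇ-∷ʳ xs

    mutual
      site-∉ : ∀ T → n ∉ labels T → site T ≡ nothing
      site-∉ (enode l cs) nm = siteOs-∉ l 0 cs (λ mm → nm (there mm))

      siteOs-∉ : ∀ l i cs → n ∉ labelsOs cs → siteOs l i cs ≡ nothing
      siteOs-∉ l i [] _ = refl
      siteOs-∉ l i (onode ts ∷ cs) nm rewrite hasRootᵇ-∉ ts (λ mm → nm (∈-++⁺ˡ mm))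
        | siteEs-∉ ts (λ mm → nm (∈-++⁺ˡ mm)) = siteOs-∉ l (suc i) cs (λ mm → nm (∈-++⁺ʳ (labelsEs ts) mm))

      siteEs-∉ : ∀ ts → n ∉ labelsEs ts → siteEs ts ≡ nothing
      siteEs-∉ [] _ = refl
      siteEs-∉ (t ∷ ts) nm rewrite site-∉ t (λ mm → nm (∈-++⁺ˡ mm)) = siteEs-∉ ts (λ mm → nm (∈-++⁺ʳ (labels t) mm))

    delEs-∷-other : ∀ t ts → label t ≢ n → delEs (t ∷ ts) ≡ del t ∷ delEs ts
    delEs-∷-other t ts ne with label t ≟ n
    ... | yes e = ⊥-elim (ne e)
    ... | no _ = refl

    delEs-leaf : delEs (enode n [] ∷ []) ≡ []
    delEs-leaf with n ≟ n
    ... | yes _ = refl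
    ... | no ne = ⊥-elim (ne refl)

    delEs-++ : ∀ ts us → delEs (ts ++ us) ≡ delEs ts ++ delEs us
    delEs-++ [] us = refl
    delEs-++ (t ∷ ts) us with label t ≟ n
    ... | yes _ = delEs-++ ts us
    ... | no _ = cong (del t ∷_) (delEs-++ ts us)

    siteEs-++ : ∀ ts us → siteEs ts ≡ nothing → siteEs (ts ++ us) ≡ siteEs us
    siteEs-++ [] us _ = refl
    siteEs-++ (t ∷ ts) us e with site t
    ... | nothing = siteEs-++ ts us e
    siteEs-++ (t ∷ ts) us () | just _

    delEs-newTree : ∀ F → n ∉ forestLabels F → AllTrees Pruned F → delEs (F ++ enode n [] ∷ []) ≡ F
    delEs-newTree F nm p = trans (delEs-++ F (enode n [] ∷ [])) (trans (cong (delEs F ++_) delEs-leaf)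
                     (trans (++-identityʳ (delEs F)) (delEs-∉ F (λ mm → nm (subst (n ∈_) (sym (forestLabels≡labelsEs F)) mm)) (AllTrees⇒PrunedEs F p))))

    siteF-newTree : ∀ F → n ∉ forestLabels F → siteF (F ++ enode n [] ∷ []) ≡ newTree
    siteF-newTree F nm = cong toSite (trans (siteEs-++ F _ (siteEs-∉ F (λ mm → nm (subst (n ∈_) (sym (forestLabels≡labelsEs F)) mm)))) refl)

  module DeleteInsert (v j n : ℕ) (k≥1 : 1 ≤ k) (j<k : j < k) where
    open Insert v j n
    open InsertLeaves v j n k≥1 j<k
    open InsertValid v j n k≥1 j<k
    open Delete n

    delOs-graft : ∀ j' X → delOs (graft j' nleaf X) ≡ delOs X
    delOs-graft j' [] = refl
    delOs-graft zero (onode ts ∷ cs) = cong (λ z → onode z ∷ delOs cs) (trans (delEs-++ ts (nleaf ∷ [])) (trans (cong (delEs ts ++_) delEs-leaf) (++-identityʳ (delEs ts))))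
    delOs-graft (suc j') (onode ts ∷ cs) = cong (onode (delEs ts) ∷_) (delOs-graft j' cs)

    delOs-replicate : ∀ i → delOs (replicate i (onode [])) ≡ replicate i (onode [])
    delOs-replicate zero = refl
    delOs-replicate (suc i) = cong (onode [] ∷_) (delOs-replicate i)

    delOs-expand : ∀ X → delOs (expand X) ≡ expand (delOs X)
    delOs-expand [] = delOs-replicate k
    delOs-expand (onode ts ∷ cs) = refl

    collapse-expand : ∀ l cs → Pruned (enode l cs) → collapse (expand cs) ≡ cs
    collapse-expand l [] _ = if-true (allLeavesᵇ-replicate k)
    collapse-expand l (c ∷ cs) (_ , al , _) = if-false al

    mutual
      del-ins : ∀ T → n ∉ labels T → Pruned T → del (ins T) ≡ T
      del-ins (enode l cs) nm p with l ≟ v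
      ... | yes _ = cong (enode l) (trans (cong collapse (trans (delOs-graft j (expand (insOs cs)))
                      (trans (delOs-expand (insOs cs)) (cong expand (delOs-insOs cs (λ mm → nm (there mm)) (Pruned⇒PrunedOs cs p)))))) (collapse-expand l cs p))
      ... | no _ = cong (enode l) (trans (cong collapse (delOs-insOs cs (λ mm → nm (there mm)) (Pruned⇒PrunedOs cs p))) (collapse-Pruned l cs p))

      delOs-insOs : ∀ cs → n ∉ labelsOs cs → PrunedOs cs → delOs (insOs cs) ≡ cs
      delOs-insOs [] _ _ = refl
      delOs-insOs (onode ts ∷ cs) nm (p , q) = cong₂ (λ a b → onode a ∷ b) (delEs-insEs ts (λ mm → nm (∈-++⁺ˡ mm)) p) (delOs-insOs cs (λ mm → nm (∈-++⁺ʳ (labelsEs ts) mm)) q)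

      delEs-insEs : ∀ ts → n ∉ labelsEs ts → PrunedEs ts → delEs (insEs ts) ≡ ts
      delEs-insEs [] _ _ = refl
      delEs-insEs (t ∷ ts) nm (p , q) = trans (delEs-∷-other (ins t) (insEs ts) (λ e → nm (∈-++⁺ˡ (subst (_∈ labels t) (trans (sym (label-ins t)) e) (label∈labels t)))))
                                      (cong₂ _∷_ (del-ins t (λ mm → nm (∈-++⁺ˡ mm)) p) (delEs-insEs ts (λ mm → nm (∈-++⁺ʳ (labels t) mm)) q))

    hasRootᵇ-insEs : ∀ ts → hasRootᵇ (insEs ts) ≡ hasRootᵇ ts
    hasRootᵇ-insEs ts = cong hasLabelᵇ (roots-insEs ts)

    siteOs-graft : ∀ l i j' X → n ∉ labelsOs X → j' < length X → siteOs l i (graft j' nleaf X) ≡ just (l , i + j')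
    siteOs-graft l i zero (onode ts ∷ cs) nm _ rewrite map-++ label ts (nleaf ∷ []) | hasLabelᵇ-∷ʳ (map label ts) = cong (λ z → just (l , z)) (sym (+-identityʳ i))
    siteOs-graft l i (suc j') (onode ts ∷ cs) nm (s≤s lt) rewrite hasRootᵇ-∉ ts (λ mm → nm (∈-++⁺ˡ mm))
      | siteEs-∉ ts (λ mm → nm (∈-++⁺ˡ mm)) = trans (siteOs-graft l (suc i) j' cs (λ mm → nm (∈-++⁺ʳ (labelsEs ts) mm)) lt) (cong (λ z → just (l , z)) (sym (+-suc i j')))

    mutual
      site-ins : ∀ T → v ∈ labels T → n ∉ labels T → Distinct (labels T) → Pruned T → site (ins T) ≡ just (v , j)
      site-ins (enode l cs) m nm U p with l ≟ v
      ... | yes refl = subst (λ z → siteOs l 0 (graft j nleaf (expand z)) ≡ just (l , j)) (sym (insOs-∉ cs (Distinct-head∉ {l} {labelsOs cs} U)))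
                         (siteOs-graft l 0 j (expand cs) (λ mm → nm (there (subst (n ∈_) (labelsOs-expand cs) mm))) (subst (j <_) (sym (length-expand cs p)) j<k))
      site-ins (enode l cs) (here e) nm U p | no ne = ⊥-elim (ne (sym e))
      site-ins (enode l cs) (there m) nm U p | no ne = siteOs-insOs l 0 cs m (λ mm → nm (there mm)) (Distinct-tail {l} U) (Pruned⇒PrunedOs cs p)

      siteOs-insOs : ∀ l i cs → v ∈ labelsOs cs → n ∉ labelsOs cs → Distinct (labelsOs cs) → PrunedOs cs → siteOs l i (insOs cs) ≡ just (v , j)
      siteOs-insOs l i (onode ts ∷ cs) m nm U (p , q) rewrite hasRootᵇ-insEs ts | hasRootᵇ-∉ ts (λ mm → nm (∈-++⁺ˡ mm))
        with ∈-++⁻ (labelsEs ts) m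
      ... | inj₁ m1 rewrite siteEs-insEs ts m1 (λ mm → nm (∈-++⁺ˡ mm)) (Distinct-++ˡ (labelsEs ts) (labelsOs cs) U) p = refl
      ... | inj₂ m2 rewrite insEs-∉ ts (λ mm → Distinct-++-disjoint (labelsEs ts) (labelsOs cs) U mm m2) | siteEs-∉ ts (λ mm → nm (∈-++⁺ˡ mm)) =
            siteOs-insOs l (suc i) cs m2 (λ mm → nm (∈-++⁺ʳ (labelsEs ts) mm)) (Distinct-++ʳ (labelsEs ts) (labelsOs cs) U) q

      siteEs-insEs : ∀ ts → v ∈ labelsEs ts → n ∉ labelsEs ts → Distinct (labelsEs ts) → PrunedEs ts → siteEs (insEs ts) ≡ just (v , j)
      siteEs-insEs (t ∷ ts) m nm U (p , q) with ∈-++⁻ (labels t) m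
      ... | inj₁ m1 rewrite site-ins t m1 (λ mm → nm (∈-++⁺ˡ mm)) (Distinct-++ˡ (labels t) (labelsEs ts) U) p = refl
      ... | inj₂ m2 rewrite ins-∉ t (λ mm → Distinct-++-disjoint (labels t) (labelsEs ts) U mm m2) | site-∉ t (λ mm → nm (∈-++⁺ˡ mm)) =
            siteEs-insEs ts m2 (λ mm → nm (∈-++⁺ʳ (labels t) mm)) (Distinct-++ʳ (labels t) (labelsEs ts) U) q

  ins-here : ∀ v j n X → Insert.ins v j n (enode v X) ≡ enode v (graft j (enode n []) (expand (Insert.insOs v j n X)))
  ins-here v j n X with v ≟ v
  ... | yes _ = refl
  ... | no ne = ⊥-elim (ne refl)

  ins-elsewhere : ∀ v j n l X → l ≢ v → Insert.ins v j n (enode l X) ≡ enode l (Insert.insOs v j n X)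
  ins-elsewhere v j n l X ne with l ≟ v
  ... | yes e = ⊥-elim (ne e)
  ... | no _ = refl

  module DeleteDecompose (n : ℕ) (k≥1 : 1 ≤ k) where
    open Delete n

    mutual
      mult-del : ∀ x T → mult x (labels (del T)) ≤ mult x (labels T)
      mult-del x (enode l cs) with l ≟ x
      ... | yes refl rewrite mult-∷-≡ l (labelsOs (collapse (delOs cs))) | mult-∷-≡ l (labelsOs cs) = s≤s (mult-collapse x cs)
      ... | no ne rewrite mult-∷-≢ (labelsOs (collapse (delOs cs))) ne | mult-∷-≢ (labelsOs cs) ne = mult-collapse x cs

      mult-collapse : ∀ x cs → mult x (labelsOs (collapse (delOs cs))) ≤ mult x (labelsOs cs)
      mult-collapse x cs with allLeavesᵇ (delOs cs)
      ... | true = z≤n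
      ... | false = mult-delOs x cs

      mult-delOs : ∀ x cs → mult x (labelsOs (delOs cs)) ≤ mult x (labelsOs cs)
      mult-delOs x [] = z≤n
      mult-delOs x (onode ts ∷ cs) rewrite mult-++ x (labelsEs (delEs ts)) (labelsOs (delOs cs)) | mult-++ x (labelsEs ts) (labelsOs cs) =
        +-mono-≤ (mult-delEs x ts) (mult-delOs x cs)

      mult-delEs : ∀ x ts → mult x (labelsEs (delEs ts)) ≤ mult x (labelsEs ts)
      mult-delEs x [] = z≤n
      mult-delEs x (t ∷ ts) with label t ≟ n
      ... | yes _ rewrite mult-++ x (labels t) (labelsEs ts) = ≤-trans (mult-delEs x ts) (m≤n+m _ _)
      ... | no _ rewrite mult-++ x (labels (del t)) (labelsEs (delEs ts)) | mult-++ x (labels t) (labelsEs ts) = +-mono-≤ (mult-del x t) (mult-delEs x ts)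

    ∈-del : ∀ {x} T → x ∈ labels (del T) → x ∈ labels T
    ∈-del {x} T m = mult≥1⇒∈ _ (≤-trans (∈⇒mult≥1 m) (mult-del x T))

    ∈-delOs : ∀ {x} cs → x ∈ labelsOs (delOs cs) → x ∈ labelsOs cs
    ∈-delOs {x} cs m = mult≥1⇒∈ _ (≤-trans (∈⇒mult≥1 m) (mult-delOs x cs))

    ∈-delEs : ∀ {x} ts → x ∈ labelsEs (delEs ts) → x ∈ labelsEs ts
    ∈-delEs {x} ts m = mult≥1⇒∈ _ (≤-trans (∈⇒mult≥1 m) (mult-delEs x ts))

    nleaf : ETree
    nleaf = enode n []

    -- A forest containing n as a leaf is obtained from its deletion by one of the two kinds
    -- of insertion.
    OsDecomposition : List OTree → Set
    OsDecomposition cs =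
      (Σ ℕ λ j → (j < length cs) × (graft j nleaf (delOs cs) ≡ cs) × (allLeavesᵇ (delOs cs) ≡ true → cs ≡ graft j nleaf (replicate (length cs) (onode []))))
      ⊎ (Σ ℕ λ v → Σ ℕ λ j → (j < k) × (v ∈ labelsOs (delOs cs)) × (Insert.insOs v j n (delOs cs) ≡ cs) × (allLeavesᵇ (delOs cs) ≡ false))

    EsDecomposition : List ETree → Set
    EsDecomposition ts =
      (delEs ts ++ nleaf ∷ [] ≡ ts)
      ⊎ (Σ ℕ λ v → Σ ℕ λ j → (j < k) × (v ∈ labelsEs (delEs ts)) × (Insert.insEs v j n (delEs ts) ≡ ts) × (delEs ts ≢ []))

    EDecomposition : ETree → Set
    EDecomposition T = Σ ℕ λ v → Σ ℕ λ j → (j < k) × (v ∈ labels (del T)) × (Insert.ins v j n (del T) ≡ T)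

    collapse-true : ∀ X → allLeavesᵇ X ≡ true → collapse X ≡ []
    collapse-true X e = if-true e

    collapse-false : ∀ X → allLeavesᵇ X ≡ false → collapse X ≡ X
    collapse-false X e = if-false e

    expand-id : ∀ X → allLeavesᵇ X ≡ false → expand X ≡ X
    expand-id [] ()
    expand-id (c ∷ cs) _ = refl

    ∈-collapse : ∀ {x} X → x ∈ labelsOs (collapse X) → x ∈ labelsOs X
    ∈-collapse {x} X m with allLeavesᵇ X
    ... | true = ⊥-elim (lem m)
      where lem : x ∉ []
            lem ()
    ... | false = m

    Increasing-tail : ∀ {x xs} → Increasing (x ∷ xs) → Increasing xs
    Increasing-tail inc[x] = inc[]
    Increasing-tail (inc∷ _ p) = p

    decompose-Os-first : ∀ ts cs → PrunedOs cs → (∀ {x} → x ∈ labelsEs ts → x ∉ labelsOs cs) → n ∈ labelsEs ts →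
      EsDecomposition ts → OsDecomposition (onode ts ∷ cs)
    decompose-Os-first ts cs pcs disj n∈ts (inj₁ eqA) =
      inj₁ (0 , s≤s z≤n , cong₂ (λ a b → onode a ∷ b) eqA dcs , allL (delEs ts) eqA)
      where
        dcs : delOs cs ≡ cs
        dcs = delOs-∉ cs (disj n∈ts) pcs
        allL : ∀ us → us ++ nleaf ∷ [] ≡ ts → allLeavesᵇ (onode us ∷ delOs cs) ≡ true →
               onode ts ∷ cs ≡ graft 0 nleaf (replicate (length (onode ts ∷ cs)) (onode []))
        allL [] refl e = cong (onode (nleaf ∷ []) ∷_) (allLeavesᵇ⇒replicate cs (trans (cong allLeavesᵇ (sym dcs)) e))
        allL (u ∷ us) _ ()
    decompose-Os-first ts cs pcs disj n∈ts (inj₂ (v , j , jk , vin , eqB , nonempty)) =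
      inj₂ (v , j , jk , ∈-++⁺ˡ vin ,
            cong₂ (λ a b → onode a ∷ b) eqB (trans (cong (Insert.insOs v j n) (delOs-∉ cs (disj n∈ts) pcs))
              (InsertValid.insOs-∉ v j n k≥1 jk cs (disj (∈-delEs ts vin)))) ,
            alf (delEs ts) nonempty)
      where
        alf : ∀ us → us ≢ [] → allLeavesᵇ (onode us ∷ delOs cs) ≡ false
        alf [] ne = ⊥-elim (ne refl)
        alf (u ∷ us) _ = refl

    decompose-Os-later : ∀ ts cs → PrunedEs ts → (∀ {x} → x ∈ labelsOs cs → x ∉ labelsEs ts) → n ∈ labelsOs cs →
      OsDecomposition cs → OsDecomposition (onode ts ∷ cs)
    decompose-Os-later ts cs pts disj n∈cs (inj₁ (j , jl , eqA , allL)) =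
      inj₁ (suc j , s≤s jl , cong₂ _∷_ (cong onode dts) eqA , allL' (delEs ts) dts)
      where
        dts : delEs ts ≡ ts
        dts = delEs-∉ ts (disj n∈cs) pts
        allL' : ∀ us → us ≡ ts → allLeavesᵇ (onode us ∷ delOs cs) ≡ true →
                onode ts ∷ cs ≡ graft (suc j) nleaf (replicate (length (onode ts ∷ cs)) (onode []))
        allL' [] refl e = cong (onode [] ∷_) (allL e)
        allL' (u ∷ us) _ ()
    decompose-Os-later ts cs pts disj n∈cs (inj₂ (v , j , jk , vin , eqB , alf)) =
      inj₂ (v , j , jk , ∈-++⁺ʳ (labelsEs (delEs ts)) vin ,
            cong₂ (λ a b → onode a ∷ b) (trans (cong (Insert.insEs v j n) (delEs-∉ ts (disj n∈cs) pts))
              (InsertValid.insEs-∉ v j n k≥1 jk ts (disj (∈-delOs cs vin)))) eqB ,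
            trans (cong (isLeafOᵇ (onode (delEs ts)) ∧_) alf) (∧-zeroʳ _))

    mutual
      decompose-tree : ∀ T → n ∈ labels T → label T ≢ n → (∀ x → x ∈ labels T → x ≤ n) → Distinct (labels T) → Pruned T → IncE T → EDecomposition T
      decompose-tree (enode l []) (here e) ne B U P I = ⊥-elim (ne (sym e))
      decompose-tree (enode l (c ∷ cs)) (here e) ne B U P I = ⊥-elim (ne (sym e))
      decompose-tree (enode l (c ∷ cs)) (there m) ne B U (len , al , pos) I with decompose-Os l (c ∷ cs) m (λ x mm → B x (there mm)) (Distinct-tail {l} U) pos I
      ... | inj₁ (j , jl , eqA , allL) = l , j , subst (j <_) len jl , here refl , go (allLeavesᵇ (delOs (c ∷ cs))) refl
        where
          l∉ : l ∉ labelsOs (c ∷ cs)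
          l∉ = Distinct-head∉ {l} {labelsOs (c ∷ cs)} U
          X = collapse (delOs (c ∷ cs))
          go : ∀ b → allLeavesᵇ (delOs (c ∷ cs)) ≡ b → Insert.ins l j n (enode l X) ≡ enode l (c ∷ cs)
          go b e = trans (ins-here l j n X) (cong (enode l) (trans (cong (λ z → graft j nleaf (expand z))
                     (InsertValid.insOs-∉ l j n k≥1 (subst (j <_) len jl) X (λ mm → l∉ (∈-delOs (c ∷ cs) (∈-collapse (delOs (c ∷ cs)) mm))))) (fin b e)))
            where
              fin : ∀ b → allLeavesᵇ (delOs (c ∷ cs)) ≡ b → graft j nleaf (expand X) ≡ c ∷ cs
              fin true e = trans (cong (λ z → graft j nleaf (expand z)) (collapse-true (delOs (c ∷ cs)) e))
                             (sym (trans (allL e) (cong (λ z → graft j nleaf (replicate z (onode []))) len)))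
              fin false e = trans (cong (λ z → graft j nleaf (expand z)) (collapse-false (delOs (c ∷ cs)) e))
                             (trans (cong (graft j nleaf) (expand-id (delOs (c ∷ cs)) e)) eqA)
      ... | inj₂ (v , j , jk , vin , eqB , alf) = v , j , jk , there (subst (λ z → v ∈ labelsOs z) (sym (collapse-false (delOs (c ∷ cs)) alf)) vin) ,
            trans (cong (Insert.ins v j n) (cong (enode l) (collapse-false (delOs (c ∷ cs)) alf)))
              (trans (ins-elsewhere v j n l (delOs (c ∷ cs)) (λ e → Distinct-head∉ {l} {labelsOs (c ∷ cs)} U (subst (_∈ labelsOs (c ∷ cs)) (sym e) (∈-delOs (c ∷ cs) vin))))
                (cong (enode l) eqB))

      decompose-Os : ∀ l cs → n ∈ labelsOs cs → (∀ x → x ∈ labelsOs cs → x ≤ n) → Distinct (labelsOs cs) → PrunedOs cs → IncOs l cs → OsDecomposition cs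
      decompose-Os l (onode ts ∷ cs) m B U (pts , pcs) (aa , inc , ies , ios) with ∈-++⁻ (labelsEs ts) m
      ... | inj₁ m1 = decompose-Os-first ts cs pcs (Distinct-++-disjoint (labelsEs ts) (labelsOs cs) U) m1
            (decompose-Es ts m1 (λ x mm → B x (∈-++⁺ˡ mm)) (Distinct-++ˡ (labelsEs ts) (labelsOs cs) U) pts ies inc)
      ... | inj₂ m2 = decompose-Os-later ts cs pts (λ mc mt → Distinct-++-disjoint (labelsEs ts) (labelsOs cs) U mt mc) m2
            (decompose-Os l cs m2 (λ x mm → B x (∈-++⁺ʳ (labelsEs ts) mm)) (Distinct-++ʳ (labelsEs ts) (labelsOs cs) U) pcs ios)

      decompose-Es : ∀ ts → n ∈ labelsEs ts → (∀ x → x ∈ labelsEs ts → x ≤ n) → Distinct (labelsEs ts) → PrunedEs ts → IncEs ts → Increasing (map label ts) → EsDecomposition ts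
      decompose-Es (t ∷ ts) m B U (pt , pts) (it , its) inc with ∈-++⁻ (labels t) m
      ... | inj₂ m2 with label t ≟ n
      ...   | yes e = ⊥-elim (Distinct-++-disjoint (labels t) (labelsEs ts) U (subst (_∈ labels t) e (label∈labels t)) m2)
      ...   | no ne with decompose-Es ts m2 (λ x mm → B x (∈-++⁺ʳ (labels t) mm)) (Distinct-++ʳ (labels t) (labelsEs ts) U) pts its (Increasing-tail inc)
      ...     | inj₁ eqA = inj₁ (cong₂ _∷_ (del-∉ t n∉t pt) eqA)
        where n∉t : n ∉ labels t
              n∉t mm = Distinct-++-disjoint (labels t) (labelsEs ts) U mm m2
      ...     | inj₂ (v , j , jk , vin , eqB , _) = inj₂ (v , j , jk , ∈-++⁺ʳ (labels (del t)) vin ,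
                 cong₂ _∷_ (trans (cong (Insert.ins v j n) (del-∉ t n∉t pt)) (InsertValid.ins-∉ v j n k≥1 jk t (λ mm → Distinct-++-disjoint (labels t) (labelsEs ts) U mm (∈-delEs ts vin)))) eqB ,
                 λ ())
        where n∉t : n ∉ labels t
              n∉t mm = Distinct-++-disjoint (labels t) (labelsEs ts) U mm m2
      decompose-Es (t ∷ ts) m B U (pt , pts) (it , its) inc | inj₁ m1 with label t ≟ n
      ...   | no ne with decompose-tree t m1 ne (λ x mm → B x (∈-++⁺ˡ mm)) (Distinct-++ˡ (labels t) (labelsEs ts) U) pt it
      ...     | v , j , jk , vin , eqT = inj₂ (v , j , jk , ∈-++⁺ˡ vin ,
                 cong₂ _∷_ eqT (trans (cong (Insert.insEs v j n) (delEs-∉ ts n∉ts pts)) (InsertValid.insEs-∉ v j n k≥1 jk ts (λ mm → Distinct-++-disjoint (labels t) (labelsEs ts) U (∈-del t vin) mm))) ,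
                 λ ())
        where n∉ts : n ∉ labelsEs ts
              n∉ts = Distinct-++-disjoint (labels t) (labelsEs ts) U m1
      decompose-Es (enode l cs ∷ ts) m B U (pt , pts) (it , its) inc | inj₁ m1 | yes refl = inj₁ (lem cs ts pt it inc (λ x mm → B x mm))
        where
          lem : ∀ cs ts → Pruned (enode l cs) → IncE (enode l cs) → Increasing (l ∷ map label ts) → (∀ x → x ∈ labelsEs (enode l cs ∷ ts) → x ≤ l) →
                delEs ts ++ nleaf ∷ [] ≡ enode l cs ∷ ts
          lem [] [] _ _ _ _ = refl
          lem cs (u ∷ us) _ _ (inc∷ lt _) B' = ⊥-elim (<⇒≱ lt (B' (label u) (∈-++⁺ʳ (labels (enode l cs)) (∈-++⁺ˡ (label∈labels u)))))
          lem (c ∷ cs) [] (_ , al , _) I' _ B' with ¬allLeavesᵇ⇒label l (c ∷ cs) al I'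
          ... | x , lt , xm = ⊥-elim (<⇒≱ lt (B' x (∈-++⁺ˡ (there xm))))

    mutual
      Pruned-del : ∀ T → Pruned T → Pruned (del T)
      Pruned-del (enode l cs) p = go (allLeavesᵇ (delOs cs)) refl
        where
          go : ∀ b → allLeavesᵇ (delOs cs) ≡ b → Pruned (enode l (collapse (delOs cs)))
          go true e = subst (λ z → Pruned (enode l z)) (sym (collapse-true (delOs cs) e)) tt
          go false e = subst (λ z → Pruned (enode l z)) (sym (collapse-false (delOs cs) e)) (fin cs p e)
            where
              fin : ∀ cs → Pruned (enode l cs) → allLeavesᵇ (delOs cs) ≡ false → Pruned (enode l (delOs cs))
              fin [] _ ()
              fin (onode ts ∷ cs) (len , al , q) e = trans (length-delOs (onode ts ∷ cs)) len , e , PrunedOs-delOs (onode ts ∷ cs) q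

      PrunedOs-delOs : ∀ cs → PrunedOs cs → PrunedOs (delOs cs)
      PrunedOs-delOs [] _ = tt
      PrunedOs-delOs (onode ts ∷ cs) (p , q) = PrunedEs-delEs ts p , PrunedOs-delOs cs q

      PrunedEs-delEs : ∀ ts → PrunedEs ts → PrunedEs (delEs ts)
      PrunedEs-delEs [] _ = tt
      PrunedEs-delEs (t ∷ ts) (p , q) with label t ≟ n
      ... | yes _ = PrunedEs-delEs ts q
      ... | no _ = Pruned-del t p , PrunedEs-delEs ts q

      length-delOs : ∀ cs → length (delOs cs) ≡ length cs
      length-delOs [] = refl
      length-delOs (onode ts ∷ cs) = cong suc (length-delOs cs)

    label-del : ∀ T → label (del T) ≡ label T
    label-del (enode l cs) = refl

    roots-delEs⊆ : ∀ {y} ts → y ∈ map label (delEs ts) → y ∈ map label ts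
    roots-delEs⊆ (t ∷ ts) m with label t ≟ n
    ... | yes _ = there (roots-delEs⊆ ts m)
    roots-delEs⊆ (t ∷ ts) (here e) | no _ = here (trans e (label-del t))
    roots-delEs⊆ (t ∷ ts) (there m) | no _ = there (roots-delEs⊆ ts m)

    Increasing-head< : ∀ x xs → Increasing (x ∷ xs) → ∀ y → y ∈ xs → x < y
    Increasing-head< x (y ∷ xs) (inc∷ lt p) y' (here refl) = lt
    Increasing-head< x (y ∷ xs) (inc∷ lt p) y' (there m) = <-trans lt (Increasing-head< y xs p y' m)

    Increasing-∷ : ∀ x xs → (∀ y → y ∈ xs → x < y) → Increasing xs → Increasing (x ∷ xs)
    Increasing-∷ x [] _ _ = inc[x]
    Increasing-∷ x (y ∷ xs) h p = inc∷ (h y (here refl)) p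

    Increasing-delEs : ∀ ts → Increasing (map label ts) → Increasing (map label (delEs ts))
    Increasing-delEs [] p = p
    Increasing-delEs (t ∷ ts) p with label t ≟ n
    ... | yes _ = Increasing-delEs ts (Increasing-tail p)
    ... | no _ = Increasing-∷ (label (del t)) (map label (delEs ts)) (λ y m → subst (_< y) (sym (label-del t)) (Increasing-head< (label t) (map label ts) p y (roots-delEs⊆ ts m)))
                   (Increasing-delEs ts (Increasing-tail p))

    AllAbove-delEs : ∀ l ts → AllAbove l ts → AllAbove l (delEs ts)
    AllAbove-delEs l [] _ = tt
    AllAbove-delEs l (t ∷ ts) (a , b) with label t ≟ n
    ... | yes _ = AllAbove-delEs l ts b
    ... | no _ = subst (l <_) (sym (label-del t)) a , AllAbove-delEs l ts b

    mutual
      IncE-del : ∀ T → IncE T → IncE (del T)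
      IncE-del (enode l cs) p = go (allLeavesᵇ (delOs cs)) refl
        where
          go : ∀ b → allLeavesᵇ (delOs cs) ≡ b → IncOs l (collapse (delOs cs))
          go true e = subst (IncOs l) (sym (collapse-true (delOs cs) e)) tt
          go false e = subst (IncOs l) (sym (collapse-false (delOs cs) e)) (IncOs-delOs l cs p)

      IncOs-delOs : ∀ l cs → IncOs l cs → IncOs l (delOs cs)
      IncOs-delOs l [] _ = tt
      IncOs-delOs l (onode ts ∷ cs) (aa , inc , ies , ios) = AllAbove-delEs l ts aa , Increasing-delEs ts inc , IncEs-delEs ts ies , IncOs-delOs l cs ios

      IncEs-delEs : ∀ ts → IncEs ts → IncEs (delEs ts)
      IncEs-delEs [] _ = tt
      IncEs-delEs (t ∷ ts) (p , q) with label t ≟ n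
      ... | yes _ = IncEs-delEs ts q
      ... | no _ = IncE-del t p , IncEs-delEs ts q

  properLeavesF-Distinct : ∀ m F → ForestOn m F → Distinct (properLeavesF F)
  properLeavesF-Distinct m F V = Distinct-mono {properLeavesF F} {forestLabels F} (λ x → mult-properLeavesF x F) (ForestOnProps.U m F V)

  AllTrees-split : ∀ F → AllTrees (IsIncPrunedTree k) F → AllTrees Pruned F × AllTrees IncE F
  AllTrees-split [] _ = tt , tt
  AllTrees-split (t ∷ F) ((pr , ie) , q) = let (a , b) = AllTrees-split F q in (IsPrunedEvenKary⇒Pruned t pr , a) , (ie , b)

  AllTrees-merge : ∀ F → AllTrees Pruned F → AllTrees IncE F → AllTrees (IsIncPrunedTree k) F
  AllTrees-merge [] _ _ = tt
  AllTrees-merge (t ∷ F) (p , p') (i , i') = (Pruned⇒IsPrunedEvenKary t p , i) , AllTrees-merge F p' i'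

  ForestOn⇒IsIncForest : ∀ m F → ForestOn m F → IsIncForest m k F
  ForestOn⇒IsIncForest m F V = AllTrees-merge F (ForestOn.pruned V) (ForestOn.increasing V) , ForestOn.labels↭ V , ForestOn.rootsIncreasing V

  IsIncForest⇒ForestOn : ∀ m F → IsIncForest m k F → ForestOn m F
  IsIncForest⇒ForestOn m F (at , pm , rt) = record { pruned = proj₁ (AllTrees-split F at) ; increasing = proj₂ (AllTrees-split F at) ; labels↭ = pm ; rootsIncreasing = rt }

  InFbar⇒fbarᵇ : ∀ F → InFbar k F → fbarᵇ F ≡ true
  InFbar⇒fbarᵇ (enode l [] ∷ []) _ = refl
  InFbar⇒fbarᵇ (enode l (c ∷ cs) ∷ []) (inj₁ ())
  InFbar⇒fbarᵇ (enode l (c ∷ cs) ∷ []) (inj₂ fl) = FirstLeaves⇒firstLeavesᵇ (k ∸ 1) (c ∷ cs) fl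
  InFbar⇒fbarᵇ (t ∷ u ∷ F) p = InFbar⇒fbarᵇ (u ∷ F) p

  fbarᵇ⇒InFbar : ∀ F → fbarᵇ F ≡ true → InFbar k F
  fbarᵇ⇒InFbar [] ()
  fbarᵇ⇒InFbar (enode l [] ∷ []) _ = inj₁ refl
  fbarᵇ⇒InFbar (enode l (c ∷ cs) ∷ []) e = inj₂ (firstLeavesᵇ⇒FirstLeaves (k ∸ 1) (c ∷ cs) e)
  fbarᵇ⇒InFbar (t ∷ u ∷ F) e = fbarᵇ⇒InFbar (u ∷ F) e

  module GraftDelete (m : ℕ) (k≥1 : 1 ≤ k) where
    n = suc m
    open Delete n
    open DeleteDecompose n k≥1

    new∉labels : ∀ F → ForestOn m F → n ∉ labelsEs F
    new∉labels F V mm = <-irrefl refl (s≤s (proj₂ (ForestOnProps.bound m F V n (subst (n ∈_) (sym (forestLabels≡labelsEs F)) mm))))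

    delete-graftAt : ∀ F tp → ForestOn m F → ValidSite k m tp → (delEs (graftAt n tp F) ≡ F) × (siteF (graftAt n tp F) ≡ tp)
    delete-graftAt F newTree V _ = delEs-newTree F (λ mm → new∉labels F V (subst (n ∈_) (forestLabels≡labelsEs F) mm)) (ForestOn.pruned V) , siteF-newTree F (λ mm → new∉labels F V (subst (n ∈_) (forestLabels≡labelsEs F) mm))
    delete-graftAt F (under v j) V ((a , b) , jk) =
      DeleteInsert.delEs-insEs v j n k≥1 jk F (new∉labels F V) (AllTrees⇒PrunedEs F (ForestOn.pruned V)) ,
      cong toSite (DeleteInsert.siteEs-insEs v j n k≥1 jk F (subst (v ∈_) (forestLabels≡labelsEs F) vin) (new∉labels F V) (subst Distinct (forestLabels≡labelsEs F) (ForestOnProps.U m F V)) (AllTrees⇒PrunedEs F (ForestOn.pruned V)))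
      where vin : v ∈ forestLabels F
            vin = ∈-resp-↭ (Perm.↭-sym (ForestOn.labels↭ V)) (∈-range⁺ m a b)

    ForestOn-delEs : ∀ F → ForestOn n F → forestLabels F ↭ n ∷ forestLabels (delEs F) → ForestOn m (delEs F)
    ForestOn-delEs F V p = record
      { pruned = PrunedEs⇒AllTrees (delEs F) (PrunedEs-delEs F (AllTrees⇒PrunedEs F (ForestOn.pruned V)))
      ; increasing = IncEs⇒AllTrees (delEs F) (IncEs-delEs F (AllTrees⇒IncEs F (ForestOn.increasing V)))
      ; labels↭ = Perm.↭-sym (PermP.drop-∷ (Perm.↭-trans (range-suc-↭ m) (Perm.↭-trans (Perm.↭-sym (ForestOn.labels↭ V)) p)))
      ; rootsIncreasing = Increasing-delEs F (ForestOn.rootsIncreasing V)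
      }

    delEs-Distinct : ∀ F → ForestOn n F → Distinct (labelsEs (delEs F))
    delEs-Distinct F V = Distinct-mono {labelsEs (delEs F)} {labelsEs F} (λ x → mult-delEs x F) (subst Distinct (forestLabels≡labelsEs F) (ForestOnProps.U n F V))

    graftAt-delete : ∀ F → ForestOn n F → Σ Site λ tp → ValidSite k m tp × ForestOn m (delEs F) × (F ≡ graftAt n tp (delEs F))
    graftAt-delete F V with decompose-Es F (subst (n ∈_) (forestLabels≡labelsEs F) (∈-resp-↭ (Perm.↭-sym (ForestOn.labels↭ V)) (∈-range⁺ n (s≤s z≤n) ≤-refl)))
                   (λ x mm → proj₂ (ForestOnProps.bound n F V x (subst (x ∈_) (sym (forestLabels≡labelsEs F)) mm)))
                   (subst Distinct (forestLabels≡labelsEs F) (ForestOnProps.U n F V)) (AllTrees⇒PrunedEs F (ForestOn.pruned V)) (AllTrees⇒IncEs F (ForestOn.increasing V)) (ForestOn.rootsIncreasing V)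
    ... | inj₁ eqA = newTree , tt , ForestOn-delEs F V pf , sym eqA
      where pf : forestLabels F ↭ n ∷ forestLabels (delEs F)
            pf = subst (λ z → forestLabels z ↭ n ∷ forestLabels (delEs F)) eqA
                   (Perm.↭-trans (Perm.↭-reflexive (forestLabels-++ (delEs F) (nleaf ∷ []))) (PermP.++-comm (forestLabels (delEs F)) (n ∷ [])))
    ... | inj₂ (v , j , jk , vin , eqB , _) = under v j , (bnd , jk) , V' , sym eqB
      where pf : forestLabels F ↭ n ∷ forestLabels (delEs F)
            pf = subst (λ z → forestLabels z ↭ n ∷ forestLabels (delEs F)) eqB
                   (Perm.↭-trans (Perm.↭-reflexive (forestLabels≡labelsEs (Insert.insEs v j n (delEs F))))
                     (Perm.↭-trans (InsertValid.labelsEs-insEs-↭ v j n k≥1 jk (delEs F) vin (delEs-Distinct F V) (PrunedEs-delEs F (AllTrees⇒PrunedEs F (ForestOn.pruned V))))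
                       (Perm.↭-reflexive (cong (n ∷_) (sym (forestLabels≡labelsEs (delEs F)))))))
            V' = ForestOn-delEs F V pf
            bnd = ∈-range⁻ m (∈-resp-↭ (ForestOn.labels↭ V') (subst (v ∈_) (sym (forestLabels≡labelsEs (delEs F))) vin))

-- The bijection

module Bijection (k : ℕ) (k≥1 : 1 ≤ k) where
  open StirlingWords k
  open PrunedForests k

  ζ : ℕ → List ℕ → Forest
  ζ zero π = []
  ζ (suc m) π = graftAt (suc m) (siteOf (eraseAll (suc m) π) (firstIndex (suc m) π)) (ζ m (eraseAll (suc m) π))

  ζ-block : ∀ m A C → suc m ∉ A → suc m ∉ C →
          ζ (suc m) (A ++ block (suc m) ++ C) ≡ graftAt (suc m) (siteOf (A ++ C) (length A)) (ζ m (A ++ C))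
  ζ-block m A C nA nC rewrite eraseAll-block (suc m) A C nA nC | firstIndex-block (suc m) A C k≥1 nA = refl

  Stirling-zero : ∀ π → Stirling 0 π → π ≡ []
  Stirling-zero [] _ = refl
  Stirling-zero (x ∷ π) (_ , r , _) with r x (here refl)
  ... | a , b = ⊥-elim (<-irrefl refl (≤-trans a b))

  ForestOn-zero : ForestOn 0 []
  ForestOn-zero = record { pruned = tt ; increasing = tt ; labels↭ = Perm.↭-refl ; rootsIncreasing = inc[] }

  ForestOn-graftAt : ∀ m F tp → ForestOn m F → ValidSite k m tp → ForestOn (suc m) (graftAt (suc m) tp F)
  ForestOn-graftAt m F newTree V _ = ForestOn-newTree m F V
  ForestOn-graftAt m F (under v j) V ((a , b) , jk) = InsertForest.ForestOn-under m v j k≥1 jk F V a b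

  pred-k<k : k ∸ 1 < k
  pred-k<k = subst (k ∸ 1 <_) (suc-pred-k k≥1) ≤-refl

  mult-before<k : ∀ m w p → Stirling m w → p < length w → mult (nth w p) (take p w) < k
  mult-before<k m w p V lt = ≤-trans (subst (_≤ c + mult v (drop p w)) (+-comm c 1) (+-monoʳ-≤ c (∈⇒mult≥1 (nth-∈-drop w p lt))))
                             (≤-trans (≤-reflexive (sym (mult-take-drop v p w))) (Stirling-mult≤k m w V v))
    where v = nth w p
          c = mult v (take p w)

  siteOf-valid : ∀ m w p → Stirling m w → p ≤ length w → ValidSite k m (siteOf w p)
  siteOf-valid m w zero V le = tt
  siteOf-valid m w (suc p) V le = go (length w ≤? suc p) (nth w (suc p) ≟ hd w)
    where
      rng = proj₁ (proj₂ V)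
      go : Dec (length w ≤ suc p) → Dec (nth w (suc p) ≡ hd w) → ValidSite k m (siteOf w (suc p))
      go (yes le') _ = subst (ValidSite k m) (sym (siteOf-end w p le')) (rng (hd w) (hd-∈ w (≤-trans (s≤s z≤n) le)) , pred-k<k)
      go (no nle) (yes e) = subst (ValidSite k m) (sym (siteOf-head w p (≰⇒> nle) e))
                              (rng (hd w) (hd-∈ w (≤-trans (s≤s z≤n) le)) ,
                               ≤-trans (s≤s (∸-monoˡ-≤ 1 (<⇒≤ (subst (λ z → mult z (take (suc p) w) < k) e (mult-before<k m w (suc p) V (≰⇒> nle)))))) pred-k<k)
      go (no nle) (no ne) = subst (ValidSite k m) (sym (siteOf-other w p (≰⇒> nle) ne))
                              (rng (nth w (suc p)) (drop-⊆ (suc p) w (nth-∈-drop w (suc p) (≰⇒> nle))) , mult-before<k m w (suc p) V (≰⇒> nle))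

  ζ-valid : ∀ m π → Stirling m π → ForestOn m (ζ m π)
  ζ-valid zero π V = ForestOn-zero
  ζ-valid (suc m) π V with decompose m π k≥1 V
  ... | decomposition A C nA nC refl val = subst (ForestOn (suc m)) (sym (ζ-block m A C nA nC))
          (ForestOn-graftAt m (ζ m (A ++ C)) (siteOf (A ++ C) (length A)) (ζ-valid m (A ++ C) val)
            (siteOf-valid m (A ++ C) (length A) val (length-++-≤ˡ A)))

  ζ-injective : ∀ m π σ → Stirling m π → Stirling m σ → ζ m π ≡ ζ m σ → π ≡ σ
  ζ-injective zero π σ Vπ Vσ e = trans (Stirling-zero π Vπ) (sym (Stirling-zero σ Vσ))
  ζ-injective (suc m) π σ Vπ Vσ e with decompose m π k≥1 Vπ | decompose m σ k≥1 Vσ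
  ... | decomposition A C nA nC refl val | decomposition A' C' nA' nC' refl val' = fin
    where
      w = A ++ C
      w' = A' ++ C'
      tp = siteOf w (length A)
      tp' = siteOf w' (length A')
      F = ζ m w
      F' = ζ m w'
      e' : graftAt (suc m) tp F ≡ graftAt (suc m) tp' F'
      e' = trans (sym (ζ-block m A C nA nC)) (trans e (ζ-block m A' C' nA' nC'))
      d1 = GraftDelete.delete-graftAt m k≥1 F tp (ζ-valid m w val) (siteOf-valid m w (length A) val (length-++-≤ˡ A))
      d1' = GraftDelete.delete-graftAt m k≥1 F' tp' (ζ-valid m w' val') (siteOf-valid m w' (length A') val' (length-++-≤ˡ A'))
      FF : F ≡ F'
      FF = trans (sym (proj₁ d1)) (trans (cong (Delete.delEs (suc m)) e') (proj₁ d1'))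
      ww : w ≡ w'
      ww = ζ-injective m w w' val val' FF
      tt' : tp ≡ tp'
      tt' = trans (sym (proj₂ d1)) (trans (cong (Delete.siteF (suc m)) e') (proj₂ d1'))
      ll : length A ≡ length A'
      ll = trans (sym (positionOf-siteOf m w (length A) val (length-++-≤ˡ A)))
             (trans (cong (positionOf w) tt') (trans (cong (λ z → positionOf z tp') ww) (positionOf-siteOf m w' (length A') val' (length-++-≤ˡ A'))))
      fin : A ++ block (suc m) ++ C ≡ A' ++ block (suc m) ++ C'
      fin with ++-injective-length A C A' C' ww ll
      ... | refl , refl = refl

  ζ-surjective : ∀ m F → ForestOn m F → Σ (List ℕ) λ π → Stirling m π × ζ m π ≡ F
  ζ-surjective zero [] V = [] , ((λ x a b → ⊥-elim (<-irrefl refl (≤-trans a b))) , (λ x ()) , tt) , refl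
  ζ-surjective zero (enode l cs ∷ F) V with ∈-resp-↭ (ForestOn.labels↭ V) (here refl)
  ... | ()
  ζ-surjective (suc m) F V with GraftDelete.graftAt-delete m k≥1 F V
  ... | tp , tpv , V' , eqF with ζ-surjective m (Delete.delEs (suc m) F) V'
  ... | w , Vw , ew = π , Stirling-insert-block m A C VAC , ζeq
    where
      p = positionOf w tp
      rt = siteOf-positionOf m w tp k≥1 Vw tpv
      A = take p w
      C = drop p w
      AC : A ++ C ≡ w
      AC = take++drop≡id p w
      VAC : Stirling m (A ++ C)
      VAC = subst (Stirling m) (sym AC) Vw
      π = A ++ block (suc m) ++ C
      le : ∀ x → x ∈ w → x ≤ m
      le x mm = proj₂ (proj₁ (proj₂ Vw) x mm)
      nA : suc m ∉ A
      nA mm = <-irrefl refl (s≤s (le (suc m) (take-⊆ p w mm)))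
      nC : suc m ∉ C
      nC mm = <-irrefl refl (s≤s (le (suc m) (drop-⊆ p w mm)))
      lA : length A ≡ p
      lA = length-take-long p w (proj₂ rt)
      ζeq : ζ (suc m) π ≡ F
      ζeq = trans (ζ-block m A C nA nC)
              (trans (cong₂ (λ z z' → graftAt (suc m) (siteOf z z') (ζ m z)) AC lA)
                (trans (cong₂ (graftAt (suc m)) (proj₁ rt) ew) (sym eqF)))

  -- The last two invariants say nothing about the empty permutation.
  record Correspondence (m : ℕ) (π : List ℕ) (F : Forest) : Set where
    field
      apValues⊆ : ∀ x → x ∈ apValues π → x ∈ properLeavesF F
      ⊆apValues : ∀ x → x ∈ properLeavesF F → x ∈ apValues π
      qbar≡fbar : 1 ≤ m → qbarᵇ π ≡ fbarᵇ F
      hd≡lastRoot : 1 ≤ m → hd π ≡ lastRoot F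

  correspondence-newTree : ∀ m C → Stirling m C → Correspondence m C (ζ m C) → Correspondence (suc m) (block (suc m) ++ C) (graftAt (suc m) newTree (ζ m C))
  correspondence-newTree m C val IH = record
    { apValues⊆ = λ x mm → subst (x ∈_) (sym (properLeavesF-newTree (suc m) (ζ m C))) (Correspondence.apValues⊆ IH x (subst (x ∈_) eqa mm))
    ; ⊆apValues = λ x mm → subst (x ∈_) (sym eqa) (Correspondence.⊆apValues IH x (subst (x ∈_) (properLeavesF-newTree (suc m) (ζ m C)) mm))
    ; qbar≡fbar = λ _ → trans (qbarᵇ-block (suc m) C k≥1) (sym (fbarᵇ-newTree (suc m) (ζ m C)))
    ; hd≡lastRoot = λ _ → trans (hd-block (suc m) C k≥1) (sym (lastRoot-newTree (suc m) (ζ m C)))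
    }
    where eqa : apValues (block (suc m) ++ C) ≡ apValues C
          eqa = apValues-leading-block (suc m) C (λ x mm → m≤n⇒m≤1+n (proj₂ (proj₁ (proj₂ val) x mm)))

  correspondence-under : ∀ m a A' C u j → (val : Stirling m ((a ∷ A') ++ C)) → Correspondence m ((a ∷ A') ++ C) (ζ m ((a ∷ A') ++ C)) →
             j < k → 1 ≤ u → u ≤ m →
             (∀ x → x ∈ apValues ((a ∷ A') ++ C) → NotNext x C → x ≢ u) → (∀ x → x ∈ apValues ((a ∷ A') ++ C) → x ≢ u → NotNext x C) →
             (qbarᵇ ((a ∷ A') ++ block (suc m) ++ C) ≡ fbarᵇ (Insert.insEs u j (suc m) (ζ m ((a ∷ A') ++ C)))) →
             Correspondence (suc m) ((a ∷ A') ++ block (suc m) ++ C) (graftAt (suc m) (under u j) (ζ m ((a ∷ A') ++ C)))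
  correspondence-under m a A' C u j val IH jk u1 um H1 H2 qb = record
    { apValues⊆ = to' ; ⊆apValues = from' ; qbar≡fbar = λ _ → qb
    ; hd≡lastRoot = λ _ → trans (Correspondence.hd≡lastRoot IH m≥1) (sym (InsertRightmost.lastRoot-insEs u j (suc m) k≥1 jk F)) }
    where
      open BlockInsertion m a A' C k≥1 val using (n∈; fwd; bwd)
      F = ζ m ((a ∷ A') ++ C)
      VFF = ζ-valid m ((a ∷ A') ++ C) val
      m≥1 : 1 ≤ m
      m≥1 = let (p , q) = proj₁ (proj₂ val) a (here refl) in ≤-trans p q
      uin : u ∈ forestLabels F
      uin = ∈-resp-↭ (Perm.↭-sym (ForestOn.labels↭ VFF)) (∈-range⁺ m u1 um)
      open InsertLeaves u j (suc m) k≥1 jk using (properLeavesF-ins⁻; properLeavesF-ins⁺; properLeavesF-ins-new)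
      to' : ∀ x → x ∈ apValues ((a ∷ A') ++ block (suc m) ++ C) → x ∈ properLeavesF (Insert.insEs u j (suc m) F)
      to' x mm with fwd x mm
      ... | inj₁ refl = properLeavesF-ins-new F uin (ForestOn.pruned VFF)
      ... | inj₂ (mw , nh) = properLeavesF-ins⁺ F x (Correspondence.apValues⊆ IH x mw) (H1 x mw nh)
      from' : ∀ x → x ∈ properLeavesF (Insert.insEs u j (suc m) F) → x ∈ apValues ((a ∷ A') ++ block (suc m) ++ C)
      from' x mm with properLeavesF-ins⁻ F x mm
      ... | inj₁ refl = n∈
      ... | inj₂ (mf , ne) = bwd x (Correspondence.⊆apValues IH x mf) (H2 x (Correspondence.⊆apValues IH x mf) ne)

  correspondence-end : ∀ m a A' → Stirling m ((a ∷ A') ++ []) →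
    Correspondence m ((a ∷ A') ++ []) (ζ m ((a ∷ A') ++ [])) →
    Correspondence (suc m) ((a ∷ A') ++ block (suc m) ++ [])
      (graftAt (suc m) (siteOf ((a ∷ A') ++ []) (length (a ∷ A'))) (ζ m ((a ∷ A') ++ [])))
  correspondence-end m a A' val IH =
    subst (λ z → Correspondence (suc m) ((a ∷ A') ++ block (suc m) ++ []) (graftAt (suc m) z F)) (sym eqtp)
      (correspondence-under m a A' [] a (k ∸ 1) val IH pred-k<k a1 am H1 (λ x _ _ C' ()) qb)
    where
      w = (a ∷ A') ++ []
      F = ζ m w
      lw : length w ≡ suc (length A')
      lw = cong length (++-identityʳ (a ∷ A'))
      eqtp : siteOf w (suc (length A')) ≡ under a (k ∸ 1)
      eqtp = siteOf-end w (length A') (≤-reflexive lw)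
      a1 = proj₁ (proj₁ (proj₂ val) a (here refl))
      am = proj₂ (proj₁ (proj₂ val) a (here refl))
      m≥1 = ≤-trans a1 am
      H1 : ∀ x → x ∈ apValues w → NotNext x [] → x ≢ a
      H1 x mm _ refl = head∉apValues m a (A' ++ []) val mm
      kle : k ≤ length (a ∷ A')
      kle = ≤-trans (≤-reflexive (sym (proj₁ val a a1 am))) (≤-trans (mult≤length a w) (≤-reflexive lw))
      qb : qbarᵇ ((a ∷ A') ++ block (suc m) ++ []) ≡ fbarᵇ (Insert.insEs a (k ∸ 1) (suc m) F)
      qb = trans (qbarᵇ-long-prefix a A' (block (suc m) ++ []) [] kle)
             (trans (Correspondence.qbar≡fbar IH m≥1) (sym (InsertRightmost.fbarᵇ-last a (k ∸ 1) (suc m) k≥1 pred-k<k F (sym (Correspondence.hd≡lastRoot IH m≥1)) refl)))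

  correspondence-head-repeated : ∀ m a A' C' → Stirling m ((a ∷ A') ++ a ∷ C') →
    Correspondence m ((a ∷ A') ++ a ∷ C') (ζ m ((a ∷ A') ++ a ∷ C')) →
    Correspondence (suc m) ((a ∷ A') ++ block (suc m) ++ a ∷ C')
      (graftAt (suc m) (siteOf ((a ∷ A') ++ a ∷ C') (length (a ∷ A'))) (ζ m ((a ∷ A') ++ a ∷ C')))
  correspondence-head-repeated m a A' C' val IH =
    subst (λ z → Correspondence (suc m) ((a ∷ A') ++ block (suc m) ++ a ∷ C') (graftAt (suc m) z F)) (sym eqtp)
      (correspondence-under m a A' (a ∷ C') a jj val IH (proj₂ tv) (proj₁ (proj₁ tv)) (proj₂ (proj₁ tv))
        (λ x _ nh → NotNext⇒≢ x a C' nh) (λ x _ ne → ≢⇒NotNext x a C' ne) qb)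
    where
      w = (a ∷ A') ++ a ∷ C'
      F = ζ m w
      p = suc (length A')
      jj = mult a (take p w) ∸ 1
      eqtp : siteOf w p ≡ under a jj
      eqtp = siteOf-head w (length A') (length<length-insert (a ∷ A') a C') (nth-insert (a ∷ A') a C')
      tv : ValidSite k m (under a jj)
      tv = subst (ValidSite k m) eqtp (siteOf-valid m w p val (<⇒≤ (length<length-insert (a ∷ A') a C')))
      a1 = proj₁ (proj₁ (proj₂ val) a (here refl))
      am = proj₂ (proj₁ (proj₂ val) a (here refl))
      m≥1 = ≤-trans a1 am
      Jeq : jj ≡ mult a A'
      Jeq = cong (_∸ 1) (trans (cong (mult a) (take-length-++ (a ∷ A') (a ∷ C'))) (mult-∷-≡ a A'))
      big : suc (suc (mult a A')) ≤ k
      big = ≤-trans (s≤s (s≤s (m≤m+n (mult a A') (mult a C')))) (≤-trans (≤-reflexive (sym cw)) (≤-reflexive (proj₁ val a a1 am)))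
        where
          cw : mult a w ≡ suc (suc (mult a A' + mult a C'))
          cw = trans (mult-++ a (a ∷ A') (a ∷ C')) (trans (cong₂ _+_ (mult-∷-≡ a A') (mult-∷-≡ a C')) (cong suc (+-suc (mult a A') (mult a C'))))
      Jlt : jj < k ∸ 1
      Jlt = subst (_< k ∸ 1) (sym Jeq) (subst (suc (mult a A') ≤_) refl (≤-pred (subst (suc (suc (mult a A')) ≤_) (sym (suc-pred-k k≥1)) big)))
      qb : qbarᵇ ((a ∷ A') ++ block (suc m) ++ a ∷ C') ≡ fbarᵇ (Insert.insEs a jj (suc m) F)
      qb with k ≤? p
      ... | yes kle = trans (qbarᵇ-long-prefix a A' (block (suc m) ++ a ∷ C') (a ∷ C') kle)
                        (trans (qbarᵇ-head-repeated m a A' C' val kle) (sym (InsertRightmost.fbarᵇ-early a jj (suc m) k≥1 (proj₂ tv) F (sym (Correspondence.hd≡lastRoot IH m≥1)) Jlt (ForestOn.pruned (ζ-valid m w val)))))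
      ... | no nle = trans (qbarᵇ-cut-by-block a A' (suc m) (a ∷ C') (≰⇒> nle) (s≤s am))
                        (sym (InsertRightmost.fbarᵇ-early a jj (suc m) k≥1 (proj₂ tv) F (sym (Correspondence.hd≡lastRoot IH m≥1)) Jlt (ForestOn.pruned (ζ-valid m w val))))

  correspondence-other : ∀ m a A' v C' → v ≢ a → Stirling m ((a ∷ A') ++ v ∷ C') →
    Correspondence m ((a ∷ A') ++ v ∷ C') (ζ m ((a ∷ A') ++ v ∷ C')) →
    Correspondence (suc m) ((a ∷ A') ++ block (suc m) ++ v ∷ C')
      (graftAt (suc m) (siteOf ((a ∷ A') ++ v ∷ C') (length (a ∷ A'))) (ζ m ((a ∷ A') ++ v ∷ C')))
  correspondence-other m a A' v C' ne val IH =
    subst (λ z → Correspondence (suc m) ((a ∷ A') ++ block (suc m) ++ v ∷ C') (graftAt (suc m) z F)) (sym eqtp)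
      (correspondence-under m a A' (v ∷ C') v jj val IH (proj₂ tv) (proj₁ (proj₁ tv)) (proj₂ (proj₁ tv))
        (λ x _ nh → NotNext⇒≢ x v C' nh) (λ x _ ne' → ≢⇒NotNext x v C' ne') qb)
    where
      w = (a ∷ A') ++ v ∷ C'
      F = ζ m w
      p = suc (length A')
      jj = mult v (take p w)
      eqtp : siteOf w p ≡ under v jj
      eqtp = trans (siteOf-other w (length A') (length<length-insert (a ∷ A') v C') (λ e → ne (trans (sym (nth-insert (a ∷ A') v C')) e)))
               (cong (λ z → under z (mult z (take p w))) (nth-insert (a ∷ A') v C'))
      tv : ValidSite k m (under v jj)
      tv = subst (ValidSite k m) eqtp (siteOf-valid m w p val (<⇒≤ (length<length-insert (a ∷ A') v C')))
      a1 = proj₁ (proj₁ (proj₂ val) a (here refl))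
      am = proj₂ (proj₁ (proj₂ val) a (here refl))
      m≥1 = ≤-trans a1 am
      fne : fbarᵇ (Insert.insEs v jj (suc m) F) ≡ fbarᵇ F
      fne = InsertRightmost.fbarᵇ-other v jj (suc m) k≥1 (proj₂ tv) F (λ e → ne (trans (sym e) (sym (Correspondence.hd≡lastRoot IH m≥1))))
      qb : qbarᵇ ((a ∷ A') ++ block (suc m) ++ v ∷ C') ≡ fbarᵇ (Insert.insEs v jj (suc m) F)
      qb with k ≤? p
      ... | yes kle = trans (qbarᵇ-long-prefix a A' (block (suc m) ++ v ∷ C') (v ∷ C') kle) (trans (Correspondence.qbar≡fbar IH m≥1) (sym fne))
      ... | no nle = trans (qbarᵇ-cut-by-block a A' (suc m) (v ∷ C') (≰⇒> nle) (s≤s am))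
                       (sym (trans fne (trans (sym (Correspondence.qbar≡fbar IH m≥1)) (qbarᵇ-short-prefix a A' v C' (≰⇒> nle) ne))))

  correspondence-step : ∀ m A C → Stirling m (A ++ C) → Correspondence m (A ++ C) (ζ m (A ++ C)) →
          Correspondence (suc m) (A ++ block (suc m) ++ C) (graftAt (suc m) (siteOf (A ++ C) (length A)) (ζ m (A ++ C)))
  correspondence-step m [] C val IH = correspondence-newTree m C val IH
  correspondence-step m (a ∷ A') [] val IH = correspondence-end m a A' val IH
  correspondence-step m (a ∷ A') (v ∷ C') val IH with v ≟ a
  ... | yes refl = correspondence-head-repeated m a A' C' val IH
  ... | no v≢a = correspondence-other m a A' v C' v≢a val IH

  ζ-correspondence : ∀ m π → Stirling m π → Correspondence m π (ζ m π)
  ζ-correspondence zero π V with Stirling-zero π V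
  ... | refl = record { apValues⊆ = λ x () ; ⊆apValues = λ x () ; qbar≡fbar = λ () ; hd≡lastRoot = λ () }
  ζ-correspondence (suc m) π V with decompose m π k≥1 V
  ... | decomposition A C nA nC refl val = subst (Correspondence (suc m) (A ++ block (suc m) ++ C)) (sym (ζ-block m A C nA nC)) (correspondence-step m A C val (ζ-correspondence m (A ++ C) val))

  ζ-ap : ∀ m π → Stirling m π → ap k π ≡ lleaf (ζ m π) ∸ si (ζ m π)
  ζ-ap m π V = begin
    ap k π                        ≡⟨ ap≡length-apValues π ⟩
    length (apValues π)           ≡⟨ Distinct-same-elements⇒length≡ (apValues π) (properLeavesF F)
                                       (apValues-Distinct π (Stirling-mult≤k m π V)) (properLeavesF-Distinct m F (ζ-valid m π V))
                                       (Correspondence.apValues⊆ I) (Correspondence.⊆apValues I) ⟩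
    length (properLeavesF F)       ≡⟨ lleaf∸si≡properLeaves F ⟨
    lleaf F ∸ si F                ∎
    where
      open ≡-Reasoning
      F = ζ m π
      I = ζ-correspondence m π V

  ζ-bar : ∀ m π → 1 ≤ m → Stirling m π → InQbar k π ⇔ InFbar k (ζ m π)
  ζ-bar m π m≥1 V = mk⇔
    (λ π∈Q̄ → fbarᵇ⇒InFbar F (trans (sym qbar≡fbar) (InQbar⇒qbarᵇ k≥1 π π∈Q̄)))
    (λ F∈F̄ → qbarᵇ⇒InQbar π (trans qbar≡fbar (InFbar⇒fbarᵇ F F∈F̄)))
    where
      F = ζ m π
      qbar≡fbar = Correspondence.qbar≡fbar (ζ-correspondence m π V) m≥1

  ζ𝓕 : ∀ n → Q n k → 𝓕 n k
  ζ𝓕 n (π , st) = ζ n π , ForestOn⇒IsIncForest n (ζ n π) (ζ-valid n π (IsStirling⇒Stirling n π st))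

  ζ𝓕-injective : ∀ n (π σ : Q n k) → proj₁ (ζ𝓕 n π) ≡ proj₁ (ζ𝓕 n σ) → proj₁ π ≡ proj₁ σ
  ζ𝓕-injective n (π , sπ) (σ , sσ) = ζ-injective n π σ (IsStirling⇒Stirling n π sπ) (IsStirling⇒Stirling n σ sσ)

  ζ𝓕-surjective : ∀ n (F : 𝓕 n k) → ∃ λ π → proj₁ (ζ𝓕 n π) ≡ proj₁ F
  ζ𝓕-surjective n (F , isF) with ζ-surjective n F (IsIncForest⇒ForestOn n F isF)
  ... | π , V , e = (π , Stirling⇒IsStirling n π V) , e

  ζ𝓕-ap : ∀ n (π : Q n k) → ap k (proj₁ π) ≡ lleaf (proj₁ (ζ𝓕 n π)) ∸ si (proj₁ (ζ𝓕 n π))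
  ζ𝓕-ap n (π , st) = ζ-ap n π (IsStirling⇒Stirling n π st)

  ζ𝓕-bar : ∀ n → 1 ≤ n → (π : Q n k) → InQbar k (proj₁ π) ⇔ InFbar k (proj₁ (ζ𝓕 n π))
  ζ𝓕-bar n n≥1 (π , st) = ζ-bar n π n≥1 (IsStirling⇒Stirling n π st)

proposition3p3 : (n k : ℕ) → 1 ≤ n → 1 ≤ k →
    Σ (Q n k → 𝓕 n k) λ ζ →
      ((π σ : Q n k) → proj₁ (ζ π) ≡ proj₁ (ζ σ) → proj₁ π ≡ proj₁ σ) ×
      ((F : 𝓕 n k) → ∃ λ π → proj₁ (ζ π) ≡ proj₁ F) ×
      ((π : Q n k) → ap k (proj₁ π) ≡ lleaf (proj₁ (ζ π)) ∸ si (proj₁ (ζ π))) ×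
      ((π : Q n k) → InQbar k (proj₁ π) ⇔ InFbar k (proj₁ (ζ π)))
proposition3p3 n k n≥1 k≥1 = ζ𝓕 n , ζ𝓕-injective n , ζ𝓕-surjective n , ζ𝓕-ap n , ζ𝓕-bar n n≥1
  where open Bijection k k≥1
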